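{- Let $G\in\mathcal{C}$. Let $\Sigma$ be a pyramid in $G$ with apex $a$, base $b_1b_2b_3$ and paths $P_1,P_2,P_3$, and assume $N_G(a)\subseteq V(\Sigma)$. Let $P$ be a path in $G\setminus V(\Sigma)$. Then one of the following holds: (1) $N_\Sigma(P)$ is local in $\Sigma$; (2) $P$ contains a major vertex for $\Sigma$; (3) $P$ contains (as a subpath) a corner path for $\Sigma$; (4) there exist distinct $i,j\in\{1,2,3\}$ and a subpath $Q=q_1\hbox{ - }\cdots\hbox{ - }q_m$ of $P$ such that $N_\Sigma(q_1)\subseteq V(P_i)$; $q_1$ has a unique neighbour in $P_i$ and $N_{P_i}(q_1)=N_{P_i}(a)$; $N_\Sigma(q_m)\subseteq V(P_j)$; $q_m$ has exactly two neighbours $x,y$ in $P_j$, $x$ is adjacent to $y$, and $a\notin\{x,y\}$; and there are no other edges between $\Sigma$ and $Q$ (in particular, $a$ is contained in the cross-edge of an extended prism); (5) there exist $i\in\{1,2,3\}$ and a subpath $Q$ of $P$ such that, after renaming the indices so that $b_i$ plays the role of $b_2$, $(\Sigma,Q)$ is a loaded pyramid with loaded pyramid corner $b_i$.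
   Context: Graphs are finite and simple; "path" means induced path; for a path $P$ with ends $u,v$, $P^*=V(P)\setminus\{u,v\}$. A hole is an induced cycle of length at least $4$. For $X\subseteq V(G)$, $N(X)$ is the set of vertices outside $X$ with a neighbour in $X$; for an induced subgraph $H$, $N_H(X)=N(X)\cap V(H)$. Complete/anticomplete: all/no edges between two sets. A theta consists of two vertices and three paths between them of length at least $2$ with pairwise disjoint, anticomplete interiors. A near-prism consists of triangles $\{a_1,a_2,a_3\}$, $\{b_1,b_2,b_3\}$ and paths $P_i$ from $a_i$ to $b_i$ with $P_i\cup P_j$ a hole for $i\ne j$; a prism is a near-prism with disjoint triangles. An extended prism is obtained from a prism with paths $P_1,P_2,P_3$ by adding one edge $uv$ with $u\in P_1^*,v\in P_2^*$ (the cross-edge). A wheel $(H,x)$ is a hole $H$ plus a vertex $x$ with at least three neighbours in $H$; it is even if $x$ has an even number of neighbours in $H$. $\mathcal{C}$ is the class of graphs with no induced $C_4$, theta, prism or even wheel. A pyramid consists of a vertex $a$ (apex), a triangle $\{b_1,b_2,b_3\}$ (base) and paths $P_i$ from $a$ to $b_i$ with $P_i\cup P_j$ a hole for $i\ne j$. $X\subseteq V(\Sigma)$ is local if $X\subseteq V(P_i)$ for some $i$ or $X\subseteq\{b_1,b_2,b_3\}$. A path $R=r_1\hbox{ - }\cdots\hbox{ - }r_k$ disjoint from $\Sigma$ is a corner path for $b_1$ if $r_1$ is adjacent to $b_2,b_3$, $r_k$ has a neighbour in $P_1\setminus b_1$, and there are no other edges from $V(\Sigma)\setminus\{b_1\}$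 to $R$ (similarly for $b_2,b_3$); a corner path for $\Sigma$ is one for some $b_i$. A vertex $v\notin V(\Sigma)$ is major for $\Sigma$ if the one-vertex path $v$ is not a corner path for $\Sigma$ and $N_\Sigma(v)$ is not local. A loaded pyramid is a pair $(\Sigma,P)$ where $\Sigma$ is a pyramid with apex $a$, base $b_1b_2b_3$, paths $P_1,P_2,P_3$, $a$ adjacent to $b_2$, and $P=p_1\hbox{ - }\cdots\hbox{ - }p_k$ is a path disjoint from $\Sigma$ with $p_1$ adjacent to $b_2$, $p_k$ having a neighbour in $P_1^*$, $P_3$ anticomplete to $P$, $b_2$ anticomplete to $P\setminus p_1$, and $P_1\setminus b_1$ anticomplete to $P\setminus p_k$; $b_2$ is its loaded pyramid corner. -}

module Defs where

open import Data.Nat using (ℕ; zero; suc; _≤_)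
open import Data.Nat.Divisibility using (_∣_)
open import Data.Fin using (Fin; toℕ)
open import Data.List using (List; []; _∷_; length; lookup; filter; head; last; reverse)
open import Data.List.Membership.Propositional using (_∈_; _∉_)
open import Data.List.Relation.Binary.Infix.Heterogeneous using (Infix)
open import Data.Maybe using (just)
open import Data.Product using (Σ; ∃; ∃-syntax; _×_; _,_)
open import Data.Sum using (_⊎_)
open import Function.Bundles using (_⇔_)
open import Relation.Binary.Core using (Rel)
open import Relation.Binary.Definitions using (Decidable)
open import Relation.Binary.PropositionalEquality using (_≡_; _≢_)
open import Relation.Nullary using (¬_)

record Graph : Set₁ where
  field
    n        : ℕ
    E        : Fin n → Fin n → Set
    E?       : Decidable E
    E-sym    : ∀ {u v} → E u v → E v u
    E-irrefl : ∀ {v} → ¬ E v v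

module _ (G : Graph) where
  open Graph G

  Vtx : Set
  Vtx = Fin n

  Distinct : List Vtx → Set
  Distinct xs = ∀ i j → lookup xs i ≡ lookup xs j → i ≡ j

  -- induced path (nonempty), listed in order
  IsPath : List Vtx → Set
  IsPath xs = 1 ≤ length xs × Distinct xs
    × (∀ i j → E (lookup xs i) (lookup xs j) ⇔ (suc (toℕ i) ≡ toℕ j ⊎ suc (toℕ j) ≡ toℕ i))

  EndsAt : List Vtx → Vtx → Vtx → Set
  EndsAt xs u v = head xs ≡ just u × last xs ≡ just v

  PathFromTo : Vtx → Vtx → List Vtx → Set
  PathFromTo u v xs = IsPath xs × EndsAt xs u v

  Interior : Vtx → Vtx → List Vtx → Vtx → Set
  Interior u v xs x = x ∈ xs × x ≢ u × x ≢ v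

  CycAdj : ℕ → ℕ → ℕ → Set
  CycAdj len i j = suc i ≡ j ⊎ (i ≡ 0 × suc j ≡ len)

  IsHole : List Vtx → Set
  IsHole hs = 4 ≤ length hs × Distinct hs
    × (∀ i j → E (lookup hs i) (lookup hs j)
                 ⇔ (CycAdj (length hs) (toℕ i) (toℕ j) ⊎ CycAdj (length hs) (toℕ j) (toℕ i)))

  IsHoleSet : (Vtx → Set) → Set
  IsHoleSet S = Σ (List Vtx) λ hs → IsHole hs × (∀ v → (v ∈ hs ⇔ S v))

  Triangle : (Fin 3 → Vtx) → Set
  Triangle t = ∀ i j → i ≢ j → t i ≢ t j × E (t i) (t j)

  HasC4 : Set
  HasC4 = Σ (List Vtx) λ hs → IsHole hs × length hs ≡ 4

  HasTheta : Set
  HasTheta = Σ Vtx λ u → Σ Vtx λ v → Σ (Fin 3 → List Vtx) λ P →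
    (∀ i → PathFromTo u v (P i) × 3 ≤ length (P i))
    × (∀ i j → i ≢ j → ∀ x y → Interior u v (P i) x → Interior u v (P j) y → x ≢ y × ¬ E x y)

  HasPrism : Set
  HasPrism = Σ (Fin 3 → Vtx) λ a → Σ (Fin 3 → Vtx) λ b → Σ (Fin 3 → List Vtx) λ P →
    Triangle a × Triangle b × (∀ i j → a i ≢ b j)
    × (∀ i → PathFromTo (a i) (b i) (P i))
    × (∀ i j → i ≢ j → IsHoleSet (λ v → v ∈ P i ⊎ v ∈ P j))

  degIn : Vtx → List Vtx → ℕ
  degIn x hs = length (filter (E? x) hs)

  HasEvenWheel : Set
  HasEvenWheel = Σ (List Vtx) λ hs → Σ Vtx λ x →
    IsHole hs × x ∉ hs × 3 ≤ degIn x hs × 2 ∣ degIn x hs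

  InC : Set
  InC = ¬ HasC4 × ¬ HasTheta × ¬ HasPrism × ¬ HasEvenWheel

  record Pyramid : Set where
    field
      apex  : Vtx
      base  : Fin 3 → Vtx
      path  : Fin 3 → List Vtx
      base-triangle : Triangle base
      paths : ∀ i → PathFromTo apex (base i) (path i)
      holes : ∀ i j → i ≢ j → IsHoleSet (λ v → v ∈ path i ⊎ v ∈ path j)

  Subpath : List Vtx → List Vtx → Set
  Subpath Q P = Infix _≡_ Q P ⊎ Infix _≡_ (reverse Q) P

  module _ (Py : Pyramid) where
    open Pyramid Py

    InΣ : Vtx → Set
    InΣ v = ∃[ i ] v ∈ path i

    NΣ : (Vtx → Set) → Vtx → Set
    NΣ X v = InΣ v × ¬ X v × ∃[ x ] (X x × E v x)

    Local : (Vtx → Set) → Set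
    Local X = (∃[ i ] (∀ v → X v → v ∈ path i)) ⊎ (∀ v → X v → ∃[ i ] v ≡ base i)

    CornerPathFor : Fin 3 → List Vtx → Set
    CornerPathFor i R = IsPath R × (∀ r → r ∈ R → ¬ InΣ r)
      × Σ Vtx λ r₁ → Σ Vtx λ rₖ → EndsAt R r₁ rₖ
      × (∀ j → j ≢ i → E r₁ (base j))
      × (∃[ s ] (s ∈ path i × s ≢ base i × E rₖ s))
      × (∀ s r → InΣ s → s ≢ base i → r ∈ R → E s r →
           (r ≡ r₁ × ∃[ j ] (j ≢ i × s ≡ base j)) ⊎ (r ≡ rₖ × s ∈ path i))

    CornerPath : List Vtx → Set
    CornerPath R = ∃[ i ] CornerPathFor i R

    Major : Vtx → Set
    Major v = ¬ InΣ v × ¬ CornerPath (v ∷ []) × ¬ Local (NΣ (_≡ v))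

    -- (Σ, Q) is a loaded pyramid after renaming so that b_j, b_i, b_k play the
    -- roles of b_1, b_2, b_3 (so b_i is the loaded pyramid corner)
    LoadedWith : Fin 3 → Fin 3 → Fin 3 → List Vtx → Set
    LoadedWith j i k Q = E apex (base i) × IsPath Q × (∀ q → q ∈ Q → ¬ InΣ q)
      × Σ Vtx λ p₁ → Σ Vtx λ pₖ → EndsAt Q p₁ pₖ
      × E p₁ (base i)
      × (∃[ s ] (Interior apex (base j) (path j) s × E pₖ s))
      × (∀ s q → s ∈ path k → q ∈ Q → ¬ E s q)
      × (∀ q → q ∈ Q → q ≢ p₁ → ¬ E (base i) q)
      × (∀ s q → s ∈ path j → s ≢ base j → q ∈ Q → q ≢ pₖ → ¬ E s q)

    Outcome4 : List Vtx → Set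
    Outcome4 P = Σ (Fin 3) λ i → Σ (Fin 3) λ j → i ≢ j ×
      Σ (List Vtx) λ Q → Σ Vtx λ q₁ → Σ Vtx λ qₘ → Subpath Q P × EndsAt Q q₁ qₘ
      × (∀ s → NΣ (_≡ q₁) s → s ∈ path i)
      × (∃[ u ] (u ∈ path i × E q₁ u × (∀ w → w ∈ path i → E q₁ w → w ≡ u)))
      × (∀ w → w ∈ path i → (E q₁ w ⇔ E apex w))
      × (∀ s → NΣ (_≡ qₘ) s → s ∈ path j)
      × Σ Vtx λ x → Σ Vtx λ y → x ≢ y × x ∈ path j × y ∈ path j
      × E qₘ x × E qₘ y × (∀ w → w ∈ path j → E qₘ w → w ≡ x ⊎ w ≡ y)
      × E x y × x ≢ apex × y ≢ apex
      × (∀ s q → InΣ s → q ∈ Q → E s q →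
           (q ≡ q₁ × s ∈ path i) ⊎ (q ≡ qₘ × (s ≡ x ⊎ s ≡ y)))

    Outcome5 : List Vtx → Set
    Outcome5 P = Σ (Fin 3) λ i → Σ (Fin 3) λ j → Σ (Fin 3) λ k →
      i ≢ j × j ≢ k × i ≢ k ×
      Σ (List Vtx) λ Q → Subpath Q P × LoadedWith j i k Q

-- Choose a minimal subpath Q = q₁ … qₘ of P whose neighbourhood in Σ is not local; then the
-- neighbourhoods of Q⁻ = Q ∖ qₘ and Q⁺ = Q ∖ q₁ are local, i.e. contained in some path Pᵢ or in the
-- base.  If m = 1 the vertex q₁ is major or a corner path.  If both Q⁻ and Q⁺ attach to paths, they
-- attach to different paths Pᵢ, Pⱼ, and only q₁ (on Pᵢ) and qₘ (on Pⱼ) have neighbours in Σ.  Joining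
-- Q to arcs of Σ through the apex a and through the base then yields a theta, a prism or an even wheel,
-- unless q₁ sees only the neighbour of a on Pᵢ and qₘ sees exactly an edge of Pⱼ: outcome (4).  If Q⁺
-- attaches to the base, some b j sees qₘ and no other vertex of Q; then Q is a corner path, or a is
-- adjacent to b j and (Σ, Q) is a loaded pyramid, or else Pⱼ, Pₖ + b k b j and a path running from a
-- along Pᵢ into Q and on to b j form a theta.  Throughout, a sees no vertex of P, as N(a) ⊆ Σ.

module Submission where

open import Defs
open import Data.Nat using (ℕ; zero; suc; _≤_; z≤n; s≤s; _+_)
open import Data.Nat.Properties using (+-comm; suc-injective; ≤-trans; m≤n+m)
open import Data.Nat.Divisibility using (_∣_; divides)
open import Data.Fin using (Fin; toℕ; zero; suc) renaming (_≟_ to _≟F_)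
open import Data.Fin.Patterns using (0F; 1F; 2F)
open import Data.Fin.Properties using (all?; any?; ¬∀⟶∃¬; 0≢1+n) renaming (suc-injective to Fin-suc-injective)
open import Data.List using (List; []; _∷_; length; lookup; head; last; reverse; _++_; [_]; drop)
open import Data.List.Properties using (++-assoc; unfold-reverse; reverse-++; reverse-involutive; length-++; length-reverse)
open import Data.List.Membership.Propositional using (_∈_; _∉_)
import Data.List.Membership.Propositional as Membership
open import Data.List.Membership.Propositional.Properties using (∈-++⁺ˡ; ∈-++⁺ʳ; ∈-++⁻; ∈-∃++; ∈-lookup)
open import Data.List.Relation.Unary.Any using (Any; here; there)
import Data.List.Relation.Unary.Any as Any
open import Data.List.Relation.Unary.Any.Properties using () renaming (reverse⁺ to ∈-reverse⁺; reverse⁻ to ∈-reverse⁻)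
open import Data.List.Relation.Binary.Infix.Heterogeneous using (Infix; here; there)
open import Data.List.Relation.Binary.Prefix.Heterogeneous using (Prefix; []; _∷_)
open import Data.Maybe using (Maybe; just)
open import Data.Maybe.Properties using (just-injective)
open import Data.Product using (Σ; ∃; ∃-syntax; _×_; _,_; proj₁; proj₂)
open import Data.Sum using (_⊎_; inj₁; inj₂; swap; [_,_]′) renaming (map to ⊎-map)
open import Data.Empty using (⊥; ⊥-elim)
open import Data.Unit using (⊤; tt)
open import Function.Base using (case_of_)
open import Function.Bundles using (_⇔_; mk⇔; Equivalence)
open import Function.Construct.Composition using () renaming (equivalence to ⇔-trans)
open import Function.Construct.Symmetry using (⇔-sym)
open import Relation.Nullary using (¬_; Dec; yes; no; _×-dec_; _⊎-dec_; _→-dec_; ¬?)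
import Relation.Nullary.Decidable as Dec
open import Relation.Binary.PropositionalEquality using (module ≡-Reasoning; _≡_; _≢_; refl; sym; trans; cong; cong₂; subst; subst₂; ≢-sym)

module _ {A : Set} where

  ∈-tail : ∀ {z y : A} {ys} → z ∈ y ∷ ys → z ≢ y → z ∈ ys
  ∈-tail (here z≡y) z≢y = ⊥-elim (z≢y z≡y)
  ∈-tail (there z∈ys) _ = z∈ys

  head⇒≡∷ : ∀ {x : A} xs → head xs ≡ just x → xs ≡ x ∷ drop 1 xs
  head⇒≡∷ (x ∷ xs) refl = refl

  last-++ : ∀ (xs : List A) y ys → last (xs ++ y ∷ ys) ≡ last (y ∷ ys)
  last-++ [] y ys = refl
  last-++ (x ∷ []) y ys = refl
  last-++ (x ∷ x′ ∷ xs) y ys = last-++ (x′ ∷ xs) y ys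

  last-++-nonempty : ∀ (xs ys : List A) → (∃ λ y → y ∈ ys) → last (xs ++ ys) ≡ last ys
  last-++-nonempty xs (y ∷ ys) _ = last-++ xs y ys

  last-∷ʳ : ∀ (xs : List A) y → last (xs ++ [ y ]) ≡ just y
  last-∷ʳ xs y = last-++ xs y []

  last-reverse : ∀ (xs : List A) → last (reverse xs) ≡ head xs
  last-reverse [] = refl
  last-reverse (x ∷ xs) = trans (cong last (unfold-reverse x xs)) (last-∷ʳ (reverse xs) x)

  head-reverse : ∀ (xs : List A) → head (reverse xs) ≡ last xs
  head-reverse xs = trans (sym (last-reverse (reverse xs))) (cong last (reverse-involutive xs))

  last-exists : ∀ (x : A) xs → Σ A λ l → last (x ∷ xs) ≡ just l
  last-exists x [] = x , refl
  last-exists x (y ∷ ys) = last-exists y ys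

  last-∈ : ∀ {u : A} xs → last xs ≡ just u → u ∈ xs
  last-∈ (x ∷ []) refl = here refl
  last-∈ (x ∷ y ∷ xs) e = there (last-∈ (y ∷ xs) e)

  at-most-two : ∀ (m₁ m₂ : Maybe A) {u₁ u₂ u₃} → (m₁ ≡ just u₁ ⊎ m₂ ≡ just u₁) → (m₁ ≡ just u₂ ⊎ m₂ ≡ just u₂)
    → (m₁ ≡ just u₃ ⊎ m₂ ≡ just u₃) → u₁ ≢ u₂ → u₁ ≢ u₃ → u₂ ≢ u₃ → ⊥
  at-most-two _ _ (inj₁ a) (inj₁ b) _ n₁₂ _ _ = n₁₂ (just-injective (trans (sym a) b))
  at-most-two _ _ (inj₂ a) (inj₂ b) _ n₁₂ _ _ = n₁₂ (just-injective (trans (sym a) b))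
  at-most-two _ _ (inj₁ a) _ (inj₁ c) _ n₁₃ _ = n₁₃ (just-injective (trans (sym a) c))
  at-most-two _ _ (inj₂ a) _ (inj₂ c) _ n₁₃ _ = n₁₃ (just-injective (trans (sym a) c))
  at-most-two _ _ _ (inj₁ b) (inj₁ c) _ _ n₂₃ = n₂₃ (just-injective (trans (sym b) c))
  at-most-two _ _ _ (inj₂ b) (inj₂ c) _ _ n₂₃ = n₂₃ (just-injective (trans (sym b) c))

  init-of-suffix : ∀ (xs ys zs : List A) z → xs ++ ys ≡ zs ++ [ z ] → (∃ λ y → y ∈ ys)
    → Σ (List A) λ ys⁻ → ys ≡ ys⁻ ++ [ z ] × (∀ v → v ∈ ys⁻ → v ∈ zs)
  init-of-suffix [] ys zs z e _ = zs , e , λ v v∈ → v∈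
  init-of-suffix (x ∷ xs) ys [] z e (y , y∈) with subst (y ∈_) (cong (drop 1) e) (∈-++⁺ʳ xs y∈)
  ... | ()
  init-of-suffix (x ∷ xs) ys (w ∷ zs) z e ne with init-of-suffix xs ys zs z (cong (drop 1) e) ne
  ... | ys⁻ , e′ , ⊆zs = ys⁻ , e′ , λ v v∈ → there (⊆zs v v∈)

  infix-++ : ∀ (xs ys zs : List A) → Infix _≡_ ys (xs ++ ys ++ zs)
  infix-++ [] ys zs = here (prefix ys)
    where
    prefix : ∀ ys → Prefix _≡_ ys (ys ++ zs)
    prefix [] = []
    prefix (y ∷ ys) = refl ∷ prefix ys
  infix-++ (x ∷ xs) ys zs = there (infix-++ xs ys zs)

  module _ {p : A → Set} (p? : ∀ x → Dec (p x)) where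

    any-∈? : ∀ xs → Dec (∃ λ u → u ∈ xs × p u)
    any-∈? xs = Dec.map′ Membership.find (λ (u , u∈ , pu) → Membership.lose u∈ pu) (Any.any? p? xs)

    first-satisfying : ∀ xs → (∃ λ u → u ∈ xs × p u)
      → Σ (List A) λ pre → Σ A λ u → Σ (List A) λ post → xs ≡ pre ++ u ∷ post × p u × (∀ z → z ∈ pre → ¬ p z)
    first-satisfying (x ∷ xs) w with p? x
    ... | yes px = [] , x , xs , refl , px , λ z ()
    first-satisfying (x ∷ xs) (u , here refl , pu) | no ¬px = ⊥-elim (¬px pu)
    first-satisfying (x ∷ xs) (u , there u∈ , pu) | no ¬px with first-satisfying xs (u , u∈ , pu)
    ... | pre , v , post , refl , pv , none = x ∷ pre , v , post , refl , pv ,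
          λ { z (here refl) pz → ¬px pz ; z (there z∈) pz → none z z∈ pz }

    last-satisfying : ∀ xs → (∃ λ u → u ∈ xs × p u)
      → Σ (List A) λ pre → Σ A λ u → Σ (List A) λ post → xs ≡ pre ++ u ∷ post × p u × (∀ z → z ∈ post → ¬ p z)
    last-satisfying (x ∷ xs) (u , u∈ , pu) with any-∈? xs
    ... | yes w with last-satisfying xs w
    ...   | pre , v , post , refl , pv , none = x ∷ pre , v , post , refl , pv , none
    last-satisfying (x ∷ xs) (u , here refl , pu) | no ¬w = [] , x , xs , refl , pu , λ z z∈ pz → ¬w (z , z∈ , pz)
    last-satisfying (x ∷ xs) (u , there u∈ , pu) | no ¬w = ⊥-elim (¬w (u , u∈ , pu))

¬→⇒×¬ : ∀ {A B : Set} → Dec A → ¬ (A → B) → A × ¬ B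
¬→⇒×¬ (yes a) ¬a→b = a , λ b → ¬a→b (λ _ → b)
¬→⇒×¬ (no ¬a) ¬a→b = ⊥-elim (¬a→b (λ a → ⊥-elim (¬a a)))

third : (i j : Fin 3) → i ≢ j → Σ (Fin 3) λ k → k ≢ i × k ≢ j
third 0F 0F i≢j = ⊥-elim (i≢j refl)
third 0F 1F _ = 2F , (λ ()) , λ ()
third 0F 2F _ = 1F , (λ ()) , λ ()
third 1F 0F _ = 2F , (λ ()) , λ ()
third 1F 1F i≢j = ⊥-elim (i≢j refl)
third 1F 2F _ = 0F , (λ ()) , λ ()
third 2F 0F _ = 1F , (λ ()) , λ ()
third 2F 1F _ = 0F , (λ ()) , λ ()
third 2F 2F i≢j = ⊥-elim (i≢j refl)

module Third (i j : Fin 3) (i≢j : i ≢ j) where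
  k : Fin 3
  k = proj₁ (third i j i≢j)
  k≢i : k ≢ i
  k≢i = proj₁ (proj₂ (third i j i≢j))
  k≢j : k ≢ j
  k≢j = proj₂ (proj₂ (third i j i≢j))

third-unique : ∀ (i j : Fin 3) (i≢j : i ≢ j) l → l ≢ i → l ≢ j → l ≡ proj₁ (third i j i≢j)
third-unique 0F 1F _ 2F _ _ = refl
third-unique 0F 2F _ 1F _ _ = refl
third-unique 1F 0F _ 2F _ _ = refl
third-unique 1F 2F _ 0F _ _ = refl
third-unique 2F 0F _ 1F _ _ = refl
third-unique 2F 1F _ 0F _ _ = refl
third-unique 0F _ _ 0F l≢i _ = ⊥-elim (l≢i refl)
third-unique 1F _ _ 1F l≢i _ = ⊥-elim (l≢i refl)
third-unique 2F _ _ 2F l≢i _ = ⊥-elim (l≢i refl)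
third-unique _ 0F _ 0F _ l≢j = ⊥-elim (l≢j refl)
third-unique _ 1F _ 1F _ l≢j = ⊥-elim (l≢j refl)
third-unique _ 2F _ 2F _ l≢j = ⊥-elim (l≢j refl)
third-unique 0F 0F i≢j _ _ _ = ⊥-elim (i≢j refl)
third-unique 1F 1F i≢j _ _ _ = ⊥-elim (i≢j refl)
third-unique 2F 2F i≢j _ _ _ = ⊥-elim (i≢j refl)

other : Fin 3 → Fin 3
other 0F = 1F
other (suc _) = 0F

other≢ : ∀ i → other i ≢ i
other≢ 0F ()
other≢ (suc i) ()

pairwise : {R : Fin 3 → Fin 3 → Set} → (∀ {i j} → R i j → R j i)
  → R 0F 1F → R 0F 2F → R 1F 2F → ∀ i j → i ≢ j → R i j
pairwise sym′ r₀₁ r₀₂ r₁₂ 0F 1F _ = r₀₁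
pairwise sym′ r₀₁ r₀₂ r₁₂ 0F 2F _ = r₀₂
pairwise sym′ r₀₁ r₀₂ r₁₂ 1F 2F _ = r₁₂
pairwise sym′ r₀₁ r₀₂ r₁₂ 1F 0F _ = sym′ r₀₁
pairwise sym′ r₀₁ r₀₂ r₁₂ 2F 0F _ = sym′ r₀₂
pairwise sym′ r₀₁ r₀₂ r₁₂ 2F 1F _ = sym′ r₁₂
pairwise _ _ _ _ 0F 0F i≢i = ⊥-elim (i≢i refl)
pairwise _ _ _ _ 1F 1F i≢i = ⊥-elim (i≢i refl)
pairwise _ _ _ _ 2F 2F i≢i = ⊥-elim (i≢i refl)

module InducedPaths (G : Graph) where
  open Graph G public

  V : Set
  V = Vtx G

  E⇒≢ : ∀ {u v} → E u v → u ≢ v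
  E⇒≢ e refl = E-irrefl e

  AdjHead : V → List V → Set
  AdjHead x [] = ⊤
  AdjHead x (y ∷ _) = E x y

  -- Recursive counterpart of IsPath (see isPath⇒induced and induced⇒isPath).
  Induced : List V → Set
  Induced [] = ⊤
  Induced (x ∷ ys) = (∀ z → z ∈ ys → x ≢ z × (E x z → head ys ≡ just z)) × AdjHead x ys × Induced ys

  Abutting : List V → List V → Set
  Abutting xs ys = ∀ u v → u ∈ xs → v ∈ ys → u ≢ v × (E u v → last xs ≡ just u × head ys ≡ just v)

  EndsAdjacent : List V → List V → Set
  EndsAdjacent xs ys = ∀ u v → last xs ≡ just u → head ys ≡ just v → E u v

  induced-[_] : ∀ x → Induced [ x ]
  induced-[ x ] = (λ z ()) , tt , tt

  induced-head∉ : ∀ {x ys} → Induced (x ∷ ys) → x ∉ ys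
  induced-head∉ (fresh , _ , _) z∈ = proj₁ (fresh _ z∈) refl

  induced-last≢head : ∀ x ys → Induced (x ∷ ys) → (∃[ y ] (y ∈ ys)) → last (x ∷ ys) ≢ just x
  induced-last≢head x (y ∷ ys) ip _ e = induced-head∉ ip (last-∈ (y ∷ ys) e)

  induced-++⁺ : ∀ xs ys → Induced xs → Induced ys → Abutting xs ys → EndsAdjacent xs ys → Induced (xs ++ ys)
  induced-++⁺ [] ys _ ipy _ _ = ipy
  induced-++⁺ (x ∷ []) [] _ _ _ _ = induced-[ x ]
  induced-++⁺ (x ∷ []) (y ∷ ys) _ ipy ab ends =
    (λ z z∈ → proj₁ (ab x z (here refl) z∈) , λ exz → proj₂ (proj₂ (ab x z (here refl) z∈) exz)) , ends x y refl refl , ipy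
  induced-++⁺ (x ∷ w ∷ ws) ys ipx@(fresh , adj , ipw) ipy ab ends = fresh′ , adj , induced-++⁺ (w ∷ ws) ys ipw ipy ab′ ends
    where
    ab′ : Abutting (w ∷ ws) ys
    ab′ u v u∈ v∈ = ab u v (there u∈) v∈
    fresh′ : ∀ z → z ∈ (w ∷ ws) ++ ys → x ≢ z × (E x z → just w ≡ just z)
    fresh′ z z∈ with ∈-++⁻ (w ∷ ws) z∈
    ... | inj₁ z∈xs = fresh z z∈xs
    ... | inj₂ z∈ys = proj₁ (ab x z (here refl) z∈ys) ,
          λ exz → ⊥-elim (induced-head∉ ipx (last-∈ (w ∷ ws) (proj₁ (proj₂ (ab x z (here refl) z∈ys) exz))))

  induced-++⁻ : ∀ xs ys → Induced (xs ++ ys) → Induced xs × Induced ys × Abutting xs ys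
  induced-++⁻ [] ys ip = tt , ip , λ u v ()
  induced-++⁻ (x ∷ []) ys (fresh , _ , ipy) = induced-[ x ] , ipy , ab
    where
    ab : Abutting (x ∷ []) ys
    ab u v (here refl) v∈ = proj₁ (fresh v v∈) , λ e → refl , proj₂ (fresh v v∈) e
  induced-++⁻ (x ∷ w ∷ ws) ys (fresh , adj , ip′) with induced-++⁻ (w ∷ ws) ys ip′
  ... | ipx′ , ipy , ab′ = ((λ z z∈ → fresh z (∈-++⁺ˡ z∈)) , adj , ipx′) , ipy , ab
    where
    ab : Abutting (x ∷ w ∷ ws) ys
    ab u v (here refl) v∈ = proj₁ (fresh v (∈-++⁺ʳ (w ∷ ws) v∈)) ,
      λ e → ⊥-elim (proj₁ (ab′ w v (here refl) v∈) (just-injective (proj₂ (fresh v (∈-++⁺ʳ (w ∷ ws) v∈)) e)))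
    ab u v (there u∈) v∈ = ab′ u v u∈ v∈

  induced-++⇒endsAdjacent : ∀ xs ys → Induced (xs ++ ys) → EndsAdjacent xs ys
  induced-++⇒endsAdjacent (x ∷ []) (y ∷ ys) (_ , adj , _) .x .y refl refl = adj
  induced-++⇒endsAdjacent (x ∷ w ∷ ws) ys (_ , _ , ip) = induced-++⇒endsAdjacent (w ∷ ws) ys ip

  induced-reverse : ∀ xs → Induced xs → Induced (reverse xs)
  induced-reverse [] _ = tt
  induced-reverse (x ∷ xs) (fresh , adj , ip) =
    subst Induced (sym (unfold-reverse x xs)) (induced-++⁺ (reverse xs) [ x ] (induced-reverse xs ip) induced-[ x ] ab ends)
    where
    ab : Abutting (reverse xs) [ x ]
    ab u v u∈ (here refl) = (λ e → proj₁ (fresh u (∈-reverse⁻ u∈)) (sym e)) ,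
      λ e → trans (last-reverse xs) (proj₂ (fresh u (∈-reverse⁻ u∈)) (E-sym e)) , refl
    adj⇒ : ∀ xs u → AdjHead x xs → head xs ≡ just u → E u x
    adj⇒ (y ∷ ys) u e refl = E-sym e
    ends : EndsAdjacent (reverse xs) [ x ]
    ends u v e refl = adj⇒ xs u adj (trans (sym (last-reverse xs)) e)

  induced-neighbour : ∀ pre w post z → Induced (pre ++ w ∷ post) → z ∈ pre ++ w ∷ post → E w z
    → last pre ≡ just z ⊎ head post ≡ just z
  induced-neighbour pre w post z ip z∈ e with induced-++⁻ pre (w ∷ post) ip
  ... | _ , (fresh , _ , _) , ab with ∈-++⁻ pre z∈
  ... | inj₁ z∈pre = inj₁ (proj₁ (proj₂ (ab z w z∈pre (here refl)) (E-sym e)))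
  ... | inj₂ (here refl) = ⊥-elim (E-irrefl e)
  ... | inj₂ (there z∈post) = inj₂ (proj₂ (fresh z z∈post) e)

  induced-inner-neighbours : ∀ pre u r post l → Induced (pre ++ u ∷ r ∷ post) → last pre ≡ just l →
    E u l × E u r × l ≢ r × l ∈ pre ++ u ∷ r ∷ post × r ∈ pre ++ u ∷ r ∷ post
  induced-inner-neighbours pre u r post l ip el with induced-++⁻ pre (u ∷ r ∷ post) ip
  ... | _ , (_ , adj , _) , ab =
    E-sym (induced-++⇒endsAdjacent pre (u ∷ r ∷ post) ip l u el refl) , adj ,
    proj₁ (ab l r (last-∈ pre el) (there (here refl))) , ∈-++⁺ˡ (last-∈ pre el) , ∈-++⁺ʳ pre (there (here refl))

  Consecutive : ℕ → ℕ → Set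
  Consecutive m k = suc m ≡ k ⊎ suc k ≡ m

  consecutive-suc : ∀ m k → Consecutive (suc m) (suc k) ⇔ Consecutive m k
  consecutive-suc m k = mk⇔ (⊎-map suc-injective suc-injective) (⊎-map (cong suc) (cong suc))

  IndexAdjacency : List V → Set
  IndexAdjacency xs = ∀ i j → E (lookup xs i) (lookup xs j) ⇔ Consecutive (toℕ i) (toℕ j)

  ∈⇒index : ∀ {z} (xs : List V) → z ∈ xs → Σ (Fin (length xs)) λ k → lookup xs k ≡ z
  ∈⇒index (x ∷ xs) (here refl) = zero , refl
  ∈⇒index (x ∷ xs) (there p) with ∈⇒index xs p
  ... | k , e = suc k , e

  head≡lookup⇒zero : ∀ ys (j : Fin (length ys)) → Distinct G ys → head ys ≡ just (lookup ys j) → toℕ j ≡ 0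
  head≡lookup⇒zero (y ∷ ys) j d e = cong toℕ (sym (d zero j (just-injective e)))

  induced⇒distinct : ∀ xs → Induced xs → Distinct G xs
  induced⇒distinct (x ∷ ys) ip zero zero e = refl
  induced⇒distinct (x ∷ ys) ip zero (suc j) e = ⊥-elim (induced-head∉ ip (subst (_∈ ys) (sym e) (∈-lookup j)))
  induced⇒distinct (x ∷ ys) ip (suc i) zero e = ⊥-elim (induced-head∉ ip (subst (_∈ ys) e (∈-lookup i)))
  induced⇒distinct (x ∷ ys) (_ , _ , ip) (suc i) (suc j) e = cong suc (induced⇒distinct ys ip i j e)

  induced⇒indexAdjacency : ∀ xs → Induced xs → IndexAdjacency xs
  induced⇒indexAdjacency (x ∷ ys) ip zero zero = mk⇔ (λ e → ⊥-elim (E-irrefl e)) λ { (inj₁ ()) ; (inj₂ ()) }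
  induced⇒indexAdjacency (x ∷ ys) (fresh , adj , ip) zero (suc j) = mk⇔ to from
    where
    to : E x (lookup ys j) → Consecutive 0 (suc (toℕ j))
    to e = inj₁ (cong suc (sym (head≡lookup⇒zero ys j (induced⇒distinct ys ip) (proj₂ (fresh _ (∈-lookup j)) e))))
    from′ : ∀ ys (j : Fin (length ys)) → AdjHead x ys → Consecutive 0 (suc (toℕ j)) → E x (lookup ys j)
    from′ (y ∷ ys) zero e _ = e
    from′ (y ∷ ys) (suc j) _ (inj₁ ())
    from′ (y ∷ ys) (suc j) _ (inj₂ ())
    from : Consecutive 0 (suc (toℕ j)) → E x (lookup ys j)
    from = from′ ys j adj
  induced⇒indexAdjacency (x ∷ ys) ip (suc i) zero =
    ⇔-trans (mk⇔ E-sym E-sym) (⇔-trans (induced⇒indexAdjacency (x ∷ ys) ip zero (suc i)) (mk⇔ swap swap))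
  induced⇒indexAdjacency (x ∷ ys) (_ , _ , ip) (suc i) (suc j) =
    ⇔-trans (induced⇒indexAdjacency ys ip i j) (⇔-sym (consecutive-suc (toℕ i) (toℕ j)))

  distinct-indexAdjacency⇒induced : ∀ xs → Distinct G xs → IndexAdjacency xs → Induced xs
  distinct-indexAdjacency⇒induced [] _ _ = tt
  distinct-indexAdjacency⇒induced (x ∷ ys) d adj = fresh , adjHead ys adj , distinct-indexAdjacency⇒induced ys d′ adj′
    where
    d′ : Distinct G ys
    d′ i j e = Fin-suc-injective (d (suc i) (suc j) e)
    adj′ : IndexAdjacency ys
    adj′ i j = ⇔-trans (adj (suc i) (suc j)) (consecutive-suc (toℕ i) (toℕ j))
    index-one : ∀ (ys : List V) (k : Fin (length ys)) → Consecutive 0 (suc (toℕ k)) → head ys ≡ just (lookup ys k)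
    index-one (y ∷ ys) zero _ = refl
    index-one (y ∷ ys) (suc k) (inj₁ ())
    index-one (y ∷ ys) (suc k) (inj₂ ())
    fresh : ∀ z → z ∈ ys → x ≢ z × (E x z → head ys ≡ just z)
    fresh z z∈ with ∈⇒index ys z∈
    ... | k , refl = (λ e → 0≢1+n (d zero (suc k) e)) , λ e → index-one ys k (Equivalence.to (adj zero (suc k)) e)
    adjHead : ∀ ys → IndexAdjacency (x ∷ ys) → AdjHead x ys
    adjHead [] _ = tt
    adjHead (y ∷ ys) adj = Equivalence.from (adj zero (suc zero)) (inj₁ refl)

  isPath⇒induced : ∀ xs → IsPath G xs → Induced xs
  isPath⇒induced xs (_ , d , adj) = distinct-indexAdjacency⇒induced xs d adj

  induced⇒isPath : ∀ x xs → Induced (x ∷ xs) → IsPath G (x ∷ xs)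
  induced⇒isPath x xs ip = s≤s z≤n , induced⇒distinct (x ∷ xs) ip , induced⇒indexAdjacency (x ∷ xs) ip

module Holes (G : Graph) where
  open InducedPaths G public

  HoleAt : V → List V → Set
  HoleAt x ys = Induced ys × 3 ≤ length ys × x ∉ ys × (∀ z → z ∈ ys → E x z ⇔ (head ys ≡ just z ⊎ last ys ≡ just z))

  last-lookup : ∀ (ys : List V) (k : Fin (length ys)) → suc (toℕ k) ≡ length ys → last ys ≡ just (lookup ys k)
  last-lookup (y ∷ []) zero _ = refl
  last-lookup (y ∷ y′ ∷ ys) (suc k) e = last-lookup (y′ ∷ ys) k (suc-injective e)

  last-index : ∀ (y : V) ys → Σ (Fin (length (y ∷ ys))) λ k → suc (toℕ k) ≡ length (y ∷ ys)
  last-index y [] = zero , refl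
  last-index y (y′ ∷ ys) with last-index y′ ys
  ... | k , e = suc k , cong suc e

  last≡lookup⇒index : ∀ (ys : List V) (k : Fin (length ys)) → Distinct G ys → last ys ≡ just (lookup ys k)
    → suc (toℕ k) ≡ length ys
  last≡lookup⇒index (y ∷ ys) k d e with last-index y ys
  ... | k₀ , e₀ = subst (λ q → suc (toℕ q) ≡ length (y ∷ ys)) (d k₀ k (just-injective (trans (sym (last-lookup (y ∷ ys) k₀ e₀)) e))) e₀

  CycAdjacent : ℕ → ℕ → ℕ → Set
  CycAdjacent L m k = CycAdj G L m k ⊎ CycAdj G L k m

  cycAdjacent-zero : ∀ (ys : List V) (k : Fin (length ys)) → Distinct G ys →
    CycAdjacent (suc (length ys)) 0 (suc (toℕ k)) ⇔ (head ys ≡ just (lookup ys k) ⊎ last ys ≡ just (lookup ys k))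
  cycAdjacent-zero ys k d = mk⇔ to from
    where
    head-lookup : ∀ (ys : List V) (k : Fin (length ys)) → toℕ k ≡ 0 → head ys ≡ just (lookup ys k)
    head-lookup (y ∷ ys) zero _ = refl
    to : CycAdjacent (suc (length ys)) 0 (suc (toℕ k)) → (head ys ≡ just (lookup ys k) ⊎ last ys ≡ just (lookup ys k))
    to (inj₁ (inj₁ e)) = inj₁ (head-lookup ys k (suc-injective (sym e)))
    to (inj₁ (inj₂ (_ , e))) = inj₂ (last-lookup ys k (suc-injective e))
    to (inj₂ (inj₁ ()))
    to (inj₂ (inj₂ (() , _)))
    from : (head ys ≡ just (lookup ys k) ⊎ last ys ≡ just (lookup ys k)) → CycAdjacent (suc (length ys)) 0 (suc (toℕ k))
    from (inj₁ e) = inj₁ (inj₁ (cong suc (sym (head≡lookup⇒zero ys k d e))))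
    from (inj₂ e) = inj₁ (inj₂ (refl , cong suc (last≡lookup⇒index ys k d e)))

  cycAdjacent-suc : ∀ L m k → CycAdjacent L (suc m) (suc k) ⇔ Consecutive m k
  cycAdjacent-suc L m k = mk⇔ to from
    where
    to : CycAdjacent L (suc m) (suc k) → Consecutive m k
    to (inj₁ (inj₁ e)) = inj₁ (suc-injective e)
    to (inj₂ (inj₁ e)) = inj₂ (suc-injective e)
    from : Consecutive m k → CycAdjacent L (suc m) (suc k)
    from (inj₁ e) = inj₁ (inj₁ (cong suc e))
    from (inj₂ e) = inj₂ (inj₁ (cong suc e))

  holeAt⇒isHole : ∀ x ys → HoleAt x ys → IsHole G (x ∷ ys)
  holeAt⇒isHole x ys (ip , len≥3 , x∉ , x-adj) = s≤s len≥3 , distinct , adjacency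
    where
    dys = induced⇒distinct ys ip
    distinct : Distinct G (x ∷ ys)
    distinct zero zero e = refl
    distinct zero (suc j) e = ⊥-elim (x∉ (subst (_∈ ys) (sym e) (∈-lookup j)))
    distinct (suc i) zero e = ⊥-elim (x∉ (subst (_∈ ys) e (∈-lookup i)))
    distinct (suc i) (suc j) e = cong suc (dys i j e)
    nonempty : length ys ≢ 0
    nonempty e with subst (3 ≤_) e len≥3
    ... | ()
    adjacency : ∀ i j → E (lookup (x ∷ ys) i) (lookup (x ∷ ys) j) ⇔ CycAdjacent (length (x ∷ ys)) (toℕ i) (toℕ j)
    adjacency zero zero = mk⇔ (λ e → ⊥-elim (E-irrefl e)) λ where
      (inj₁ (inj₂ (_ , e))) → ⊥-elim (nonempty (suc-injective (sym e)))
      (inj₂ (inj₂ (_ , e))) → ⊥-elim (nonempty (suc-injective (sym e)))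
    adjacency zero (suc k) = ⇔-trans (x-adj (lookup ys k) (∈-lookup k)) (⇔-sym (cycAdjacent-zero ys k dys))
    adjacency (suc k) zero = ⇔-trans (mk⇔ E-sym E-sym) (⇔-trans (adjacency zero (suc k)) (mk⇔ swap swap))
    adjacency (suc k) (suc l) = ⇔-trans (induced⇒indexAdjacency ys ip k l) (⇔-sym (cycAdjacent-suc (suc (length ys)) (toℕ k) (toℕ l)))

  isHole⇒holeAt : ∀ hs → IsHole G hs → Σ V λ x → Σ (List V) λ ys → hs ≡ x ∷ ys × HoleAt x ys
  isHole⇒holeAt (x ∷ ys) (s≤s len≥3 , distinct , adjacency) = x , ys , refl , ip , len≥3 , x∉ , x-adj
    where
    dys : Distinct G ys
    dys i j e = Fin-suc-injective (distinct (suc i) (suc j) e)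
    ip : Induced ys
    ip = distinct-indexAdjacency⇒induced ys dys
           (λ i j → ⇔-trans (adjacency (suc i) (suc j)) (cycAdjacent-suc (suc (length ys)) (toℕ i) (toℕ j)))
    x∉ : x ∉ ys
    x∉ z∈ with ∈⇒index ys z∈
    ... | k , e = 0≢1+n (distinct zero (suc k) (sym e))
    x-adj : ∀ z → z ∈ ys → E x z ⇔ (head ys ≡ just z ⊎ last ys ≡ just z)
    x-adj z z∈ with ∈⇒index ys z∈
    ... | k , refl = ⇔-trans (adjacency zero (suc k)) (cycAdjacent-zero ys k dys)

  induced-no-triangle : ∀ ys → Induced ys → ∀ u v w → u ∈ ys → v ∈ ys → w ∈ ys → E u v → E v w → E u w → ⊥
  induced-no-triangle (y ∷ ys) (fresh , _ , ip) u v w u∈ v∈ w∈ euv evw euw with u ≟F y | v ≟F y | w ≟F y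
  ... | yes refl | _ | _ = E-irrefl (subst (E v) (sym (just-injective (trans (sym hv) hw))) evw)
    where
    hv = proj₂ (fresh v (∈-tail v∈ (λ e → E⇒≢ euv (sym e)))) euv
    hw = proj₂ (fresh w (∈-tail w∈ (λ e → E⇒≢ euw (sym e)))) euw
  ... | no _ | yes refl | _ = E-irrefl (subst (E u) (sym (just-injective (trans (sym hu) hw))) euw)
    where
    hu = proj₂ (fresh u (∈-tail u∈ (E⇒≢ euv))) (E-sym euv)
    hw = proj₂ (fresh w (∈-tail w∈ (λ e → E⇒≢ evw (sym e)))) evw
  ... | no _ | no _ | yes refl = E-irrefl (subst (E u) (sym (just-injective (trans (sym hu) hv))) euv)
    where
    hu = proj₂ (fresh u (∈-tail u∈ (E⇒≢ euw))) (E-sym euw)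
    hv = proj₂ (fresh v (∈-tail v∈ (E⇒≢ evw))) (E-sym evw)
  ... | no u≢y | no v≢y | no w≢y =
    induced-no-triangle ys ip u v w (∈-tail u∈ u≢y) (∈-tail v∈ v≢y) (∈-tail w∈ w≢y) euv evw euw

  induced-ends-nonadjacent : ∀ ys → Induced ys → 3 ≤ length ys → ∀ h l → head ys ≡ just h → last ys ≡ just l → ¬ E h l
  induced-ends-nonadjacent (h ∷ y₂ ∷ y₃ ∷ rest) (fresh , _ , (fresh₂ , _ , _)) (s≤s (s≤s (s≤s z≤n))) .h l refl el e =
    proj₁ (fresh₂ l (last-∈ (y₃ ∷ rest) el)) (just-injective (proj₂ (fresh l (last-∈ (y₂ ∷ y₃ ∷ rest) el)) e))

  holeAt-nbrs-nonadjacent : ∀ x ys → HoleAt x ys → ∀ v w → v ∈ ys → w ∈ ys → E x v → E x w → ¬ E v w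
  holeAt-nbrs-nonadjacent x ys (ip , len≥3 , _ , x-adj) v w v∈ w∈ ev ew evw
    with Equivalence.to (x-adj v v∈) ev | Equivalence.to (x-adj w w∈) ew
  ... | inj₁ a | inj₁ b = E⇒≢ evw (just-injective (trans (sym a) b))
  ... | inj₂ a | inj₂ b = E⇒≢ evw (just-injective (trans (sym a) b))
  ... | inj₁ a | inj₂ b = induced-ends-nonadjacent ys ip len≥3 v w a b evw
  ... | inj₂ a | inj₁ b = induced-ends-nonadjacent ys ip len≥3 w v b a (E-sym evw)

  holeAt-no-triangle : ∀ x ys → HoleAt x ys → ∀ u v w → u ∈ x ∷ ys → v ∈ x ∷ ys → w ∈ x ∷ ys → E u v → E v w → E u w → ⊥
  holeAt-no-triangle x ys hs@(ip , _ , _ , _) u v w u∈ v∈ w∈ euv evw euw with u ≟F x | v ≟F x | w ≟F x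
  ... | yes refl | _ | _ =
    holeAt-nbrs-nonadjacent x ys hs v w (∈-tail v∈ (λ e → E⇒≢ euv (sym e))) (∈-tail w∈ (λ e → E⇒≢ euw (sym e))) euv euw evw
  ... | no _ | yes refl | _ =
    holeAt-nbrs-nonadjacent x ys hs u w (∈-tail u∈ (E⇒≢ euv)) (∈-tail w∈ (λ e → E⇒≢ evw (sym e))) (E-sym euv) evw euw
  ... | no _ | no _ | yes refl =
    holeAt-nbrs-nonadjacent x ys hs u v (∈-tail u∈ (E⇒≢ euw)) (∈-tail v∈ (E⇒≢ evw)) (E-sym euw) (E-sym evw) euv
  ... | no u≢x | no v≢x | no w≢x =
    induced-no-triangle ys ip u v w (∈-tail u∈ u≢x) (∈-tail v∈ v≢x) (∈-tail w∈ w≢x) euv evw euw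

  -- The cyclic predecessor and successor of an entry of x ∷ pre ++ w ∷ post.
  lastOr : V → List V → Maybe V
  lastOr x [] = just x
  lastOr x (p ∷ ps) = last (p ∷ ps)

  headOr : V → List V → Maybe V
  headOr x [] = just x
  headOr x (p ∷ ps) = just p

  holeAt-neighbour : ∀ x pre w post z → HoleAt x (pre ++ w ∷ post) → z ∈ x ∷ (pre ++ w ∷ post) → E w z
    → lastOr x pre ≡ just z ⊎ headOr x post ≡ just z
  holeAt-neighbour x pre w post z (ip , _) (there z∈) e with induced-neighbour pre w post z ip z∈ e
  ... | inj₁ a = inj₁ (lastOr-∷ pre a)
    where lastOr-∷ : ∀ pre → last pre ≡ just z → lastOr x pre ≡ just z
          lastOr-∷ (_ ∷ _) a = a
  ... | inj₂ b = inj₂ (headOr-∷ post b)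
    where headOr-∷ : ∀ post → head post ≡ just z → headOr x post ≡ just z
          headOr-∷ (_ ∷ _) b = b
  holeAt-neighbour x pre w post .x (ip , _ , _ , x-adj) (here refl) e
    with Equivalence.to (x-adj w (∈-++⁺ʳ pre (here refl))) (E-sym e)
  ... | inj₁ h = inj₁ (w-first pre ip h)
    where w-first : ∀ pre → Induced (pre ++ w ∷ post) → head (pre ++ w ∷ post) ≡ just w → lastOr x pre ≡ just x
          w-first [] _ _ = refl
          w-first (p ∷ ps) ip′ h′ with induced-++⁻ (p ∷ ps) (w ∷ post) ip′
          ... | _ , _ , ab = ⊥-elim (proj₁ (ab p w (here refl) (here refl)) (just-injective h′))
  ... | inj₂ l = inj₂ (w-last post ip l)
    where w-last : ∀ post → Induced (pre ++ w ∷ post) → last (pre ++ w ∷ post) ≡ just w → headOr x post ≡ just x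
          w-last [] _ _ = refl
          w-last (q ∷ qs) ip′ l′ with induced-++⁻ pre (w ∷ q ∷ qs) ip′
          ... | _ , ipw , _ = ⊥-elim (induced-head∉ ipw (last-∈ (q ∷ qs) (trans (sym (last-++ pre w (q ∷ qs))) l′)))

  holeAt-no-claw : ∀ x ys → HoleAt x ys → ∀ w u₁ u₂ u₃ → w ∈ x ∷ ys → u₁ ∈ x ∷ ys → u₂ ∈ x ∷ ys → u₃ ∈ x ∷ ys
    → E w u₁ → E w u₂ → E w u₃ → u₁ ≢ u₂ → u₁ ≢ u₃ → u₂ ≢ u₃ → ⊥
  holeAt-no-claw x ys (_ , _ , _ , x-adj) w u₁ u₂ u₃ (here refl) u₁∈ u₂∈ u₃∈ e₁ e₂ e₃ =
    at-most-two (head ys) (last ys) (end u₁∈ e₁) (end u₂∈ e₂) (end u₃∈ e₃)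
    where
    end : ∀ {u} → u ∈ x ∷ ys → E x u → head ys ≡ just u ⊎ last ys ≡ just u
    end u∈ e = Equivalence.to (x-adj _ (∈-tail u∈ (λ q → E⇒≢ e (sym q)))) e
  holeAt-no-claw x ys hs w u₁ u₂ u₃ (there w∈) u₁∈ u₂∈ u₃∈ e₁ e₂ e₃ with ∈-∃++ w∈
  ... | pre , post , refl =
    at-most-two (lastOr x pre) (headOr x post) (nbr u₁∈ e₁) (nbr u₂∈ e₂) (nbr u₃∈ e₃)
    where
    nbr : ∀ {u} → u ∈ x ∷ (pre ++ w ∷ post) → E w u → lastOr x pre ≡ just u ⊎ headOr x post ≡ just u
    nbr = holeAt-neighbour x pre w post _ hs

  holeSet-no-triangle : ∀ (S : V → Set) → IsHoleSet G S → ∀ u v w → S u → S v → S w → E u v → E v w → E u w → ⊥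
  holeSet-no-triangle S (hs , ih , mem) u v w su sv sw with isHole⇒holeAt hs ih
  ... | x , ys , refl , hsx = holeAt-no-triangle x ys hsx u v w (Equivalence.from (mem u) su) (Equivalence.from (mem v) sv) (Equivalence.from (mem w) sw)

  holeSet-no-claw : ∀ (S : V → Set) → IsHoleSet G S → ∀ w u₁ u₂ u₃ → S w → S u₁ → S u₂ → S u₃
    → E w u₁ → E w u₂ → E w u₃ → u₁ ≢ u₂ → u₁ ≢ u₃ → u₂ ≢ u₃ → ⊥
  holeSet-no-claw S (hs , ih , mem) w u₁ u₂ u₃ sw s₁ s₂ s₃ with isHole⇒holeAt hs ih
  ... | x , ys , refl , hsx = holeAt-no-claw x ys hsx w u₁ u₂ u₃ (∈hs sw) (∈hs s₁) (∈hs s₂) (∈hs s₃)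
    where ∈hs : ∀ {v} → S v → v ∈ x ∷ ys
          ∈hs = Equivalence.from (mem _)

module Obstructions (G : Graph) where
  open Holes G public

  Anticomplete : List V → List V → Set
  Anticomplete X Y = ∀ u v → u ∈ X → v ∈ Y → u ≢ v × ¬ E u v

  ac-sym : ∀ {X Y} → Anticomplete X Y → Anticomplete Y X
  ac-sym ac u v u∈ v∈ = (λ e → proj₁ (ac v u v∈ u∈) (sym e)) , λ e → proj₂ (ac v u v∈ u∈) (E-sym e)

  ac-++ˡ : ∀ X X′ {Y} → Anticomplete X Y → Anticomplete X′ Y → Anticomplete (X ++ X′) Y
  ac-++ˡ X X′ ac ac′ u v u∈ v∈ with ∈-++⁻ X u∈
  ... | inj₁ p = ac u v p v∈
  ... | inj₂ p = ac′ u v p v∈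

  ac-++ʳ : ∀ {X} Y Y′ → Anticomplete X Y → Anticomplete X Y′ → Anticomplete X (Y ++ Y′)
  ac-++ʳ Y Y′ ac ac′ = ac-sym (ac-++ˡ Y Y′ (ac-sym ac) (ac-sym ac′))

  ac-∷ˡ : ∀ x X {Y} → Anticomplete [ x ] Y → Anticomplete X Y → Anticomplete (x ∷ X) Y
  ac-∷ˡ x X = ac-++ˡ [ x ] X

  ac-∷ʳ : ∀ {X} y Y → Anticomplete X [ y ] → Anticomplete X Y → Anticomplete X (y ∷ Y)
  ac-∷ʳ y Y = ac-++ʳ [ y ] Y

  ac-reverseˡ : ∀ X {Y} → Anticomplete X Y → Anticomplete (reverse X) Y
  ac-reverseˡ X ac u v u∈ v∈ = ac u v (∈-reverse⁻ u∈) v∈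

  ac-reverseʳ : ∀ {X} Y → Anticomplete X Y → Anticomplete X (reverse Y)
  ac-reverseʳ Y ac u v u∈ v∈ = ac u v u∈ (∈-reverse⁻ v∈)

  ac-point : ∀ {x Y} → (∀ v → v ∈ Y → x ≢ v × ¬ E x v) → Anticomplete [ x ] Y
  ac-point f u v (here refl) v∈ = f v v∈

  ac-mono : ∀ {X X′ Y Y′} → (∀ u → u ∈ X′ → u ∈ X) → (∀ v → v ∈ Y′ → v ∈ Y) → Anticomplete X Y → Anticomplete X′ Y′
  ac-mono f g ac u v u∈ v∈ = ac u v (f u u∈) (g v v∈)

  induced-gap⇒ac : ∀ A B C → (∃ λ w → w ∈ B) → Induced (A ++ B ++ C) → Anticomplete A C
  induced-gap⇒ac A (b ∷ bs) C _ ip u v u∈ v∈ with induced-++⁻ A ((b ∷ bs) ++ C) ip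
  ... | _ , ipBC , ab with induced-++⁻ (b ∷ bs) C ipBC
  ...   | _ , _ , abBC = proj₁ (ab u v u∈ (∈-++⁺ʳ (b ∷ bs) v∈)) ,
          λ e → proj₁ (abBC b v (here refl) v∈) (just-injective (proj₂ (proj₂ (ab u v u∈ (∈-++⁺ʳ (b ∷ bs) v∈)) e)))

  interior-∈ : ∀ u v L x → Interior G u v (u ∷ L ++ [ v ]) x → x ∈ L
  interior-∈ u v L x (here e , x≢u , _) = ⊥-elim (x≢u e)
  interior-∈ u v L x (there x∈ , _ , x≢v) with ∈-++⁻ L x∈
  ... | inj₁ p = p
  ... | inj₂ (here e) = ⊥-elim (x≢v e)

  ThetaArm : V → V → List V → Set
  ThetaArm u v L = Induced (u ∷ L ++ [ v ]) × (∃ λ w → w ∈ L)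

  theta : ∀ u v L₁ L₂ L₃ → ThetaArm u v L₁ → ThetaArm u v L₂ → ThetaArm u v L₃
    → Anticomplete L₁ L₂ → Anticomplete L₁ L₃ → Anticomplete L₂ L₃ → HasTheta G
  theta u v L₁ L₂ L₃ arm₁ arm₂ arm₃ ac₁₂ ac₁₃ ac₂₃ = u , v , path , isArm , interiors
    where
    L : Fin 3 → List V
    L 0F = L₁
    L 1F = L₂
    L 2F = L₃
    path : Fin 3 → List V
    path i = u ∷ L i ++ [ v ]
    arm : ∀ i → ThetaArm u v (L i)
    arm 0F = arm₁
    arm 1F = arm₂
    arm 2F = arm₃
    isArm : ∀ i → PathFromTo G u v (path i) × 3 ≤ length (path i)
    isArm i with arm i
    ... | ip , l , l∈ = (induced⇒isPath u (L i ++ [ v ]) ip , refl , last-∷ʳ (u ∷ L i) v) , long (L i) l∈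
      where long : ∀ L → l ∈ L → 3 ≤ length (u ∷ L ++ [ v ])
            long (_ ∷ L) _ = s≤s (s≤s (subst (1 ≤_) (sym (length-++ L)) (≤-trans (s≤s z≤n) (m≤n+m 1 (length L)))))
    interiors : ∀ i j → i ≢ j → ∀ x y → Interior G u v (path i) x → Interior G u v (path j) y → x ≢ y × ¬ E x y
    interiors i j i≢j x y x∈ y∈ =
      pairwise {λ i j → Anticomplete (L i) (L j)} ac-sym ac₁₂ ac₁₃ ac₂₃ i j i≢j x y (interior-∈ u v (L i) x x∈) (interior-∈ u v (L j) y y∈)

  Rungs : V → V → V → V → List V → List V → Set
  Rungs x x′ y y′ R R′ = ∀ u v → u ∈ R → v ∈ R′ → u ≢ v × (E u v → (u ≡ x × v ≡ x′) ⊎ (u ≡ y × v ≡ y′))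

  rungs-sym : ∀ {x x′ y y′ R R′} → Rungs x x′ y y′ R R′ → Rungs x′ x y′ y R′ R
  rungs-sym rungs u v u∈ v∈ with rungs v u v∈ u∈
  ... | v≢u , edge = (λ e → v≢u (sym e)) , λ e → ⊎-map flip flip (edge (E-sym e))
    where flip : ∀ {A B : Set} → A × B → B × A
          flip (p , q) = q , p

  rungs-hole : ∀ x R x′ R′ y y′ → Induced (x ∷ R) → Induced (x′ ∷ R′) → (∃ λ w → w ∈ R) → (∃ λ w → w ∈ R′)
    → last (x ∷ R) ≡ just y → last (x′ ∷ R′) ≡ just y′ → E x x′ → E y y′
    → Rungs x x′ y y′ (x ∷ R) (x′ ∷ R′) → IsHole G (x ∷ R ++ reverse (x′ ∷ R′))
  rungs-hole x R@(r ∷ R₁) x′ R′@(r′ ∷ R₁′) y y′ ip ip′ _ _ ly ly′ exx′ eyy′ rungs =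
    holeAt⇒isHole x ys (induced-ys , long , x∉ , x-adj)
    where
    back = reverse (x′ ∷ R′)
    ys = R ++ back
    head-back : head back ≡ just y′
    head-back = trans (head-reverse (x′ ∷ R′)) ly′
    ab : Abutting R back
    ab u v u∈ v∈ with rungs u v (there u∈) (∈-reverse⁻ v∈)
    ... | u≢v , edge = u≢v , λ e → last-rung (edge e)
      where
      last-rung : (u ≡ x × v ≡ x′) ⊎ (u ≡ y × v ≡ y′) → last R ≡ just u × head back ≡ just v
      last-rung (inj₁ (refl , _)) = ⊥-elim (induced-head∉ ip u∈)
      last-rung (inj₂ (refl , refl)) = ly , head-back
    ends : EndsAdjacent R back
    ends u v e₁ e₂ = subst₂ E (just-injective (trans (sym ly) e₁)) (just-injective (trans (sym head-back) e₂)) eyy′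
    induced-ys : Induced ys
    induced-ys = induced-++⁺ R back (proj₂ (proj₂ ip)) (induced-reverse (x′ ∷ R′) ip′) ab ends
    long : 3 ≤ length ys
    long = subst (3 ≤_) (sym (trans (length-++ R) (cong (length R +_) (length-reverse (x′ ∷ R′)))))
             (s≤s (≤-trans (s≤s (s≤s z≤n)) (m≤n+m (suc (suc (length R₁′))) (length R₁))))
    x∉ : x ∉ ys
    x∉ x∈ with ∈-++⁻ R x∈
    ... | inj₁ p = induced-head∉ ip p
    ... | inj₂ p = proj₁ (rungs x x (here refl) (∈-reverse⁻ p)) refl
    last-ys : last ys ≡ just x′
    last-ys = trans (last-++-nonempty R back (x′ , ∈-reverse⁺ {xs = x′ ∷ R′} (here refl))) (last-reverse (x′ ∷ R′))
    x-adj : ∀ z → z ∈ ys → E x z ⇔ (head ys ≡ just z ⊎ last ys ≡ just z)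
    x-adj z z∈ = mk⇔ to from
      where
      to : E x z → (head ys ≡ just z ⊎ last ys ≡ just z)
      to e with ∈-++⁻ R z∈
      ... | inj₁ p = inj₁ (proj₂ (proj₁ ip z p) e)
      ... | inj₂ p with proj₂ (rungs x z (here refl) (∈-reverse⁻ p)) e
      ...   | inj₁ (_ , refl) = inj₂ last-ys
      ...   | inj₂ (refl , _) = ⊥-elim (induced-last≢head x R ip (r , here refl) ly)
      from : (head ys ≡ just z ⊎ last ys ≡ just z) → E x z
      from (inj₁ refl) = proj₁ (proj₂ ip)
      from (inj₂ e) = subst (E x) (just-injective (trans (sym last-ys) e)) exx′

  rungs-holeSet : ∀ x R x′ R′ → IsHole G (x ∷ R ++ reverse (x′ ∷ R′)) → IsHoleSet G (λ v → v ∈ x ∷ R ⊎ v ∈ x′ ∷ R′)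
  rungs-holeSet x R x′ R′ ih = x ∷ R ++ reverse (x′ ∷ R′) , ih , λ v → mk⇔ to from
    where
    to : ∀ {v} → v ∈ x ∷ R ++ reverse (x′ ∷ R′) → v ∈ x ∷ R ⊎ v ∈ x′ ∷ R′
    to (here e) = inj₁ (here e)
    to (there p) with ∈-++⁻ R p
    ... | inj₁ q = inj₁ (there q)
    ... | inj₂ q = inj₂ (∈-reverse⁻ q)
    from : ∀ {v} → v ∈ x ∷ R ⊎ v ∈ x′ ∷ R′ → v ∈ x ∷ R ++ reverse (x′ ∷ R′)
    from (inj₁ (here e)) = here e
    from (inj₁ (there q)) = there (∈-++⁺ˡ q)
    from (inj₂ q) = there (∈-++⁺ʳ R (∈-reverse⁺ q))

  PrismArm : V → V → List V → Set
  PrismArm x y R = Σ (List V) λ R₁ → R ≡ x ∷ R₁ × Induced (x ∷ R₁) × (∃ λ w → w ∈ R₁) × last (x ∷ R₁) ≡ just y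

  triangle : ∀ (t : Fin 3 → V) → E (t 0F) (t 1F) → E (t 0F) (t 2F) → E (t 1F) (t 2F) → Triangle G t
  triangle t e₀₁ e₀₂ e₁₂ = pairwise {λ i j → t i ≢ t j × E (t i) (t j)} (λ (t≢ , e) → ≢-sym t≢ , E-sym e)
    (E⇒≢ e₀₁ , e₀₁) (E⇒≢ e₀₂ , e₀₂) (E⇒≢ e₁₂ , e₁₂)

  prism : ∀ (x y : Fin 3 → V) (R : Fin 3 → List V) → (∀ i → PrismArm (x i) (y i) (R i))
    → Triangle G x → Triangle G y → (∀ i j → x i ≢ y j)
    → Rungs (x 0F) (x 1F) (y 0F) (y 1F) (R 0F) (R 1F)
    → Rungs (x 0F) (x 2F) (y 0F) (y 2F) (R 0F) (R 2F)
    → Rungs (x 1F) (x 2F) (y 1F) (y 2F) (R 1F) (R 2F)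
    → HasPrism G
  prism x y R arm tx ty x≢y r₀₁ r₀₂ r₁₂ = x , y , R , tx , ty , x≢y , isPath , holes
    where
    isPath : ∀ i → PathFromTo G (x i) (y i) (R i)
    isPath i with arm i
    ... | R₁ , e , ip , _ , ly = subst (PathFromTo G (x i) (y i)) (sym e) (induced⇒isPath (x i) R₁ ip , refl , ly)
    hole : ∀ i j → i ≢ j → Rungs (x i) (x j) (y i) (y j) (R i) (R j) → IsHoleSet G (λ v → v ∈ R i ⊎ v ∈ R j)
    hole i j i≢j rungs with arm i | arm j
    ... | R₁ , e , ip , ne , ly | R₁′ , e′ , ip′ , ne′ , ly′ =
      subst₂ (λ A B → IsHoleSet G (λ v → v ∈ A ⊎ v ∈ B)) (sym e) (sym e′) (rungs-holeSet (x i) R₁ (x j) R₁′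
        (rungs-hole (x i) R₁ (x j) R₁′ (y i) (y j) ip ip′ ne ne′ ly ly′ (proj₂ (tx i j i≢j)) (proj₂ (ty i j i≢j))
          (subst₂ (Rungs (x i) (x j) (y i) (y j)) e e′ rungs)))
    holes : ∀ i j → i ≢ j → IsHoleSet G (λ v → v ∈ R i ⊎ v ∈ R j)
    holes i j i≢j = hole i j i≢j (pairwise {λ i j → Rungs (x i) (x j) (y i) (y j) (R i) (R j)} rungs-sym r₀₁ r₀₂ r₁₂ i j i≢j)

  degIn-∷-adj : ∀ c x L → E c x → degIn G c (x ∷ L) ≡ suc (degIn G c L)
  degIn-∷-adj c x L e with E? c x
  ... | yes _ = refl
  ... | no ¬e = ⊥-elim (¬e e)

  degIn-∷-nonadj : ∀ c x L → ¬ E c x → degIn G c (x ∷ L) ≡ degIn G c L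
  degIn-∷-nonadj c x L ¬e with E? c x
  ... | yes e = ⊥-elim (¬e e)
  ... | no _ = refl

  degIn-++ : ∀ c xs ys → degIn G c (xs ++ ys) ≡ degIn G c xs + degIn G c ys
  degIn-++ c [] ys = refl
  degIn-++ c (x ∷ xs) ys with E? c x
  ... | yes _ = cong suc (degIn-++ c xs ys)
  ... | no _ = degIn-++ c xs ys

  degIn-reverse : ∀ c xs → degIn G c (reverse xs) ≡ degIn G c xs
  degIn-reverse c [] = refl
  degIn-reverse c (x ∷ xs) = begin
    degIn G c (reverse (x ∷ xs))             ≡⟨ cong (degIn G c) (unfold-reverse x xs) ⟩
    degIn G c (reverse xs ++ [ x ])          ≡⟨ degIn-++ c (reverse xs) [ x ] ⟩
    degIn G c (reverse xs) + degIn G c [ x ] ≡⟨ cong (_+ degIn G c [ x ]) (degIn-reverse c xs) ⟩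
    degIn G c xs + degIn G c [ x ]           ≡⟨ +-comm (degIn G c xs) (degIn G c [ x ]) ⟩
    degIn G c [ x ] + degIn G c xs           ≡⟨ degIn-++ c [ x ] xs ⟨
    degIn G c (x ∷ xs)                       ∎
    where open ≡-Reasoning

  degIn-none : ∀ c L → (∀ w → w ∈ L → ¬ E c w) → degIn G c L ≡ 0
  degIn-none c [] _ = refl
  degIn-none c (x ∷ L) none = trans (degIn-∷-nonadj c x L (none x (here refl))) (degIn-none c L (λ w w∈ → none w (there w∈)))

  degIn-unique : ∀ c L z → Induced L → z ∈ L → E c z → (∀ w → w ∈ L → E c w → w ≡ z) → degIn G c L ≡ 1
  degIn-unique c L z ip z∈ ez unique with ∈-∃++ z∈
  ... | pre , post , refl with induced-++⁻ pre (z ∷ post) ip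
  ...   | _ , (fresh , _ , _) , ab = begin
    degIn G c (pre ++ z ∷ post)           ≡⟨ degIn-++ c pre (z ∷ post) ⟩
    degIn G c pre + degIn G c (z ∷ post)  ≡⟨ cong (_+ degIn G c (z ∷ post)) none-pre ⟩
    degIn G c (z ∷ post)                  ≡⟨ degIn-∷-adj c z post ez ⟩
    suc (degIn G c post)                  ≡⟨ cong suc none-post ⟩
    1                                     ∎
    where
    open ≡-Reasoning
    none-pre : degIn G c pre ≡ 0
    none-pre = degIn-none c pre λ w w∈ e → proj₁ (ab w z w∈ (here refl)) (unique w (∈-++⁺ˡ w∈) e)
    none-post : degIn G c post ≡ 0
    none-post = degIn-none c post λ w w∈ e → proj₁ (fresh w w∈) (sym (unique w (∈-++⁺ʳ pre (there w∈)) e))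

module PyramidLegs (G : Graph) (Py : Pyramid G) where
  open Obstructions G public
  open Pyramid Py public
  open import Data.List.Membership.DecPropositional (_≟F_ {n}) using (_∈?_)

  a : V
  a = apex
  b : Fin 3 → V
  b = base
  P : Fin 3 → List V
  P = path

  leg : Fin 3 → List V
  leg i = drop 1 (P i)

  path≡apex∷leg : ∀ i → P i ≡ a ∷ leg i
  path≡apex∷leg i = head⇒≡∷ (P i) (proj₁ (proj₂ (paths i)))

  induced-apex∷leg : ∀ i → Induced (a ∷ leg i)
  induced-apex∷leg i = subst Induced (path≡apex∷leg i) (isPath⇒induced (P i) (proj₁ (paths i)))

  induced-leg : ∀ i → Induced (leg i)
  induced-leg i = proj₂ (proj₂ (induced-apex∷leg i))

  base∈path : ∀ i → b i ∈ P i
  base∈path i = last-∈ (P i) (proj₂ (proj₂ (paths i)))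

  apex∈path : ∀ i → a ∈ P i
  apex∈path i = subst (a ∈_) (sym (path≡apex∷leg i)) (here refl)

  leg⊆path : ∀ i {u} → u ∈ leg i → u ∈ P i
  leg⊆path i u∈ = subst (_ ∈_) (sym (path≡apex∷leg i)) (there u∈)

  path⇒apex⊎leg : ∀ i {u} → u ∈ P i → u ≡ a ⊎ u ∈ leg i
  path⇒apex⊎leg i u∈ with subst (_ ∈_) (path≡apex∷leg i) u∈
  ... | here e = inj₁ e
  ... | there p = inj₂ p

  apex∉leg : ∀ i → a ∉ leg i
  apex∉leg i = induced-head∉ (induced-apex∷leg i)

  base-adj : ∀ i j → i ≢ j → E (b i) (b j)
  base-adj i j i≢j = proj₂ (base-triangle i j i≢j)

  base-≢ : ∀ i j → i ≢ j → b i ≢ b j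
  base-≢ i j i≢j = proj₁ (base-triangle i j i≢j)

  InPaths : Fin 3 → Fin 3 → V → Set
  InPaths i j v = v ∈ P i ⊎ v ∈ P j

  base∉path : ∀ i j → i ≢ j → b j ∉ P i
  base∉path i j i≢j bj∈ with third i j i≢j
  ... | k , k≢i , k≢j = holeSet-no-triangle (InPaths i k) (holes i k (≢-sym k≢i)) (b i) (b j) (b k)
        (inj₁ (base∈path i)) (inj₁ bj∈) (inj₂ (base∈path k)) (base-adj i j i≢j) (base-adj j k (≢-sym k≢j)) (base-adj i k (≢-sym k≢i))

  base∈path⇒≡ : ∀ {i} l → b l ∈ P i → l ≡ i
  base∈path⇒≡ {i} l bl∈ with l ≟F i
  ... | yes l≡i = l≡i
  ... | no l≢i = ⊥-elim (base∉path i l (≢-sym l≢i) bl∈)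

  base≢apex : ∀ i → b i ≢ a
  base≢apex i e = base∉path (other i) i (other≢ i) (subst (_∈ P (other i)) (sym e) (apex∈path (other i)))

  last-leg : ∀ i → last (leg i) ≡ just (b i)
  last-leg i = drop-apex (leg i) (subst (λ q → last q ≡ just (b i)) (path≡apex∷leg i) (proj₂ (proj₂ (paths i))))
    where
    drop-apex : ∀ ts → last (a ∷ ts) ≡ just (b i) → last ts ≡ just (b i)
    drop-apex [] e = ⊥-elim (base≢apex i (sym (just-injective e)))
    drop-apex (t ∷ ts) e = e

  base∈leg : ∀ i → b i ∈ leg i
  base∈leg i = last-∈ (leg i) (last-leg i)

  last-apex∷leg : ∀ k → last (a ∷ leg k) ≡ just (b k)
  last-apex∷leg k = trans (last-++-nonempty [ a ] (leg k) (b k , base∈leg k)) (last-leg k)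

  apex-adj-head : ∀ j v → head (leg j) ≡ just v → E a v
  apex-adj-head j v h = adj (leg j) (proj₁ (proj₂ (induced-apex∷leg j))) h
    where adj : ∀ L → AdjHead a L → head L ≡ just v → E a v
          adj (l ∷ L) e refl = e

  leg-inner-neighbours : ∀ i u → u ∈ leg i → u ≢ b i → Σ V λ l → Σ V λ r → E u l × E u r × l ≢ r × l ∈ P i × r ∈ P i
  leg-inner-neighbours i u u∈ u≢b with ∈-∃++ u∈
  ... | pre , post , e = go post e
    where
    go : ∀ post → leg i ≡ pre ++ u ∷ post → Σ V λ l → Σ V λ r → E u l × E u r × l ≢ r × l ∈ P i × r ∈ P i
    go [] e = ⊥-elim (u≢b (just-injective (trans (sym (last-∷ʳ pre u)) (trans (cong last (sym e)) (last-leg i)))))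
    go (r ∷ post′) e with last-exists a pre
    ... | l , el with induced-inner-neighbours (a ∷ pre) u r post′ l (subst Induced (cong (a ∷_) e) (induced-apex∷leg i)) el
    ... | eul , eur , l≢r , l∈ , r∈ = l , r , eul , eur , l≢r , ∈P l∈ , ∈P r∈
      where ∈P : ∀ {z} → z ∈ a ∷ (pre ++ u ∷ r ∷ post′) → z ∈ P i
            ∈P = subst (_ ∈_) (sym (trans (path≡apex∷leg i) (cong (a ∷_) e)))

  -- The last vertex of leg j in P i would have three neighbours in the hole P i ∪ P j.
  leg∉path : ∀ i j → i ≢ j → ∀ u → u ∈ leg j → u ∉ P i
  leg∉path i j i≢j u u∈leg u∈P with last-satisfying (_∈? P i) (leg j) (u , u∈leg , u∈P)
  ... | pre , w , post , e , w∈P , none = go post e none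
    where
    w∈leg : ∀ post → leg j ≡ pre ++ w ∷ post → w ∈ leg j
    w∈leg post e = subst (w ∈_) (sym e) (∈-++⁺ʳ pre (here refl))
    go : ∀ post → leg j ≡ pre ++ w ∷ post → (∀ z → z ∈ post → ¬ z ∈ P i) → ⊥
    go [] e _ = base∉path i j i≢j (subst (_∈ P i) (just-injective (trans (sym (last-∷ʳ pre w)) (trans (cong last (sym e)) (last-leg j)))) w∈P)
    go (p ∷ post′) e none′ with path⇒apex⊎leg i w∈P
    ... | inj₁ w≡a = apex∉leg j (subst (_∈ leg j) w≡a (w∈leg (p ∷ post′) e))
    ... | inj₂ w∈legᵢ with w ≟F b i
    ...   | yes w≡b = base∉path j i (≢-sym i≢j) (subst (_∈ P j) w≡b (leg⊆path j (w∈leg (p ∷ post′) e)))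
    ...   | no w≢b with leg-inner-neighbours i w w∈legᵢ w≢b
    ...     | l , r , ewl , ewr , l≢r , l∈ , r∈ =
      holeSet-no-claw (InPaths i j) (holes i j i≢j) w l r p (inj₁ w∈P) (inj₁ l∈) (inj₁ r∈) (inj₂ p∈P) ewl ewr ewp l≢r
        (λ q → none′ p (here refl) (subst (_∈ P i) q l∈)) (λ q → none′ p (here refl) (subst (_∈ P i) q r∈))
      where
      ewp : E w p
      ewp = proj₁ (proj₂ (proj₁ (proj₂ (induced-++⁻ pre (w ∷ p ∷ post′) (subst Induced e (induced-leg j))))))
      p∈P : p ∈ P j
      p∈P = leg⊆path j (subst (p ∈_) (sym e) (∈-++⁺ʳ pre (there (here refl))))

  leg-edge⇒base : ∀ i j → i ≢ j → ∀ u v → u ∈ leg i → v ∈ leg j → E u v → u ≡ b i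
  leg-edge⇒base i j i≢j u v u∈ v∈ euv with u ≟F b i
  ... | yes e = e
  ... | no u≢b with leg-inner-neighbours i u u∈ u≢b
  ... | l , r , eul , eur , l≢r , l∈ , r∈ =
    ⊥-elim (holeSet-no-claw (InPaths i j) (holes i j i≢j) u l r v (inj₁ (leg⊆path i u∈)) (inj₁ l∈) (inj₁ r∈) (inj₂ (leg⊆path j v∈))
      eul eur euv l≢r (λ q → leg∉path i j i≢j v v∈ (subst (_∈ P i) q l∈)) (λ q → leg∉path i j i≢j v v∈ (subst (_∈ P i) q r∈)))

  leg-edge⇒bases : ∀ i j → i ≢ j → ∀ u v → u ∈ leg i → v ∈ leg j → E u v → u ≡ b i × v ≡ b j
  leg-edge⇒bases i j i≢j u v u∈ v∈ euv = leg-edge⇒base i j i≢j u v u∈ v∈ euv , leg-edge⇒base j i (≢-sym i≢j) v u v∈ u∈ (E-sym euv)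

  legs-distinct : ∀ i j → i ≢ j → ∀ u v → u ∈ leg i → v ∈ leg j → u ≢ v
  legs-distinct i j i≢j u v u∈ v∈ refl = leg∉path j i (≢-sym i≢j) u u∈ (leg⊆path j v∈)

  legs-ac : ∀ i j → i ≢ j → ∀ X Y → (∀ u → u ∈ X → u ∈ leg i) → (∀ v → v ∈ Y → v ∈ leg j) → b i ∉ X → Anticomplete X Y
  legs-ac i j i≢j X Y X⊆ Y⊆ b∉X u v u∈ v∈ = legs-distinct i j i≢j u v (X⊆ u u∈) (Y⊆ v v∈) ,
    λ e → b∉X (subst (_∈ X) (proj₁ (leg-edge⇒bases i j i≢j u v (X⊆ u u∈) (Y⊆ v v∈) e)) u∈)

  apex-leg-ac : ∀ i Y → (∀ v → v ∈ Y → v ∈ leg i) → (∀ v → v ∈ Y → head (leg i) ≢ just v) → Anticomplete [ a ] Y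
  apex-leg-ac i Y Y⊆ no-head = ac-point λ v v∈ → (λ e → apex∉leg i (subst (_∈ leg i) (sym e) (Y⊆ v v∈))) ,
    λ e → no-head v v∈ (proj₂ (proj₁ (induced-apex∷leg i) v (Y⊆ v v∈)) e)

  ∈-pre : ∀ {i pre x post u} → leg i ≡ pre ++ x ∷ post → u ∈ pre → u ∈ leg i
  ∈-pre {i} {pre} e u∈ = subst (_ ∈_) (sym e) (∈-++⁺ˡ u∈)

  ∈-post : ∀ {i pre x post u} → leg i ≡ pre ++ x ∷ post → u ∈ x ∷ post → u ∈ leg i
  ∈-post {i} {pre} e u∈ = subst (_ ∈_) (sym e) (∈-++⁺ʳ pre u∈)

  induced-leg≡ : ∀ {i pre x post} → leg i ≡ pre ++ x ∷ post → Induced (pre ++ x ∷ post)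
  induced-leg≡ {i} e = subst Induced e (induced-leg i)

  base∈post : ∀ {i pre x post} → leg i ≡ pre ++ x ∷ post → b i ∈ x ∷ post
  base∈post {i} {pre} {x} {post} e = last-∈ (x ∷ post) (trans (sym (last-++ pre x post)) (trans (cong last (sym e)) (last-leg i)))

  base∉pre : ∀ {i pre x post} → leg i ≡ pre ++ x ∷ post → b i ∉ pre
  base∉pre {i} {pre} {x} {post} e b∈ with induced-++⁻ pre (x ∷ post) (induced-leg≡ {i} e)
  ... | _ , _ , ab = proj₁ (ab (b i) (b i) b∈ (base∈post {i} e)) refl

  induced-apex-pre : ∀ {i pre x post} → leg i ≡ pre ++ x ∷ post → Induced (a ∷ pre ++ [ x ])
  induced-apex-pre {i} {pre} {x} {post} e =
    proj₁ (induced-++⁻ (a ∷ pre ++ [ x ]) post (subst Induced (cong (a ∷_) (trans e (sym (++-assoc pre [ x ] post)))) (induced-apex∷leg i)))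

  induced-post : ∀ {i pre x post} → leg i ≡ pre ++ x ∷ post → Induced (x ∷ post)
  induced-post {i} {pre} e = proj₁ (proj₂ (induced-++⁻ pre _ (induced-leg≡ {i} e)))

  head-leg∈pre : ∀ {i pre x post} → leg i ≡ pre ++ x ∷ post → ∀ v → head (leg i) ≡ just v → v ∈ pre ++ [ x ]
  head-leg∈pre {i} {[]} {x} e v h = subst (λ q → v ∈ q ∷ []) (just-injective (trans (sym h) (cong head e))) (here refl)
  head-leg∈pre {i} {p ∷ ps} {x} e v h = subst (_∈ p ∷ ps ++ [ x ]) (just-injective (trans (sym (cong head e)) h)) (here refl)

  last-post : ∀ {i pre x post} → leg i ≡ pre ++ x ∷ post → last (x ∷ post) ≡ just (b i)
  last-post {i} {pre} {x} {post} e = trans (sym (last-++ pre x post)) (trans (cong last (sym e)) (last-leg i))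

  ∈-pre∷ʳ : ∀ {j pre y post v} → leg j ≡ pre ++ y ∷ post → v ∈ pre ++ [ y ] → v ∈ leg j
  ∈-pre∷ʳ {j} {pre} {y} {post} e p with ∈-++⁻ pre p
  ... | inj₁ q = ∈-pre {j} e q
  ... | inj₂ (here refl) = ∈-post {j} e (here refl)

  head-pre : ∀ {j pre y post} → leg j ≡ pre ++ y ∷ post → head (pre ++ [ y ]) ≡ head (leg j)
  head-pre {j} {[]} e = sym (cong head e)
  head-pre {j} {p ∷ ps} e = sym (cong head e)

  reverse-apex-pre : ∀ (pre : List V) y → reverse (a ∷ pre ++ [ y ]) ≡ y ∷ reverse pre ++ [ a ]
  reverse-apex-pre pre y = trans (unfold-reverse a (pre ++ [ y ])) (cong (_++ [ a ]) (reverse-++ pre [ y ]))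

  induced-back-to-apex : ∀ {j pre y post} → leg j ≡ pre ++ y ∷ post → Induced (y ∷ reverse pre ++ [ a ])
  induced-back-to-apex {j} {pre} {y} e = subst Induced (reverse-apex-pre pre y) (induced-reverse _ (induced-apex-pre {j} e))

  ∈-back-to-apex : ∀ {u y} pre → u ∈ y ∷ reverse pre ++ [ a ] → u ≡ y ⊎ u ∈ pre ⊎ u ≡ a
  ∈-back-to-apex {u} {y} pre (here e) = inj₁ e
  ∈-back-to-apex pre (there p) with ∈-++⁻ (reverse pre) p
  ... | inj₁ q = inj₂ (inj₁ (∈-reverse⁻ q))
  ... | inj₂ (here e) = inj₂ (inj₂ e)

  induced-via-apex : ∀ j k → j ≢ k → ∀ {pre y post} → leg j ≡ pre ++ y ∷ post → y ≢ b j → Induced (y ∷ reverse pre ++ a ∷ leg k)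
  induced-via-apex j k j≢k {pre} {y} {post} e y≢b = subst Induced (cong (y ∷_) (++-assoc (reverse pre) [ a ] (leg k)))
    (induced-++⁺ (y ∷ reverse pre ++ [ a ]) (leg k) (induced-back-to-apex {j} e) (induced-leg k) ab ends)
    where
    ab : Abutting (y ∷ reverse pre ++ [ a ]) (leg k)
    ab u v u∈ v∈ with ∈-back-to-apex pre u∈
    ... | inj₂ (inj₂ refl) = (λ q → apex∉leg k (subst (_∈ leg k) (sym q) v∈)) , λ ev → last-∷ʳ (y ∷ reverse pre) a , proj₂ (proj₁ (induced-apex∷leg k) v v∈) ev
    ... | inj₁ refl = legs-distinct j k j≢k u v (∈-post {j} e (here refl)) v∈ , λ ev → ⊥-elim (y≢b (proj₁ (leg-edge⇒bases j k j≢k u v (∈-post {j} e (here refl)) v∈ ev)))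
    ... | inj₂ (inj₁ u∈pre) = legs-distinct j k j≢k u v (∈-pre {j} e u∈pre) v∈ ,
          λ ev → ⊥-elim (base∉pre {j} e (subst (_∈ pre) (proj₁ (leg-edge⇒bases j k j≢k u v (∈-pre {j} e u∈pre) v∈ ev)) u∈pre))
    ends : EndsAdjacent (y ∷ reverse pre ++ [ a ]) (leg k)
    ends u v lu hv = subst (λ q → E q v) (just-injective (trans (sym (last-∷ʳ (y ∷ reverse pre) a)) lu)) (apex-adj-head k v hv)

  first-nbr≢base : ∀ {i pre x post q} → leg i ≡ pre ++ x ∷ post → (∀ z → z ∈ pre → ¬ E q z) → ∀ x0 → x0 ∈ leg i → E q x0 → x0 ≢ b i → x ≢ b i
  first-nbr≢base {i} {pre} {x} {post} {q} e none-pre x0 x0∈leg ex0 x0≢b refl with ∈-++⁻ pre (subst (x0 ∈_) e x0∈leg)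
  ... | inj₁ x0∈pre = none-pre x0 x0∈pre ex0
  ... | inj₂ (here x0≡b) = x0≢b x0≡b
  ... | inj₂ (there x0∈post) = induced-last≢head (b i) post (induced-post {i} e) (x0 , x0∈post) (last-post {i} e)

  induced-arc-via-apex : ∀ i j → i ≢ j → ∀ {preX x rX preY y rY} → leg i ≡ preX ++ x ∷ rX → x ≢ b i → leg j ≡ preY ++ y ∷ rY
    → Induced (x ∷ (reverse preX ++ a ∷ preY) ++ [ y ])
  induced-arc-via-apex i j i≢j {preX} {x} {rX} {preY} {y} {rY} legᵢ≡ x≢b legⱼ≡ =
    subst Induced (cong (x ∷_) (trans (++-assoc (reverse preX) [ a ] (preY ++ [ y ])) (sym (++-assoc (reverse preX) (a ∷ preY) [ y ]))))
      (induced-++⁺ (x ∷ reverse preX ++ [ a ]) (preY ++ [ y ]) (induced-back-to-apex {i} legᵢ≡) (proj₂ (proj₂ (induced-apex-pre {j} legⱼ≡))) ab ends)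
    where
    ab : Abutting (x ∷ reverse preX ++ [ a ]) (preY ++ [ y ])
    ab u v u∈ v∈ with ∈-back-to-apex preX u∈
    ... | inj₁ refl = legs-distinct i j i≢j u v (∈-post {i} legᵢ≡ (here refl)) (∈-pre∷ʳ {j} legⱼ≡ v∈) ,
          λ e → ⊥-elim (x≢b (proj₁ (leg-edge⇒bases i j i≢j u v (∈-post {i} legᵢ≡ (here refl)) (∈-pre∷ʳ {j} legⱼ≡ v∈) e)))
    ... | inj₂ (inj₁ up) = legs-distinct i j i≢j u v (∈-pre {i} legᵢ≡ up) (∈-pre∷ʳ {j} legⱼ≡ v∈) ,
          λ e → ⊥-elim (base∉pre {i} legᵢ≡ (subst (_∈ preX) (proj₁ (leg-edge⇒bases i j i≢j u v (∈-pre {i} legᵢ≡ up) (∈-pre∷ʳ {j} legⱼ≡ v∈) e)) up))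
    ... | inj₂ (inj₂ refl) = (λ q → apex∉leg j (subst (_∈ leg j) (sym q) (∈-pre∷ʳ {j} legⱼ≡ v∈))) ,
          λ e → last-∷ʳ (x ∷ reverse preX) a , trans (head-pre {j} legⱼ≡) (proj₂ (proj₁ (induced-apex∷leg j) v (∈-pre∷ʳ {j} legⱼ≡ v∈)) e)
    ends : EndsAdjacent (x ∷ reverse preX ++ [ a ]) (preY ++ [ y ])
    ends u v lu hv = subst (λ q → E q v) (just-injective (trans (sym (last-∷ʳ (x ∷ reverse preX) a)) lu)) (apex-adj-head j v (trans (sym (head-pre {j} legⱼ≡)) hv))

  induced-arc-via-bases : ∀ i j → i ≢ j → ∀ {preX x postX preY y postY} → leg i ≡ preX ++ x ∷ postX → leg j ≡ preY ++ y ∷ postY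
    → Induced (x ∷ (postX ++ reverse postY) ++ [ y ])
  induced-arc-via-bases i j i≢j {preX} {x} {postX} {preY} {y} {postY} legᵢ≡ legⱼ≡ =
    subst Induced (cong (x ∷_) (trans (cong (postX ++_) (unfold-reverse y postY)) (sym (++-assoc postX (reverse postY) [ y ]))))
      (induced-++⁺ (x ∷ postX) (reverse (y ∷ postY)) (induced-post {i} legᵢ≡) (induced-reverse _ (induced-post {j} legⱼ≡)) ab ends)
    where
    ab : Abutting (x ∷ postX) (reverse (y ∷ postY))
    ab u v u∈ v∈ = legs-distinct i j i≢j u v (∈-post {i} legᵢ≡ u∈) (∈-post {j} legⱼ≡ (∈-reverse⁻ v∈)) ,
      λ e → bases-meet (leg-edge⇒bases i j i≢j u v (∈-post {i} legᵢ≡ u∈) (∈-post {j} legⱼ≡ (∈-reverse⁻ v∈)) e)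
      where bases-meet : u ≡ b i × v ≡ b j → last (x ∷ postX) ≡ just u × head (reverse (y ∷ postY)) ≡ just v
            bases-meet (refl , refl) = last-post {i} legᵢ≡ , trans (head-reverse (y ∷ postY)) (last-post {j} legⱼ≡)
    ends : EndsAdjacent (x ∷ postX) (reverse (y ∷ postY))
    ends u v lu hv = subst₂ E (just-injective (trans (sym (last-post {i} legᵢ≡)) lu))
      (just-injective (trans (sym (trans (head-reverse (y ∷ postY)) (last-post {j} legⱼ≡))) hv)) (base-adj i j i≢j)

  ∈-three-parts : ∀ {i} A B C {v} → leg i ≡ A ++ B ++ C → v ∈ A ⊎ v ∈ B ⊎ v ∈ C → v ∈ leg i
  ∈-three-parts A B C e (inj₁ p) = subst (_ ∈_) (sym e) (∈-++⁺ˡ p)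
  ∈-three-parts A B C e (inj₂ (inj₁ p)) = subst (_ ∈_) (sym e) (∈-++⁺ʳ A (∈-++⁺ˡ p))
  ∈-three-parts A B C e (inj₂ (inj₂ p)) = subst (_ ∈_) (sym e) (∈-++⁺ʳ A (∈-++⁺ʳ B p))

  base∉front : ∀ i A B C → leg i ≡ A ++ B ++ C → (∃ λ w → w ∈ B) → b i ∉ A
  base∉front i A (b0 ∷ bs) C e _ b∈A with induced-++⁻ A _ (subst Induced e (induced-leg i))
  ... | _ , _ , ab = proj₁ (ab (b i) (b i) b∈A b∈BC) refl
    where b∈BC = last-∈ ((b0 ∷ bs) ++ C) (trans (sym (last-++ A b0 (bs ++ C))) (trans (cong last (sym e)) (last-leg i)))

  head∉back : ∀ i A B C → leg i ≡ A ++ B ++ C → (∃ λ w → w ∈ B) → ∀ v → head (leg i) ≡ just v → v ∉ C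
  head∉back i A (b0 ∷ bs) C e _ v h vC with induced-++⁻ (A ++ b0 ∷ bs) C (subst Induced (trans e (sym (++-assoc A (b0 ∷ bs) C))) (induced-leg i))
  ... | _ , _ , ab = proj₁ (ab v v (hdin A h′) vC) refl
    where
    h′ : head (A ++ b0 ∷ bs ++ C) ≡ just v
    h′ = trans (cong head (sym e)) h
    hdin : ∀ A → head (A ++ b0 ∷ bs ++ C) ≡ just v → v ∈ A ++ b0 ∷ bs
    hdin [] refl = here refl
    hdin (x ∷ A) refl = here refl

  arcs-ac : ∀ i j → i ≢ j → ∀ A B C → leg i ≡ A ++ B ++ C → (∃ λ w → w ∈ B) → ∀ preY y postY → leg j ≡ preY ++ y ∷ postY
    → Anticomplete (reverse A ++ a ∷ preY) (C ++ reverse postY)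
  arcs-ac i j i≢j A B C leg≡ neB preY y postY legⱼ≡ =
    ac-++ˡ (reverse A) (a ∷ preY)
      (ac-reverseˡ A (ac-++ʳ C (reverse postY) (induced-gap⇒ac A B C neB (subst Induced leg≡ (induced-leg i)))
                                        (ac-reverseʳ postY (legs-ac i j i≢j A postY (λ u p → ∈-three-parts A B C leg≡ (inj₁ p))
                                                                     (λ v p → ∈-post {j} legⱼ≡ (there p)) (base∉front i A B C leg≡ neB)))))
      (ac-∷ˡ a preY
        (ac-++ʳ C (reverse postY) (apex-leg-ac i C (λ v p → ∈-three-parts A B C leg≡ (inj₂ (inj₂ p))) λ v p h → head∉back i A B C leg≡ neB v h p)
                              (ac-reverseʳ postY (apex-leg-ac j postY (λ v p → ∈-post {j} legⱼ≡ (there p)) λ v p h →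
                                  proj₁ (proj₂ (proj₂ (induced-++⁻ (preY ++ [ y ]) postY
                                    (subst Induced (trans legⱼ≡ (sym (++-assoc preY [ y ] postY))) (induced-leg j))))
                                    v v (head-leg∈pre {j} legⱼ≡ v h) p) refl)))
        (ac-++ʳ C (reverse postY) (legs-ac j i (≢-sym i≢j) preY C (λ u p → ∈-pre {j} legⱼ≡ p) (λ v p → ∈-three-parts A B C leg≡ (inj₂ (inj₂ p))) (base∉pre {j} legⱼ≡))
                              (ac-reverseʳ postY (induced-gap⇒ac preY [ y ] postY (y , here refl) (induced-leg≡ {j} legⱼ≡)))))

module Attachments (G : Graph) (Py : Pyramid G) (G∈C : InC G) (apex-closed : ∀ v → Graph.E G (Pyramid.apex Py) v → InΣ G Py v) where
  open PyramidLegs G Py public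
  open import Data.List.Membership.DecPropositional (_≟F_ {n}) using (_∈?_)

  noTheta : ¬ HasTheta G
  noTheta = proj₁ (proj₂ G∈C)
  noPrism : ¬ HasPrism G
  noPrism = proj₁ (proj₂ (proj₂ G∈C))
  noEvenWheel : ¬ HasEvenWheel G
  noEvenWheel = proj₂ (proj₂ (proj₂ G∈C))

  Outside : V → Set
  Outside q = ¬ InΣ G Py q

  leg⇒InΣ : ∀ i {s} → s ∈ leg i → InΣ G Py s
  leg⇒InΣ i si = i , leg⊆path i si

  apex-InΣ : InΣ G Py a
  apex-InΣ = 0F , apex∈path 0F

  base-InΣ : ∀ i → InΣ G Py (b i)
  base-InΣ i = i , base∈path i

  outside≢ : ∀ {q s} → Outside q → InΣ G Py s → q ≢ s
  outside≢ oq s∈Σ refl = oq s∈Σ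

  apex-nonadj : ∀ {q} → Outside q → ¬ E a q
  apex-nonadj oq e = oq (apex-closed _ e)

  record Segment : Set where
    field
      Q : List V
      q₁ qₘ : V
      Q⁺ Q⁻ : List V
      Q≡q₁∷ : Q ≡ q₁ ∷ Q⁺
      Q≡∷qₘ : Q ≡ Q⁻ ++ [ qₘ ]
      Q⁺-nonempty : ∃ λ w → w ∈ Q⁺
      induced-Q : Induced Q
      outside-Q : ∀ q → q ∈ Q → Outside q

  module SegmentFacts (seg : Segment) where
    open Segment seg

    induced-q₁∷Q⁺ : Induced (q₁ ∷ Q⁺)
    induced-q₁∷Q⁺ = subst Induced Q≡q₁∷ induced-Q

    induced-Q⁻∷ʳqₘ : Induced (Q⁻ ++ [ qₘ ])
    induced-Q⁻∷ʳqₘ = subst Induced Q≡∷qₘ induced-Q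

    q₁∉Q⁺ : q₁ ∉ Q⁺
    q₁∉Q⁺ = induced-head∉ induced-q₁∷Q⁺

    qₘ∉Q⁻ : qₘ ∉ Q⁻
    qₘ∉Q⁻ p = proj₁ (proj₂ (proj₂ (induced-++⁻ Q⁻ [ qₘ ] induced-Q⁻∷ʳqₘ)) qₘ qₘ p (here refl)) refl

    last-Q : last Q ≡ just qₘ
    last-Q = trans (cong last Q≡∷qₘ) (last-∷ʳ Q⁻ qₘ)

    head-Q : head Q ≡ just q₁
    head-Q = cong head Q≡q₁∷

    qₘ∈Q⁺ : qₘ ∈ Q⁺
    qₘ∈Q⁺ = last∈tail Q⁺ Q⁺-nonempty (trans (cong last (sym Q≡q₁∷)) last-Q)
      where last∈tail : ∀ Q⁺ → (∃ λ w → w ∈ Q⁺) → last (q₁ ∷ Q⁺) ≡ just qₘ → qₘ ∈ Q⁺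
            last∈tail (w ∷ ws) _ e = last-∈ (w ∷ ws) e

    q₁≢qₘ : q₁ ≢ qₘ
    q₁≢qₘ e = q₁∉Q⁺ (subst (_∈ Q⁺) (sym e) qₘ∈Q⁺)

    q₁∈Q : q₁ ∈ Q
    q₁∈Q = subst (q₁ ∈_) (sym Q≡q₁∷) (here refl)

    qₘ∈Q : qₘ ∈ Q
    qₘ∈Q = subst (qₘ ∈_) (sym Q≡∷qₘ) (∈-++⁺ʳ Q⁻ (here refl))

    Q⁺⊆Q : ∀ {q} → q ∈ Q⁺ → q ∈ Q
    Q⁺⊆Q p = subst (_ ∈_) (sym Q≡q₁∷) (there p)

    Q⁻⊆Q : ∀ {q} → q ∈ Q⁻ → q ∈ Q
    Q⁻⊆Q p = subst (_ ∈_) (sym Q≡∷qₘ) (∈-++⁺ˡ p)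

    ∈Q⇒q₁⊎Q⁺ : ∀ {q} → q ∈ Q → q ≡ q₁ ⊎ q ∈ Q⁺
    ∈Q⇒q₁⊎Q⁺ p with subst (_ ∈_) Q≡q₁∷ p
    ... | here e = inj₁ e
    ... | there r = inj₂ r

    ∈Q⇒Q⁻⊎qₘ : ∀ {q} → q ∈ Q → q ∈ Q⁻ ⊎ q ≡ qₘ
    ∈Q⇒Q⁻⊎qₘ p with ∈-++⁻ Q⁻ (subst (_ ∈_) Q≡∷qₘ p)
    ... | inj₁ r = inj₁ r
    ... | inj₂ (here e) = inj₂ e

    q₁∈Q⁻ : q₁ ∈ Q⁻
    q₁∈Q⁻ with ∈Q⇒Q⁻⊎qₘ q₁∈Q
    ... | inj₁ r = r
    ... | inj₂ e = ⊥-elim (q₁≢qₘ e)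

    reverse-Q : reverse Q ≡ qₘ ∷ reverse Q⁻
    reverse-Q = trans (cong reverse Q≡∷qₘ) (reverse-++ Q⁻ [ qₘ ])

    outside-Q≢ : ∀ {q s} → q ∈ Q → InΣ G Py s → q ≢ s
    outside-Q≢ q∈ s∈Σ = outside≢ (outside-Q _ q∈) s∈Σ

  reverseSegment : Segment → Segment
  reverseSegment seg = record
    { Q = reverse Q ; q₁ = qₘ ; qₘ = q₁ ; Q⁺ = reverse Q⁻ ; Q⁻ = reverse Q⁺
    ; Q≡q₁∷ = reverse-Q ; Q≡∷qₘ = trans (cong reverse Q≡q₁∷) (unfold-reverse q₁ Q⁺) ; Q⁺-nonempty = q₁ , ∈-reverse⁺ q₁∈Q⁻
    ; induced-Q = induced-reverse Q induced-Q ; outside-Q = λ q p → outside-Q q (∈-reverse⁻ p) }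
    where open Segment seg
          open SegmentFacts seg

  EndsAttach : Fin 3 → Fin 3 → Segment → Set
  EndsAttach i j seg = ∀ s q → InΣ G Py s → q ∈ Segment.Q seg → E s q → (q ≡ Segment.q₁ seg × s ∈ leg i) ⊎ (q ≡ Segment.qₘ seg × s ∈ leg j)

  endsAttach-reverse : ∀ i j seg → EndsAttach i j seg → EndsAttach j i (reverseSegment seg)
  endsAttach-reverse i j seg attach s q s∈Σ q∈ e with attach s q s∈Σ (∈-reverse⁻ q∈) e
  ... | inj₁ x = inj₂ x
  ... | inj₂ y = inj₁ y

  module EndsAttachFacts (i j : Fin 3) (i≢j : i ≢ j) (seg : Segment) (attach : EndsAttach i j seg) where
    open Segment seg
    open SegmentFacts seg

    q₁-nbr∈legᵢ : ∀ {s} → InΣ G Py s → E s q₁ → s ∈ leg i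
    q₁-nbr∈legᵢ {s} s∈Σ e with attach s q₁ s∈Σ q₁∈Q e
    ... | inj₁ (_ , p) = p
    ... | inj₂ (e′ , _) = ⊥-elim (q₁≢qₘ e′)

    qₘ-nbr∈legⱼ : ∀ {s} → InΣ G Py s → E s qₘ → s ∈ leg j
    qₘ-nbr∈legⱼ {s} s∈Σ e with attach s qₘ s∈Σ qₘ∈Q e
    ... | inj₁ (e′ , _) = ⊥-elim (q₁≢qₘ (sym e′))
    ... | inj₂ (_ , p) = p

    legₖ-ac : ∀ k → k ≢ i → k ≢ j → Anticomplete (leg k) Q
    legₖ-ac k k≢i k≢j u v u∈ v∈ = (λ e → outside-Q≢ v∈ (leg⇒InΣ k u∈) (sym e)) , λ e → by-attach (attach u v (leg⇒InΣ k u∈) v∈ e)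
      where by-attach : (v ≡ q₁ × u ∈ leg i) ⊎ (v ≡ qₘ × u ∈ leg j) → ⊥
            by-attach (inj₁ (_ , p)) = legs-distinct k i k≢i u u u∈ p refl
            by-attach (inj₂ (_ , p)) = legs-distinct k j k≢j u u u∈ p refl

    q₁-nonadj-legⱼ : ∀ {v} → v ∈ leg j → ¬ E q₁ v
    q₁-nonadj-legⱼ v∈ e = legs-distinct i j i≢j _ _ (q₁-nbr∈legᵢ (leg⇒InΣ j v∈) (E-sym e)) v∈ refl

    apex-ac : Anticomplete [ a ] Q
    apex-ac = ac-point λ v v∈ → (λ e → outside-Q≢ v∈ apex-InΣ (sym e)) , apex-nonadj (outside-Q v v∈)

    legⱼ-ac : ∀ Y → (∀ y → y ∈ Y → y ∈ leg j) → (∀ y → y ∈ Y → ¬ E qₘ y) → Anticomplete Y Q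
    legⱼ-ac Y Y⊆leg none u v u∈ v∈ = (λ e → outside-Q≢ v∈ (leg⇒InΣ j (Y⊆leg u u∈)) (sym e)) , λ e → by-attach e (attach u v (leg⇒InΣ j (Y⊆leg u u∈)) v∈ e)
      where by-attach : E u v → (v ≡ q₁ × u ∈ leg i) ⊎ (v ≡ qₘ × u ∈ leg j) → ⊥
            by-attach _ (inj₁ (_ , p)) = legs-distinct i j i≢j u u p (Y⊆leg u u∈) refl
            by-attach e (inj₂ (refl , p)) = none u u∈ (E-sym e)

    legᵢ-ac : ∀ X → (∀ x → x ∈ X → x ∈ leg i) → (∀ x → x ∈ X → ¬ E q₁ x) → Anticomplete X Q
    legᵢ-ac X X⊆leg none u v u∈ v∈ = (λ e → outside-Q≢ v∈ (leg⇒InΣ i (X⊆leg u u∈)) (sym e)) , λ e → by-attach e (attach u v (leg⇒InΣ i (X⊆leg u u∈)) v∈ e)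
      where by-attach : E u v → (v ≡ q₁ × u ∈ leg i) ⊎ (v ≡ qₘ × u ∈ leg j) → ⊥
            by-attach e (inj₁ (refl , p)) = none u u∈ (E-sym e)
            by-attach _ (inj₂ (_ , p)) = legs-distinct i j i≢j u u (X⊆leg u u∈) p refl

  Outcome4At : Fin 3 → Fin 3 → List V → V → V → Set
  Outcome4At i j Q q₁ qₘ = EndsAt G Q q₁ qₘ
      × (∀ s → NΣ G Py (_≡ q₁) s → s ∈ path i)
      × (∃[ u ] (u ∈ path i × E q₁ u × (∀ w → w ∈ path i → E q₁ w → w ≡ u)))
      × (∀ w → w ∈ path i → (E q₁ w ⇔ E apex w))
      × (∀ s → NΣ G Py (_≡ qₘ) s → s ∈ path j)
      × Σ V λ x → Σ V λ y → x ≢ y × x ∈ path j × y ∈ path j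
      × E qₘ x × E qₘ y × (∀ w → w ∈ path j → E qₘ w → w ≡ x ⊎ w ≡ y)
      × E x y × x ≢ apex × y ≢ apex
      × (∀ s q → InΣ G Py s → q ∈ Q → E s q →
           (q ≡ q₁ × s ∈ path i) ⊎ (q ≡ qₘ × (s ≡ x ⊎ s ≡ y)))

  -- The paths
  -- y1 → a → b k (along preY and leg k), y2 → b j and qₘ → q₁ → x2 → b i (along Q and postX) form a prism
  -- with the base when preX and postY are nonempty; if postY is empty, y2 = b j has the four neighbours
  -- y1, b k, qₘ, b i on the hole formed by the first and the third path; if preX is empty we get outcome (4).
  module EdgeEnd (i j : Fin 3) (i≢j : i ≢ j) (seg : Segment) (attach : EndsAttach i j seg)
             (preX : List V) (x2 : V) (postX : List V) (legᵢ≡ : leg i ≡ preX ++ x2 ∷ postX)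
             (ex2 : E (Segment.q₁ seg) x2) (none-postX : ∀ z → z ∈ postX → ¬ E (Segment.q₁ seg) z)
             (preY : List V) (y1 y2 : V) (postY : List V) (legⱼ≡ : leg j ≡ preY ++ y1 ∷ y2 ∷ postY)
             (ey1 : E (Segment.qₘ seg) y1) (ey2 : E (Segment.qₘ seg) y2)
             (none-preY : ∀ z → z ∈ preY → ¬ E (Segment.qₘ seg) z) (none-postY : ∀ z → z ∈ postY → ¬ E (Segment.qₘ seg) z) where
    open Segment seg
    open SegmentFacts seg
    open EndsAttachFacts i j i≢j seg attach
    open Third i j i≢j

    legⱼ≡′ : leg j ≡ (preY ++ [ y1 ]) ++ y2 ∷ postY
    legⱼ≡′ = trans legⱼ≡ (sym (++-assoc preY [ y1 ] (y2 ∷ postY)))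

    induced-y2∷postY : Induced (y2 ∷ postY)
    induced-y2∷postY = induced-post {j} legⱼ≡′

    bⱼ∉preY : b j ∉ preY ++ [ y1 ]
    bⱼ∉preY = base∉pre {j} legⱼ≡′

    y1∈leg : y1 ∈ leg j
    y1∈leg = ∈-post {j} legⱼ≡ (here refl)
    y2∈leg : y2 ∈ leg j
    y2∈leg = ∈-post {j} legⱼ≡′ (here refl)
    preY⊆leg : ∀ {u} → u ∈ preY ++ [ y1 ] → u ∈ leg j
    preY⊆leg p = ∈-pre {j} legⱼ≡′ p
    postY⊆leg : ∀ {u} → u ∈ y2 ∷ postY → u ∈ leg j
    postY⊆leg p = ∈-post {j} legⱼ≡′ p
    postX⊆leg : ∀ {u} → u ∈ x2 ∷ postX → u ∈ leg i
    postX⊆leg p = ∈-post {i} legᵢ≡ p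

    y1≢bⱼ : y1 ≢ b j
    y1≢bⱼ e = bⱼ∉preY (subst (_∈ preY ++ [ y1 ]) e (∈-++⁺ʳ preY (here refl)))

    abutY : Abutting (preY ++ [ y1 ]) (y2 ∷ postY)
    abutY = proj₂ (proj₂ (induced-++⁻ (preY ++ [ y1 ]) (y2 ∷ postY) (induced-leg≡ {j} legⱼ≡′)))

    ey12 : E y1 y2
    ey12 = induced-++⇒endsAdjacent (preY ++ [ y1 ]) (y2 ∷ postY) (induced-leg≡ {j} legⱼ≡′) y1 y2 (last-∷ʳ preY y1) refl

    qₘ-nbr∈legⱼ⇒ : ∀ w → w ∈ leg j → E qₘ w → w ≡ y1 ⊎ w ≡ y2
    qₘ-nbr∈legⱼ⇒ w w∈ e with ∈-++⁻ preY (subst (w ∈_) legⱼ≡ w∈)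
    ... | inj₁ p = ⊥-elim (none-preY w p e)
    ... | inj₂ (here r) = inj₁ r
    ... | inj₂ (there (here r)) = inj₂ r
    ... | inj₂ (there (there p)) = ⊥-elim (none-postY w p e)

    R₀ : List V
    R₀ = reverse preY ++ a ∷ leg k
    induced-R₀ : Induced (y1 ∷ R₀)
    induced-R₀ = induced-via-apex j k (≢-sym k≢j) {preY} {y1} {y2 ∷ postY} legⱼ≡ y1≢bⱼ
    ∈R₀ : ∀ {u} → u ∈ y1 ∷ R₀ → u ∈ preY ++ [ y1 ] ⊎ u ≡ a ⊎ u ∈ leg k
    ∈R₀ (here refl) = inj₁ (∈-++⁺ʳ preY (here refl))
    ∈R₀ (there p) with ∈-++⁻ (reverse preY) p
    ... | inj₁ q = inj₁ (∈-++⁺ˡ (∈-reverse⁻ {xs = preY} q))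
    ... | inj₂ (here e) = inj₂ (inj₁ e)
    ... | inj₂ (there q) = inj₂ (inj₂ q)
    last-R₀ : last (y1 ∷ R₀) ≡ just (b k)
    last-R₀ = trans (last-++ (y1 ∷ reverse preY) a (leg k)) (last-apex∷leg k)
    R₀-nonempty : ∃ λ w → w ∈ R₀
    R₀-nonempty = a , ∈-++⁺ʳ (reverse preY) (here refl)

    R₂ : List V
    R₂ = reverse Q⁻ ++ x2 ∷ postX
    induced-R₂ : Induced (qₘ ∷ R₂)
    induced-R₂ = subst (λ L → Induced (L ++ x2 ∷ postX)) reverse-Q (induced-++⁺ (reverse Q) (x2 ∷ postX) (induced-reverse Q induced-Q) (induced-post {i} legᵢ≡) ab ends)
      where
      ab : Abutting (reverse Q) (x2 ∷ postX)
      ab u v u∈ v∈ = (outside-Q≢ (∈-reverse⁻ u∈) (leg⇒InΣ i (postX⊆leg v∈))) , λ e → by-attach v v∈ e (attach v u (leg⇒InΣ i (postX⊆leg v∈)) (∈-reverse⁻ u∈) (E-sym e))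
        where
        by-attach : ∀ v → v ∈ x2 ∷ postX → E u v → (u ≡ q₁ × v ∈ leg i) ⊎ (u ≡ qₘ × v ∈ leg j) → last (reverse Q) ≡ just u × head (x2 ∷ postX) ≡ just v
        by-attach v (here refl) e (inj₁ (refl , _)) = trans (last-reverse Q) head-Q , refl
        by-attach v (there p) e (inj₁ (refl , _)) = ⊥-elim (none-postX v p e)
        by-attach v v∈ e (inj₂ (_ , p)) = ⊥-elim (legs-distinct i j i≢j v v (postX⊆leg v∈) p refl)
      ends : EndsAdjacent (reverse Q) (x2 ∷ postX)
      ends u v lu refl = subst (λ q → E q x2) (just-injective (trans (sym (trans (last-reverse Q) head-Q)) lu)) ex2
    ∈R₂ : ∀ {u} → u ∈ qₘ ∷ R₂ → u ∈ Q ⊎ u ∈ x2 ∷ postX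
    ∈R₂ (here refl) = inj₁ qₘ∈Q
    ∈R₂ (there p) with ∈-++⁻ (reverse Q⁻) p
    ... | inj₁ q = inj₁ (Q⁻⊆Q (∈-reverse⁻ q))
    ... | inj₂ q = inj₂ q
    last-R₂ : last (qₘ ∷ R₂) ≡ just (b i)
    last-R₂ = trans (last-++ (qₘ ∷ reverse Q⁻) x2 postX) (last-post {i} legᵢ≡)
    R₂-nonempty : ∃ λ w → w ∈ R₂
    R₂-nonempty = x2 , ∈-++⁺ʳ (reverse Q⁻) (here refl)

    rungs₀₁ : Rungs y1 y2 (b k) (b j) (y1 ∷ R₀) (y2 ∷ postY)
    rungs₀₁ u v u∈ v∈ with ∈R₀ u∈
    ... | inj₁ p = proj₁ (abutY u v p v∈) ,
          λ e → inj₁ (sym (just-injective (trans (sym (last-∷ʳ preY y1)) (proj₁ (proj₂ (abutY u v p v∈) e)))) ,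
                      just-injective (sym (proj₂ (proj₂ (abutY u v p v∈) e))))
    ... | inj₂ (inj₁ refl) = (λ q → apex∉leg j (subst (_∈ leg j) (sym q) (postY⊆leg v∈))) ,
          λ e → ⊥-elim (proj₁ (abutY v v (head-leg∈pre {j} legⱼ≡ v (proj₂ (proj₁ (induced-apex∷leg j) v (postY⊆leg v∈)) e)) v∈) refl)
    ... | inj₂ (inj₂ p) = legs-distinct k j k≢j u v p (postY⊆leg v∈) , λ e → inj₂ (leg-edge⇒bases k j k≢j u v p (postY⊆leg v∈) e)

    rungs₀₂ : (∃ λ w → w ∈ preX) → Rungs y1 qₘ (b k) (b i) (y1 ∷ R₀) (qₘ ∷ R₂)
    rungs₀₂ preX-nonempty u v u∈ v∈ with ∈R₀ u∈ | ∈R₂ v∈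
    ... | inj₁ p | inj₁ v∈Q = ≢-sym (outside-Q≢ v∈Q (leg⇒InΣ j (preY⊆leg p))) , λ e → by-attach e (attach u v (leg⇒InΣ j (preY⊆leg p)) v∈Q e)
      where by-attach : E u v → (v ≡ q₁ × u ∈ leg i) ⊎ (v ≡ qₘ × u ∈ leg j) → (u ≡ y1 × v ≡ qₘ) ⊎ (u ≡ b k × v ≡ b i)
            by-attach e (inj₁ (_ , u∈legᵢ)) = ⊥-elim (legs-distinct i j i≢j u u u∈legᵢ (preY⊆leg p) refl)
            by-attach e (inj₂ (refl , _)) with qₘ-nbr∈legⱼ⇒ u (preY⊆leg p) (E-sym e)
            ... | inj₁ r = inj₁ (r , refl)
            ... | inj₂ refl = ⊥-elim (proj₁ (abutY u u p (here refl)) refl)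
    ... | inj₁ p | inj₂ v∈postX = legs-distinct j i (≢-sym i≢j) u v (preY⊆leg p) (postX⊆leg v∈postX) ,
          λ e → ⊥-elim (bⱼ∉preY (subst (_∈ preY ++ [ y1 ]) (proj₁ (leg-edge⇒bases j i (≢-sym i≢j) u v (preY⊆leg p) (postX⊆leg v∈postX) e)) p))
    ... | inj₂ (inj₁ refl) | inj₁ v∈Q = ≢-sym (outside-Q≢ v∈Q apex-InΣ) , λ e → ⊥-elim (apex-nonadj (outside-Q v v∈Q) e)
    ... | inj₂ (inj₁ refl) | inj₂ v∈postX = (λ q → apex∉leg i (subst (_∈ leg i) (sym q) (postX⊆leg v∈postX))) ,
          λ e → ⊥-elim (head∉postX preX legᵢ≡ preX-nonempty (proj₂ (proj₁ (induced-apex∷leg i) v (postX⊆leg v∈postX)) e))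
      where
      head∉postX : ∀ preX′ → leg i ≡ preX′ ++ x2 ∷ postX → (∃ λ w → w ∈ preX′) → head (leg i) ≡ just v → ⊥
      head∉postX (p ∷ ps) e′ _ h with induced-++⁻ (p ∷ ps) (x2 ∷ postX) (induced-leg≡ {i} {p ∷ ps} {x2} {postX} e′)
      ... | _ , _ , ab = proj₁ (ab p v (here refl) v∈postX) (just-injective (trans (sym (cong head e′)) h))
    ... | inj₂ (inj₂ p) | inj₁ v∈Q = ≢-sym (outside-Q≢ v∈Q (leg⇒InΣ k p)) , λ e → ⊥-elim (proj₂ (legₖ-ac k k≢i k≢j u v p v∈Q) e)
    ... | inj₂ (inj₂ p) | inj₂ v∈postX = legs-distinct k i k≢i u v p (postX⊆leg v∈postX) , λ e → inj₂ (leg-edge⇒bases k i k≢i u v p (postX⊆leg v∈postX) e)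

    rungs₁₂ : Rungs y2 qₘ (b j) (b i) (y2 ∷ postY) (qₘ ∷ R₂)
    rungs₁₂ u v u∈ v∈ with ∈R₂ v∈
    ... | inj₁ v∈Q = ≢-sym (outside-Q≢ v∈Q (leg⇒InΣ j (postY⊆leg u∈))) , λ e → by-attach e (attach u v (leg⇒InΣ j (postY⊆leg u∈)) v∈Q e)
      where by-attach : E u v → (v ≡ q₁ × u ∈ leg i) ⊎ (v ≡ qₘ × u ∈ leg j) → (u ≡ y2 × v ≡ qₘ) ⊎ (u ≡ b j × v ≡ b i)
            by-attach e (inj₁ (_ , u∈legᵢ)) = ⊥-elim (legs-distinct i j i≢j u u u∈legᵢ (postY⊆leg u∈) refl)
            by-attach e (inj₂ (refl , _)) with qₘ-nbr∈legⱼ⇒ u (postY⊆leg u∈) (E-sym e)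
            ... | inj₁ refl = ⊥-elim (proj₁ (abutY u u (∈-++⁺ʳ preY (here refl)) u∈) refl)
            ... | inj₂ r = inj₁ (r , refl)
    ... | inj₂ v∈postX = legs-distinct j i (≢-sym i≢j) u v (postY⊆leg u∈) (postX⊆leg v∈postX) , λ e → inj₂ (leg-edge⇒bases j i (≢-sym i≢j) u v (postY⊆leg u∈) (postX⊆leg v∈postX) e)

    last-y2∷postY : last (y2 ∷ postY) ≡ just (b j)
    last-y2∷postY = last-post {j} legⱼ≡′

    y1≢y2 : y1 ≢ y2
    y1≢y2 = E⇒≢ ey12

    hasPrism : (∃ λ w → w ∈ preX) → (∃ λ w → w ∈ postY) → HasPrism G
    hasPrism preX-nonempty postY-nonempty = prism top bottom side arm top-triangle bottom-triangle top≢bottom rungs₀₁ (rungs₀₂ preX-nonempty) rungs₁₂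
      where
      top : Fin 3 → V
      top 0F = y1
      top 1F = y2
      top 2F = qₘ
      bottom : Fin 3 → V
      bottom 0F = b k
      bottom 1F = b j
      bottom 2F = b i
      side : Fin 3 → List V
      side 0F = y1 ∷ R₀
      side 1F = y2 ∷ postY
      side 2F = qₘ ∷ R₂
      arm : ∀ s → PrismArm (top s) (bottom s) (side s)
      arm 0F = R₀ , refl , induced-R₀ , R₀-nonempty , last-R₀
      arm 1F = postY , refl , induced-y2∷postY , postY-nonempty , last-y2∷postY
      arm 2F = R₂ , refl , induced-R₂ , R₂-nonempty , last-R₂
      top-triangle : Triangle G top
      top-triangle = triangle top ey12 (E-sym ey1) (E-sym ey2)
      bottom-triangle : Triangle G bottom
      bottom-triangle = triangle bottom (base-adj k j k≢j) (base-adj k i k≢i) (base-adj j i (≢-sym i≢j))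
      y2≢bⱼ : y2 ≢ b j
      y2≢bⱼ e = induced-head∉ induced-y2∷postY (subst (_∈ postY) (sym e) (last∈tail postY postY-nonempty last-y2∷postY))
        where last∈tail : ∀ L → (∃ λ w → w ∈ L) → last (y2 ∷ L) ≡ just (b j) → b j ∈ L
              last∈tail (l ∷ L) _ ee = last-∈ (l ∷ L) ee
      top≢bottom : ∀ s t → top s ≢ bottom t
      top≢bottom 0F 0F = legs-distinct j k (≢-sym k≢j) y1 (b k) y1∈leg (base∈leg k)
      top≢bottom 0F 1F = y1≢bⱼ
      top≢bottom 0F 2F = legs-distinct j i (≢-sym i≢j) y1 (b i) y1∈leg (base∈leg i)
      top≢bottom 1F 0F = legs-distinct j k (≢-sym k≢j) y2 (b k) y2∈leg (base∈leg k)
      top≢bottom 1F 1F = y2≢bⱼ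
      top≢bottom 1F 2F = legs-distinct j i (≢-sym i≢j) y2 (b i) y2∈leg (base∈leg i)
      top≢bottom 2F 0F = outside-Q≢ qₘ∈Q (base-InΣ k)
      top≢bottom 2F 1F = outside-Q≢ qₘ∈Q (base-InΣ j)
      top≢bottom 2F 2F = outside-Q≢ qₘ∈Q (base-InΣ i)

    hasEvenWheel : (∃ λ w → w ∈ preX) → postY ≡ [] → HasEvenWheel G
    hasEvenWheel preX-nonempty postY≡[] = hole , y2 , isHole , y2∉hs , subst (3 ≤_) (sym deg) (s≤s (s≤s (s≤s z≤n))) , subst (2 ∣_) (sym deg) (divides 2 refl)
      where
      hole : List V
      hole = y1 ∷ R₀ ++ reverse (qₘ ∷ R₂)
      isHole : IsHole G hole
      isHole = rungs-hole y1 R₀ qₘ R₂ (b k) (b i) induced-R₀ induced-R₂ R₀-nonempty R₂-nonempty last-R₀ last-R₂ (E-sym ey1) (base-adj k i k≢i) (rungs₀₂ preX-nonempty)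
      y2≡bⱼ : y2 ≡ b j
      y2≡bⱼ = just-injective (trans (cong (λ L → last (y2 ∷ L)) (sym postY≡[])) last-y2∷postY)
      y2∉preY∷y1 : y2 ∉ preY ++ [ y1 ]
      y2∉preY∷y1 p = proj₁ (abutY y2 y2 p (here refl)) refl
      y2∉hs : y2 ∉ hole
      y2∉hs (here e) = y1≢y2 (sym e)
      y2∉hs (there p) with ∈-++⁻ R₀ p
      ... | inj₁ q with ∈R₀ (there q)
      ...   | inj₁ r = y2∉preY∷y1 r
      ...   | inj₂ (inj₁ r) = apex∉leg j (subst (_∈ leg j) r y2∈leg)
      ...   | inj₂ (inj₂ r) = legs-distinct j k (≢-sym k≢j) y2 y2 y2∈leg r refl
      y2∉hs (there p) | inj₂ q with ∈R₂ (∈-reverse⁻ q)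
      ...   | inj₁ r = outside-Q≢ r (leg⇒InΣ j y2∈leg) refl
      ...   | inj₂ r = legs-distinct j i (≢-sym i≢j) y2 y2 y2∈leg (postX⊆leg r) refl
      y2bₖ : E y2 (b k)
      y2bₖ = subst (λ q → E q (b k)) (sym y2≡bⱼ) (base-adj j k (≢-sym k≢j))
      y2bᵢ : E y2 (b i)
      y2bᵢ = subst (λ q → E q (b i)) (sym y2≡bⱼ) (base-adj j i (≢-sym i≢j))
      deg-preY : degIn G y2 (reverse preY) ≡ 0
      deg-preY = trans (degIn-reverse y2 preY) (degIn-none y2 preY λ w w∈ e →
        proj₁ (proj₂ (proj₂ (induced-++⁻ preY [ y1 ] (proj₁ (induced-++⁻ (preY ++ [ y1 ]) (y2 ∷ postY) (induced-leg≡ {j} legⱼ≡′))))) w y1 w∈ (here refl))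
          (just-injective (trans (sym (proj₁ (proj₂ (abutY w y2 (∈-++⁺ˡ w∈) (here refl)) (E-sym e)))) (last-∷ʳ preY y1))))
      deg-apex∷legₖ : degIn G y2 (a ∷ leg k) ≡ 1
      deg-apex∷legₖ = trans (degIn-∷-nonadj y2 a (leg k) (λ e → y2∉preY∷y1 (head-leg∈pre {j} legⱼ≡ y2 (proj₂ (proj₁ (induced-apex∷leg j) y2 y2∈leg) (E-sym e)))))
        (degIn-unique y2 (leg k) (b k) (induced-leg k) (base∈leg k) y2bₖ λ w w∈ e → proj₂ (leg-edge⇒bases j k (≢-sym k≢j) y2 w y2∈leg w∈ e))
      deg-Q⁻ : degIn G y2 (reverse Q⁻) ≡ 0
      deg-Q⁻ = trans (degIn-reverse y2 Q⁻) (degIn-none y2 Q⁻ λ w w∈ e → nonadj w w∈ (attach y2 w (leg⇒InΣ j y2∈leg) (Q⁻⊆Q w∈) e))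
        where nonadj : ∀ w → w ∈ Q⁻ → (w ≡ q₁ × y2 ∈ leg i) ⊎ (w ≡ qₘ × y2 ∈ leg j) → ⊥
              nonadj w w∈ (inj₁ (_ , p)) = legs-distinct i j i≢j y2 y2 p y2∈leg refl
              nonadj w w∈ (inj₂ (refl , _)) = qₘ∉Q⁻ w∈
      deg-postX : degIn G y2 (x2 ∷ postX) ≡ 1
      deg-postX = degIn-unique y2 (x2 ∷ postX) (b i) (induced-post {i} legᵢ≡) (base∈post {i} legᵢ≡) y2bᵢ
        λ w w∈ e → proj₂ (leg-edge⇒bases j i (≢-sym i≢j) y2 w y2∈leg (postX⊆leg w∈) e)
      deg-R₀ : degIn G y2 R₀ ≡ 1
      deg-R₀ = trans (degIn-++ y2 (reverse preY) (a ∷ leg k)) (cong₂ _+_ deg-preY deg-apex∷legₖ)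
      open ≡-Reasoning
      deg-R₂ : degIn G y2 (reverse (qₘ ∷ R₂)) ≡ 2
      deg-R₂ = begin
        degIn G y2 (reverse (qₘ ∷ R₂))                           ≡⟨ degIn-reverse y2 (qₘ ∷ R₂) ⟩
        degIn G y2 (qₘ ∷ reverse Q⁻ ++ x2 ∷ postX)               ≡⟨ degIn-∷-adj y2 qₘ R₂ (E-sym ey2) ⟩
        suc (degIn G y2 (reverse Q⁻ ++ x2 ∷ postX))              ≡⟨ cong suc (degIn-++ y2 (reverse Q⁻) (x2 ∷ postX)) ⟩
        suc (degIn G y2 (reverse Q⁻) + degIn G y2 (x2 ∷ postX))  ≡⟨ cong suc (cong₂ _+_ deg-Q⁻ deg-postX) ⟩
        2                                                        ∎
      deg : degIn G y2 hole ≡ 4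
      deg = begin
        degIn G y2 (y1 ∷ R₀ ++ reverse (qₘ ∷ R₂))             ≡⟨ degIn-∷-adj y2 y1 _ (E-sym ey12) ⟩
        suc (degIn G y2 (R₀ ++ reverse (qₘ ∷ R₂)))            ≡⟨ cong suc (degIn-++ y2 R₀ (reverse (qₘ ∷ R₂))) ⟩
        suc (degIn G y2 R₀ + degIn G y2 (reverse (qₘ ∷ R₂)))  ≡⟨ cong suc (cong₂ _+_ deg-R₀ deg-R₂) ⟩
        4                                                      ∎

    outcome4 : preX ≡ [] → Outcome4At i j Q q₁ qₘ
    outcome4 preX≡[] = (head-Q , last-Q) , q₁-nbrs⊆Pᵢ , (x2 , leg⊆path i x2∈leg , ex2 , q₁-nbr-unique) , q₁-nbrs≡apex-nbrs , qₘ-nbrs⊆Pⱼ ,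
            y1 , y2 , y1≢y2 , leg⊆path j y1∈leg , leg⊆path j y2∈leg , ey1 , ey2 , qₘ-nbr∈path⇒ , ey12 ,
            (λ e → apex∉leg j (subst (_∈ leg j) e y1∈leg)) , (λ e → apex∉leg j (subst (_∈ leg j) e y2∈leg)) , only-edges
      where
      legᵢ≡′ : leg i ≡ x2 ∷ postX
      legᵢ≡′ = trans legᵢ≡ (cong (_++ x2 ∷ postX) preX≡[])
      x2∈leg : x2 ∈ leg i
      x2∈leg = postX⊆leg (here refl)
      q₁-nbrs⊆Pᵢ : ∀ s → NΣ G Py (_≡ q₁) s → s ∈ path i
      q₁-nbrs⊆Pᵢ s (s∈Σ , _ , x , refl , e) = leg⊆path i (q₁-nbr∈legᵢ s∈Σ e)
      qₘ-nbrs⊆Pⱼ : ∀ s → NΣ G Py (_≡ qₘ) s → s ∈ path j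
      qₘ-nbrs⊆Pⱼ s (s∈Σ , _ , x , refl , e) = leg⊆path j (qₘ-nbr∈legⱼ s∈Σ e)
      q₁-nbr-unique-leg : ∀ w → w ∈ leg i → E q₁ w → w ≡ x2
      q₁-nbr-unique-leg w w∈ e with subst (w ∈_) legᵢ≡′ w∈
      ... | here r = r
      ... | there p = ⊥-elim (none-postX w p e)
      q₁-nbr-unique : ∀ w → w ∈ path i → E q₁ w → w ≡ x2
      q₁-nbr-unique w w∈ e with path⇒apex⊎leg i w∈
      ... | inj₁ refl = ⊥-elim (apex-nonadj (outside-Q q₁ q₁∈Q) (E-sym e))
      ... | inj₂ p = q₁-nbr-unique-leg w p e
      ax2 : E a x2
      ax2 = subst (AdjHead a) legᵢ≡′ (proj₁ (proj₂ (induced-apex∷leg i)))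
      q₁-nbrs≡apex-nbrs : ∀ w → w ∈ path i → (E q₁ w ⇔ E apex w)
      q₁-nbrs≡apex-nbrs w w∈ with path⇒apex⊎leg i w∈
      ... | inj₁ refl = mk⇔ (λ e → ⊥-elim (apex-nonadj (outside-Q q₁ q₁∈Q) (E-sym e))) (λ e → ⊥-elim (E-irrefl e))
      ... | inj₂ p = mk⇔ (λ e → subst (E a) (sym (q₁-nbr-unique-leg w p e)) ax2)
                         (λ e → subst (E q₁) (sym (just-injective (trans (sym (proj₂ (proj₁ (induced-apex∷leg i) w p) e)) (cong head legᵢ≡′)))) ex2)
      qₘ-nbr∈path⇒ : ∀ w → w ∈ path j → E qₘ w → w ≡ y1 ⊎ w ≡ y2
      qₘ-nbr∈path⇒ w w∈ e with path⇒apex⊎leg j w∈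
      ... | inj₁ refl = ⊥-elim (apex-nonadj (outside-Q qₘ qₘ∈Q) (E-sym e))
      ... | inj₂ p = qₘ-nbr∈legⱼ⇒ w p e
      only-edges : ∀ s q → InΣ G Py s → q ∈ Q → E s q → (q ≡ q₁ × s ∈ path i) ⊎ (q ≡ qₘ × (s ≡ y1 ⊎ s ≡ y2))
      only-edges s q s∈Σ q∈ e with attach s q s∈Σ q∈ e
      ... | inj₁ (r , p) = inj₁ (r , leg⊆path i p)
      ... | inj₂ (refl , p) = inj₂ (refl , qₘ-nbr∈legⱼ⇒ s p (E-sym e))

  edge-end-case : ∀ i j → (i≢j : i ≢ j) → (seg : Segment) → EndsAttach i j seg → (x0 : V) → x0 ∈ leg i → E (Segment.q₁ seg) x0
    → ∀ preY y1 y2 postY → leg j ≡ preY ++ y1 ∷ y2 ∷ postY → E (Segment.qₘ seg) y1 → E (Segment.qₘ seg) y2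
    → (∀ z → z ∈ preY → ¬ E (Segment.qₘ seg) z) → (∀ z → z ∈ postY → ¬ E (Segment.qₘ seg) z)
    → Outcome4At i j (Segment.Q seg) (Segment.q₁ seg) (Segment.qₘ seg)
  edge-end-case i j i≢j seg attach x0 x0∈leg ex0 preY y1 y2 postY legⱼ≡ ey1 ey2 none-preY none-postY
    with last-satisfying (E? (Segment.q₁ seg)) (leg i) (x0 , x0∈leg , ex0)
  ... | preX , x2 , postX , legᵢ≡ , ex2 , none-postX = by-cases preX legᵢ≡ postY legⱼ≡ none-postY
    where
    module End = EdgeEnd i j i≢j seg attach
    by-cases : ∀ preX → leg i ≡ preX ++ x2 ∷ postX → ∀ postY → leg j ≡ preY ++ y1 ∷ y2 ∷ postY → (∀ z → z ∈ postY → ¬ E (Segment.qₘ seg) z)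
       → Outcome4At i j (Segment.Q seg) (Segment.q₁ seg) (Segment.qₘ seg)
    by-cases [] legᵢ≡ postY legⱼ≡ none-postY =
      End.outcome4 [] x2 postX legᵢ≡ ex2 none-postX preY y1 y2 postY legⱼ≡ ey1 ey2 none-preY none-postY refl
    by-cases (p ∷ ps) legᵢ≡ [] legⱼ≡ none-postY = ⊥-elim (noEvenWheel
      (End.hasEvenWheel (p ∷ ps) x2 postX legᵢ≡ ex2 none-postX preY y1 y2 [] legⱼ≡ ey1 ey2 none-preY none-postY (p , here refl) refl))
    by-cases (p ∷ ps) legᵢ≡ (r ∷ rs) legⱼ≡ none-postY = ⊥-elim (noPrism
      (End.hasPrism (p ∷ ps) x2 postX legᵢ≡ ex2 none-postX preY y1 y2 (r ∷ rs) legⱼ≡ ey1 ey2 none-preY none-postY (p , here refl) (r , here refl)))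

  data Attachment (q : V) (i : Fin 3) : Set where
    one : ∀ pre x post → leg i ≡ pre ++ x ∷ post → E q x → (∀ z → z ∈ pre → ¬ E q z) → (∀ z → z ∈ post → ¬ E q z) → Attachment q i
    edge : ∀ pre x1 x2 post → leg i ≡ pre ++ x1 ∷ x2 ∷ post → E q x1 → E q x2 → (∀ z → z ∈ pre → ¬ E q z) → (∀ z → z ∈ post → ¬ E q z) → Attachment q i
    spread : ∀ pre x1 mid x2 post → (∃ λ w → w ∈ mid) → leg i ≡ pre ++ x1 ∷ mid ++ x2 ∷ post → E q x1 → E q x2
         → (∀ z → z ∈ pre → ¬ E q z) → (∀ z → z ∈ post → ¬ E q z) → Attachment q i

  attachment : ∀ q i → (∃ λ x → x ∈ leg i × E q x) → Attachment q i
  attachment q i w with first-satisfying (E? q) (leg i) w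
  ... | pre , x1 , rest , e , ex1 , npre with any-∈? (E? q) rest
  ...   | no nr = one pre x1 rest e ex1 npre λ z zi ez → nr (z , zi , ez)
  ...   | yes w′ with last-satisfying (E? q) rest w′
  ...     | [] , x2 , post , e′ , ex2 , npost = edge pre x1 x2 post (trans e (cong (λ L → pre ++ x1 ∷ L) e′)) ex1 ex2 npre npost
  ...     | (m ∷ ms) , x2 , post , e′ , ex2 , npost = spread pre x1 (m ∷ ms) x2 post (m , here refl) (trans e (cong (λ L → pre ++ x1 ∷ L) e′)) ex1 ex2 npre npost

  module TwoLegs (i j : Fin 3) (i≢j : i ≢ j) (seg : Segment) (attach : EndsAttach i j seg) where
    open Segment seg
    open SegmentFacts seg
    open EndsAttachFacts i j i≢j seg attach
    open Third i j i≢j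

    legᵢ-Q⁺-ac : Anticomplete (leg i) Q⁺
    legᵢ-Q⁺-ac u q u∈ q∈ = (λ e → outside-Q≢ (Q⁺⊆Q q∈) (leg⇒InΣ i u∈) (sym e)) , λ e → by-attach (attach u q (leg⇒InΣ i u∈) (Q⁺⊆Q q∈) e)
      where by-attach : (q ≡ q₁ × u ∈ leg i) ⊎ (q ≡ qₘ × u ∈ leg j) → ⊥
            by-attach (inj₁ (refl , _)) = q₁∉Q⁺ q∈
            by-attach (inj₂ (_ , p)) = legs-distinct i j i≢j u u u∈ p refl

    legⱼ-Q⁻-ac : Anticomplete (leg j) Q⁻
    legⱼ-Q⁻-ac u q u∈ q∈ = (λ e → outside-Q≢ (Q⁻⊆Q q∈) (leg⇒InΣ j u∈) (sym e)) , λ e → by-attach (attach u q (leg⇒InΣ j u∈) (Q⁻⊆Q q∈) e)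
      where by-attach : (q ≡ q₁ × u ∈ leg i) ⊎ (q ≡ qₘ × u ∈ leg j) → ⊥
            by-attach (inj₁ (_ , p)) = legs-distinct i j i≢j u u p u∈ refl
            by-attach (inj₂ (refl , _)) = qₘ∉Q⁻ q∈

    induced-Q∷ʳ : ∀ v → v ∈ leg j → E qₘ v → Induced (Q ++ [ v ])
    induced-Q∷ʳ v vT e = induced-++⁺ Q [ v ] induced-Q induced-[ _ ] ab ends
      where
      ab : Abutting Q [ v ]
      ab u w u∈ (here refl) = outside-Q≢ u∈ (leg⇒InΣ j vT) , λ e′ → by-attach (attach v u (leg⇒InΣ j vT) u∈ (E-sym e′))
        where by-attach : (u ≡ q₁ × v ∈ leg i) ⊎ (u ≡ qₘ × v ∈ leg j) → last Q ≡ just u × head [ v ] ≡ just v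
              by-attach (inj₁ (_ , p)) = ⊥-elim (legs-distinct i j i≢j v v p vT refl)
              by-attach (inj₂ (refl , _)) = last-Q , refl
      ends : EndsAdjacent Q [ v ]
      ends u w lu refl = subst (λ q → E q v) (just-injective (trans (sym last-Q) lu)) e

    head-Q∷ʳ : ∀ v → head (Q ++ [ v ]) ≡ just q₁
    head-Q∷ʳ v = cong (λ L → head (L ++ [ v ])) Q≡q₁∷

    theta-one-one : ∀ preX x postX → leg i ≡ preX ++ x ∷ postX → E q₁ x → (∀ z → z ∈ preX → ¬ E q₁ z) → (∀ z → z ∈ postX → ¬ E q₁ z) → x ≢ b i
       → ∀ preY y postY → leg j ≡ preY ++ y ∷ postY → E qₘ y → (∀ z → z ∈ preY → ¬ E qₘ z) → (∀ z → z ∈ postY → ¬ E qₘ z)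
       → HasTheta G
    theta-one-one preX x postX legᵢ≡ ex none-preX none-postX x≢b preY y postY legⱼ≡ ey none-preY none-postY =
      theta x y Q (reverse preX ++ a ∷ preY) (postX ++ reverse postY) arm₁ arm₂ arm₃ ac₁₂ ac₁₃ ac₂₃
      where
      x∈leg : x ∈ leg i
      x∈leg = ∈-post {i} legᵢ≡ (here refl)
      y∈leg : y ∈ leg j
      y∈leg = ∈-post {j} legⱼ≡ (here refl)
      arm₁ : ThetaArm x y Q
      arm₁ = induced-++⁺ [ x ] (Q ++ [ y ]) induced-[ _ ] (induced-Q∷ʳ y y∈leg ey) ab ends , q₁ , q₁∈Q
        where
        ab : Abutting [ x ] (Q ++ [ y ])
        ab u v (here refl) v∈ with ∈-++⁻ Q v∈
        ... | inj₁ vq = ≢-sym (outside-Q≢ vq (leg⇒InΣ i x∈leg)) , λ e → by-attach (attach x v (leg⇒InΣ i x∈leg) vq e)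
          where by-attach : (v ≡ q₁ × x ∈ leg i) ⊎ (v ≡ qₘ × x ∈ leg j) → last [ x ] ≡ just x × head (Q ++ [ y ]) ≡ just v
                by-attach (inj₁ (refl , _)) = refl , head-Q∷ʳ y
                by-attach (inj₂ (_ , p)) = ⊥-elim (legs-distinct i j i≢j x x x∈leg p refl)
        ... | inj₂ (here refl) = legs-distinct i j i≢j x y x∈leg y∈leg , λ e → ⊥-elim (x≢b (proj₁ (leg-edge⇒bases i j i≢j x y x∈leg y∈leg e)))
        ends : EndsAdjacent [ x ] (Q ++ [ y ])
        ends u v refl hv = subst (E x) (just-injective (trans (sym (head-Q∷ʳ y)) hv)) (E-sym ex)
      arm₂ : ThetaArm x y (reverse preX ++ a ∷ preY)
      arm₂ = induced-arc-via-apex i j i≢j legᵢ≡ x≢b legⱼ≡ , a , ∈-++⁺ʳ (reverse preX) (here refl)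
      base∈postX : ∀ postX → leg i ≡ preX ++ x ∷ postX → b i ∈ postX
      base∈postX postX e with base∈post {i} e
      ... | here r = ⊥-elim (x≢b (sym r))
      ... | there p = p
      arm₃ : ThetaArm x y (postX ++ reverse postY)
      arm₃ = induced-arc-via-bases i j i≢j legᵢ≡ legⱼ≡ , b i , ∈-++⁺ˡ (base∈postX postX legᵢ≡)
      ac₁₂ : Anticomplete Q (reverse preX ++ a ∷ preY)
      ac₁₂ = ac-sym (ac-++ˡ (reverse preX) (a ∷ preY) (ac-reverseˡ preX (legᵢ-ac preX (λ u p → ∈-pre {i} legᵢ≡ p) none-preX))
                                                 (ac-∷ˡ a preY apex-ac (legⱼ-ac preY (λ u p → ∈-pre {j} legⱼ≡ p) none-preY)))
      ac₁₃ : Anticomplete Q (postX ++ reverse postY)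
      ac₁₃ = ac-sym (ac-++ˡ postX (reverse postY) (legᵢ-ac postX (λ u p → ∈-post {i} legᵢ≡ (there p)) none-postX)
                                            (ac-reverseˡ postY (legⱼ-ac postY (λ u p → ∈-post {j} legⱼ≡ (there p)) none-postY)))
      ac₂₃ : Anticomplete (reverse preX ++ a ∷ preY) (postX ++ reverse postY)
      ac₂₃ = arcs-ac i j i≢j preX [ x ] postX legᵢ≡ (x , here refl) preY y postY legⱼ≡

    ∈-arc-via-apex : ∀ {v} x1 preX preY y → v ∈ x1 ∷ (reverse preX ++ a ∷ preY) ++ [ y ] → v ≡ x1 ⊎ v ∈ preX ⊎ v ≡ a ⊎ v ∈ preY ⊎ v ≡ y
    ∈-arc-via-apex x1 preX preY y (here r) = inj₁ r
    ∈-arc-via-apex x1 preX preY y (there p) with ∈-++⁻ (reverse preX ++ a ∷ preY) p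
    ... | inj₂ (here r) = inj₂ (inj₂ (inj₂ (inj₂ r)))
    ... | inj₁ q with ∈-++⁻ (reverse preX) q
    ...   | inj₁ r = inj₂ (inj₁ (∈-reverse⁻ r))
    ...   | inj₂ (here r) = inj₂ (inj₂ (inj₁ r))
    ...   | inj₂ (there r) = inj₂ (inj₂ (inj₂ (inj₁ r)))

    ∈-arc-via-bases : ∀ {v : V} (x2 : V) (postX postY : List V) (y : V) → v ∈ x2 ∷ (postX ++ reverse postY) ++ [ y ] → v ≡ x2 ⊎ v ∈ postX ⊎ v ∈ postY ⊎ v ≡ y
    ∈-arc-via-bases x2 postX postY y (here r) = inj₁ r
    ∈-arc-via-bases x2 postX postY y (there p) with ∈-++⁻ (postX ++ reverse postY) p
    ... | inj₂ (here r) = inj₂ (inj₂ (inj₂ r))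
    ... | inj₁ q with ∈-++⁻ postX q
    ...   | inj₁ r = inj₂ (inj₁ r)
    ...   | inj₂ r = inj₂ (inj₂ (inj₁ (∈-reverse⁻ r)))

    theta-spread-one : ∀ preX x1 midX x2 postX → (∃ λ w → w ∈ midX) → leg i ≡ preX ++ x1 ∷ midX ++ x2 ∷ postX → E q₁ x1 → E q₁ x2
       → (∀ z → z ∈ preX → ¬ E q₁ z) → (∀ z → z ∈ postX → ¬ E q₁ z)
       → ∀ preY y postY → leg j ≡ preY ++ y ∷ postY → E qₘ y → (∀ z → z ∈ preY → ¬ E qₘ z) → (∀ z → z ∈ postY → ¬ E qₘ z)
       → HasTheta G
    theta-spread-one preX x1 midX x2 postX mid-nonempty legᵢ≡ ex1 ex2 none-preX none-postX preY y postY legⱼ≡ ey none-preY none-postY =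
      theta q₁ y Q⁺ (x1 ∷ reverse preX ++ a ∷ preY) (x2 ∷ postX ++ reverse postY) arm₁ arm₂ arm₃ ac₁₂ ac₁₃ ac₂₃
      where
      legᵢ≡₃ : leg i ≡ (preX ++ [ x1 ]) ++ midX ++ (x2 ∷ postX)
      legᵢ≡₃ = trans legᵢ≡ (sym (++-assoc preX [ x1 ] (midX ++ x2 ∷ postX)))
      legᵢ≡₁ : leg i ≡ preX ++ x1 ∷ (midX ++ x2 ∷ postX)
      legᵢ≡₁ = legᵢ≡
      legᵢ≡₂ : leg i ≡ (preX ++ x1 ∷ midX) ++ x2 ∷ postX
      legᵢ≡₂ = trans legᵢ≡ (sym (++-assoc preX (x1 ∷ midX) (x2 ∷ postX)))
      y∈leg : y ∈ leg j
      y∈leg = ∈-post {j} legⱼ≡ (here refl)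
      bᵢ∉preX∷x1 : b i ∉ preX ++ [ x1 ]
      bᵢ∉preX∷x1 = base∉front i (preX ++ [ x1 ]) midX (x2 ∷ postX) legᵢ≡₃ mid-nonempty
      x1≢b : x1 ≢ b i
      x1≢b e = bᵢ∉preX∷x1 (subst (_∈ preX ++ [ x1 ]) e (∈-++⁺ʳ preX (here refl)))
      arm₁ : ThetaArm q₁ y Q⁺
      arm₁ = subst Induced (cong (_++ [ y ]) Q≡q₁∷) (induced-Q∷ʳ y y∈leg ey) , Q⁺-nonempty
      preX∷x1⊆leg : ∀ {v} → v ∈ preX ⊎ v ≡ x1 → v ∈ leg i
      preX∷x1⊆leg (inj₁ p) = ∈-pre {i} legᵢ≡₁ p
      preX∷x1⊆leg (inj₂ refl) = ∈-post {i} legᵢ≡₁ (here refl)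
      arm₂ : ThetaArm q₁ y (x1 ∷ reverse preX ++ a ∷ preY)
      arm₂ = induced-++⁺ [ q₁ ] (x1 ∷ (reverse preX ++ a ∷ preY) ++ [ y ]) induced-[ _ ] (induced-arc-via-apex i j i≢j legᵢ≡₁ x1≢b legⱼ≡) ab ends , x1 , here refl
        where
        ab : Abutting [ q₁ ] (x1 ∷ (reverse preX ++ a ∷ preY) ++ [ y ])
        ab u v (here refl) v∈ with ∈-arc-via-apex x1 preX preY y v∈
        ... | inj₁ refl = outside-Q≢ q₁∈Q (leg⇒InΣ i (preX∷x1⊆leg (inj₂ refl))) , λ _ → refl , refl
        ... | inj₂ (inj₁ p) = outside-Q≢ q₁∈Q (leg⇒InΣ i (preX∷x1⊆leg (inj₁ p))) , λ e → ⊥-elim (none-preX v p e)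
        ... | inj₂ (inj₂ (inj₁ refl)) = outside-Q≢ q₁∈Q apex-InΣ , λ e → ⊥-elim (apex-nonadj (outside-Q q₁ q₁∈Q) (E-sym e))
        ... | inj₂ (inj₂ (inj₂ (inj₁ p))) = outside-Q≢ q₁∈Q (leg⇒InΣ j (∈-pre {j} legⱼ≡ p)) , λ e → ⊥-elim (q₁-nonadj-legⱼ (∈-pre {j} legⱼ≡ p) e)
        ... | inj₂ (inj₂ (inj₂ (inj₂ refl))) = outside-Q≢ q₁∈Q (leg⇒InΣ j y∈leg) , λ e → ⊥-elim (q₁-nonadj-legⱼ y∈leg e)
        ends : EndsAdjacent [ q₁ ] (x1 ∷ (reverse preX ++ a ∷ preY) ++ [ y ])
        ends u v refl refl = ex1
      arm₃ : ThetaArm q₁ y (x2 ∷ postX ++ reverse postY)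
      arm₃ = induced-++⁺ [ q₁ ] (x2 ∷ (postX ++ reverse postY) ++ [ y ]) induced-[ _ ] (induced-arc-via-bases i j i≢j legᵢ≡₂ legⱼ≡) ab ends , x2 , here refl
        where
        ab : Abutting [ q₁ ] (x2 ∷ (postX ++ reverse postY) ++ [ y ])
        ab u v (here refl) v∈ with ∈-arc-via-bases x2 postX postY y v∈
        ... | inj₁ refl = outside-Q≢ q₁∈Q (leg⇒InΣ i (∈-post {i} legᵢ≡₂ (here refl))) , λ _ → refl , refl
        ... | inj₂ (inj₁ p) = outside-Q≢ q₁∈Q (leg⇒InΣ i (∈-post {i} legᵢ≡₂ (there p))) , λ e → ⊥-elim (none-postX v p e)
        ... | inj₂ (inj₂ (inj₁ p)) = outside-Q≢ q₁∈Q (leg⇒InΣ j (∈-post {j} legⱼ≡ (there p))) , λ e → ⊥-elim (q₁-nonadj-legⱼ (∈-post {j} legⱼ≡ (there p)) e)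
        ... | inj₂ (inj₂ (inj₂ refl)) = outside-Q≢ q₁∈Q (leg⇒InΣ j y∈leg) , λ e → ⊥-elim (q₁-nonadj-legⱼ y∈leg e)
        ends : EndsAdjacent [ q₁ ] (x2 ∷ (postX ++ reverse postY) ++ [ y ])
        ends u v refl refl = ex2
      ac₁₂ : Anticomplete Q⁺ (x1 ∷ reverse preX ++ a ∷ preY)
      ac₁₂ = ac-sym (ac-∷ˡ x1 (reverse preX ++ a ∷ preY) (ac-mono (λ u p → x1⊆leg u p) (λ v p → p) legᵢ-Q⁺-ac)
                    (ac-++ˡ (reverse preX) (a ∷ preY) (ac-reverseˡ preX (ac-mono (λ u p → ∈-pre {i} legᵢ≡₁ p) (λ v p → p) legᵢ-Q⁺-ac))
                      (ac-∷ˡ a preY (ac-mono (λ u p → p) (λ q → Q⁺⊆Q) apex-ac)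
                        (ac-mono (λ u p → p) (λ q → Q⁺⊆Q) (legⱼ-ac preY (λ u p → ∈-pre {j} legⱼ≡ p) none-preY)))))
        where
        x1⊆leg : ∀ u → u ∈ [ x1 ] → u ∈ leg i
        x1⊆leg u (here refl) = preX∷x1⊆leg (inj₂ refl)
      ac₁₃ : Anticomplete Q⁺ (x2 ∷ postX ++ reverse postY)
      ac₁₃ = ac-sym (ac-++ˡ (x2 ∷ postX) (reverse postY) (ac-mono (λ u p → ∈-post {i} legᵢ≡₂ p) (λ v p → p) legᵢ-Q⁺-ac)
                     (ac-reverseˡ postY (ac-mono (λ u p → p) (λ q → Q⁺⊆Q) (legⱼ-ac postY (λ u p → ∈-post {j} legⱼ≡ (there p)) none-postY))))
      ac₂₃ : Anticomplete (x1 ∷ reverse preX ++ a ∷ preY) (x2 ∷ postX ++ reverse postY)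
      ac₂₃ = subst (λ L → Anticomplete (L ++ a ∷ preY) (x2 ∷ postX ++ reverse postY)) (reverse-++ preX [ x1 ])
              (arcs-ac i j i≢j (preX ++ [ x1 ]) midX (x2 ∷ postX) legᵢ≡₃ mid-nonempty preY y postY legⱼ≡)

    arm-via-preY : ∀ preY y1 rest → leg j ≡ preY ++ y1 ∷ rest → E qₘ y1 → (∀ z → z ∈ preY → ¬ E qₘ z)
      → ThetaArm a qₘ (preY ++ [ y1 ])
    arm-via-preY preY y1 rest legⱼ≡ ey1 none-preY =
      induced-++⁺ (a ∷ preY ++ [ y1 ]) [ qₘ ] (induced-apex-pre {j} legⱼ≡) induced-[ _ ] ab ends , y1 , ∈-++⁺ʳ preY (here refl)
      where
      ab : Abutting (a ∷ preY ++ [ y1 ]) [ qₘ ]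
      ab u v (here refl) (here refl) = ≢-sym (outside-Q≢ qₘ∈Q apex-InΣ) , λ e → ⊥-elim (apex-nonadj (outside-Q qₘ qₘ∈Q) e)
      ab u v (there u∈) (here refl) with ∈-++⁻ preY u∈
      ... | inj₁ p = ≢-sym (outside-Q≢ qₘ∈Q (leg⇒InΣ j (∈-pre {j} legⱼ≡ p))) , λ e → ⊥-elim (none-preY u p (E-sym e))
      ... | inj₂ (here refl) = ≢-sym (outside-Q≢ qₘ∈Q (leg⇒InΣ j (∈-post {j} legⱼ≡ (here refl)))) , λ _ → last-∷ʳ (a ∷ preY) y1 , refl
      ends : EndsAdjacent (a ∷ preY ++ [ y1 ]) [ qₘ ]
      ends u v lu refl = subst (λ q → E q qₘ) (just-injective (trans (sym (last-∷ʳ (a ∷ preY) y1)) lu)) (E-sym ey1)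

    arm-via-legₖ : ∀ preY y1 midY y2 postY → (∃ λ w → w ∈ midY) → leg j ≡ preY ++ y1 ∷ midY ++ y2 ∷ postY
      → E qₘ y2 → (∀ z → z ∈ postY → ¬ E qₘ z) → ThetaArm a qₘ (leg k ++ reverse (y2 ∷ postY))
    arm-via-legₖ preY y1 midY y2 postY mid-nonempty legⱼ≡ ey2 none-postY =
      induced-++⁺ (a ∷ leg k ++ reverse (y2 ∷ postY)) [ qₘ ] induced-arc induced-[ _ ] ab ends , b k , ∈-++⁺ˡ (base∈leg k)
      where
      legⱼ≡₂ : leg j ≡ (preY ++ y1 ∷ midY) ++ y2 ∷ postY
      legⱼ≡₂ = trans legⱼ≡ (sym (++-assoc preY (y1 ∷ midY) (y2 ∷ postY)))
      legⱼ≡₃ : leg j ≡ (preY ++ [ y1 ]) ++ midY ++ (y2 ∷ postY)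
      legⱼ≡₃ = trans legⱼ≡ (sym (++-assoc preY [ y1 ] (midY ++ y2 ∷ postY)))
      postY⊆leg : ∀ {v} → v ∈ y2 ∷ postY → v ∈ leg j
      postY⊆leg p = ∈-post {j} legⱼ≡₂ p
      head-back : head (reverse (y2 ∷ postY)) ≡ just (b j)
      head-back = trans (head-reverse (y2 ∷ postY)) (last-post {j} legⱼ≡₂)
      induced-arc : Induced (a ∷ leg k ++ reverse (y2 ∷ postY))
      induced-arc = induced-++⁺ (a ∷ leg k) (reverse (y2 ∷ postY)) (induced-apex∷leg k) (induced-reverse _ (induced-post {j} legⱼ≡₂)) ab′ ends′
        where
        ab′ : Abutting (a ∷ leg k) (reverse (y2 ∷ postY))
        ab′ u v (here refl) v∈ = (λ q → apex∉leg j (subst (_∈ leg j) (sym q) (postY⊆leg (∈-reverse⁻ v∈)))) ,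
          λ e → ⊥-elim (proj₁ (induced-gap⇒ac (preY ++ [ y1 ]) midY (y2 ∷ postY) mid-nonempty (subst Induced legⱼ≡₃ (induced-leg j)) v v
                   (head-leg∈pre {j} legⱼ≡ v (proj₂ (proj₁ (induced-apex∷leg j) v (postY⊆leg (∈-reverse⁻ v∈))) e)) (∈-reverse⁻ v∈)) refl)
        ab′ u v (there u∈) v∈ = legs-distinct k j k≢j u v u∈ (postY⊆leg (∈-reverse⁻ v∈)) ,
          λ e → bases-meet (leg-edge⇒bases k j k≢j u v u∈ (postY⊆leg (∈-reverse⁻ v∈)) e)
          where bases-meet : u ≡ b k × v ≡ b j → last (a ∷ leg k) ≡ just u × head (reverse (y2 ∷ postY)) ≡ just v
                bases-meet (refl , refl) = last-apex∷leg k , head-back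
        ends′ : EndsAdjacent (a ∷ leg k) (reverse (y2 ∷ postY))
        ends′ u v lu hv = subst₂ E (just-injective (trans (sym (last-apex∷leg k)) lu)) (just-injective (trans (sym head-back) hv)) (base-adj k j k≢j)
      last-arc : last (a ∷ leg k ++ reverse (y2 ∷ postY)) ≡ just y2
      last-arc = trans (last-++-nonempty (a ∷ leg k) (reverse (y2 ∷ postY)) (y2 , ∈-reverse⁺ {xs = y2 ∷ postY} (here refl))) (last-reverse (y2 ∷ postY))
      ab : Abutting (a ∷ leg k ++ reverse (y2 ∷ postY)) [ qₘ ]
      ab u v (here refl) (here refl) = ≢-sym (outside-Q≢ qₘ∈Q apex-InΣ) , λ e → ⊥-elim (apex-nonadj (outside-Q qₘ qₘ∈Q) e)
      ab u v (there u∈) (here refl) with ∈-++⁻ (leg k) u∈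
      ... | inj₁ p = ≢-sym (outside-Q≢ qₘ∈Q (leg⇒InΣ k p)) , λ e → ⊥-elim (proj₂ (legₖ-ac k k≢i k≢j u qₘ p qₘ∈Q) e)
      ... | inj₂ p with ∈-reverse⁻ {xs = y2 ∷ postY} p
      ...   | here refl = ≢-sym (outside-Q≢ qₘ∈Q (leg⇒InΣ j (postY⊆leg (here refl)))) , λ _ → last-arc , refl
      ...   | there r = ≢-sym (outside-Q≢ qₘ∈Q (leg⇒InΣ j (postY⊆leg (there r)))) , λ e → ⊥-elim (none-postY u r (E-sym e))
      ends : EndsAdjacent (a ∷ leg k ++ reverse (y2 ∷ postY)) [ qₘ ]
      ends u v lu refl = subst (λ q → E q qₘ) (just-injective (trans (sym last-arc) lu)) (E-sym ey2)

    arm-via-Q : ∀ preX x1 restX → leg i ≡ preX ++ x1 ∷ restX → E q₁ x1 → (∀ z → z ∈ preX → ¬ E q₁ z)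
      → ThetaArm a qₘ (preX ++ x1 ∷ Q⁻)
    arm-via-Q preX x1 restX legᵢ≡ ex1 none-preX =
      subst Induced (cong (a ∷_) (trans (cong ((preX ++ [ x1 ]) ++_) Q≡∷qₘ) (trans (++-assoc preX [ x1 ] (Q⁻ ++ [ qₘ ])) (sym (++-assoc preX (x1 ∷ Q⁻) [ qₘ ])))))
        (induced-++⁺ (a ∷ preX ++ [ x1 ]) Q (induced-apex-pre {i} legᵢ≡) induced-Q ab ends) , x1 , ∈-++⁺ʳ preX (here refl)
      where
      x1∈leg : x1 ∈ leg i
      x1∈leg = ∈-post {i} legᵢ≡ (here refl)
      ab : Abutting (a ∷ preX ++ [ x1 ]) Q
      ab u v (here refl) v∈ = ≢-sym (outside-Q≢ v∈ apex-InΣ) , λ e → ⊥-elim (apex-nonadj (outside-Q v v∈) e)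
      ab u v (there u∈) v∈ with ∈-++⁻ preX u∈
      ... | inj₁ p = ≢-sym (outside-Q≢ v∈ (leg⇒InΣ i (∈-pre {i} legᵢ≡ p))) , λ e → ⊥-elim (proj₂ (legᵢ-ac preX (λ w q → ∈-pre {i} legᵢ≡ q) none-preX u v p v∈) e)
      ... | inj₂ (here refl) = ≢-sym (outside-Q≢ v∈ (leg⇒InΣ i x1∈leg)) , λ e → first-edge (attach u v (leg⇒InΣ i x1∈leg) v∈ e)
        where first-edge : (v ≡ q₁ × u ∈ leg i) ⊎ (v ≡ qₘ × u ∈ leg j) → last (a ∷ preX ++ [ x1 ]) ≡ just u × head Q ≡ just v
              first-edge (inj₁ (refl , _)) = last-∷ʳ (a ∷ preX) x1 , head-Q
              first-edge (inj₂ (_ , p)) = ⊥-elim (legs-distinct i j i≢j u u x1∈leg p refl)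
      ends : EndsAdjacent (a ∷ preX ++ [ x1 ]) Q
      ends u v lu hv = subst₂ E (just-injective (trans (sym (last-∷ʳ (a ∷ preX) x1)) lu)) (just-injective (trans (sym head-Q) hv)) (E-sym ex1)

    theta-any-spread : ∀ preY y1 midY y2 postY → (∃ λ w → w ∈ midY) → leg j ≡ preY ++ y1 ∷ midY ++ y2 ∷ postY → E qₘ y1 → E qₘ y2
       → (∀ z → z ∈ preY → ¬ E qₘ z) → (∀ z → z ∈ postY → ¬ E qₘ z)
       → ∀ preX x1 restX → leg i ≡ preX ++ x1 ∷ restX → E q₁ x1 → (∀ z → z ∈ preX → ¬ E q₁ z) → x1 ≢ b i
       → HasTheta G
    theta-any-spread preY y1 midY y2 postY mid-nonempty legⱼ≡ ey1 ey2 none-preY none-postY preX x1 restX legᵢ≡ ex1 none-preX x1≢b =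
      theta a qₘ (preY ++ [ y1 ]) (leg k ++ reverse (y2 ∷ postY)) (preX ++ x1 ∷ Q⁻) arm₁ arm₂ arm₃ ac₁₂ ac₁₃ ac₂₃
      where
      legⱼ≡₂ : leg j ≡ (preY ++ y1 ∷ midY) ++ y2 ∷ postY
      legⱼ≡₂ = trans legⱼ≡ (sym (++-assoc preY (y1 ∷ midY) (y2 ∷ postY)))
      legⱼ≡₃ : leg j ≡ (preY ++ [ y1 ]) ++ midY ++ (y2 ∷ postY)
      legⱼ≡₃ = trans legⱼ≡ (sym (++-assoc preY [ y1 ] (midY ++ y2 ∷ postY)))
      bⱼ∉preY∷y1 : b j ∉ preY ++ [ y1 ]
      bⱼ∉preY∷y1 = base∉front j (preY ++ [ y1 ]) midY (y2 ∷ postY) legⱼ≡₃ mid-nonempty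
      x1∈leg : x1 ∈ leg i
      x1∈leg = ∈-post {i} legᵢ≡ (here refl)
      postY⊆leg : ∀ {v} → v ∈ y2 ∷ postY → v ∈ leg j
      postY⊆leg p = ∈-post {j} legⱼ≡₂ p
      preY⊆leg : ∀ {v} → v ∈ preY ++ [ y1 ] → v ∈ leg j
      preY⊆leg p = ∈-pre∷ʳ {j} legⱼ≡ p
      arm₁ : ThetaArm a qₘ (preY ++ [ y1 ])
      arm₁ = arm-via-preY preY y1 (midY ++ y2 ∷ postY) legⱼ≡ ey1 none-preY
      arm₂ : ThetaArm a qₘ (leg k ++ reverse (y2 ∷ postY))
      arm₂ = arm-via-legₖ preY y1 midY y2 postY mid-nonempty legⱼ≡ ey2 none-postY
      arm₃ : ThetaArm a qₘ (preX ++ x1 ∷ Q⁻)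
      arm₃ = arm-via-Q preX x1 restX legᵢ≡ ex1 none-preX
      ac₁₂ : Anticomplete (preY ++ [ y1 ]) (leg k ++ reverse (y2 ∷ postY))
      ac₁₂ = ac-++ʳ (leg k) (reverse (y2 ∷ postY)) (legs-ac j k (≢-sym k≢j) (preY ++ [ y1 ]) (leg k) (λ u p → preY⊆leg p) (λ v p → p) bⱼ∉preY∷y1)
              (ac-reverseʳ (y2 ∷ postY) (induced-gap⇒ac (preY ++ [ y1 ]) midY (y2 ∷ postY) mid-nonempty (subst Induced legⱼ≡₃ (induced-leg j))))
      ac₁₃ : Anticomplete (preY ++ [ y1 ]) (preX ++ x1 ∷ Q⁻)
      ac₁₃ = ac-++ʳ preX (x1 ∷ Q⁻) (legs-ac j i (≢-sym i≢j) (preY ++ [ y1 ]) preX (λ u p → preY⊆leg p) (λ v p → ∈-pre {i} legᵢ≡ p) bⱼ∉preY∷y1)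
              (ac-∷ʳ x1 Q⁻ (legs-ac j i (≢-sym i≢j) (preY ++ [ y1 ]) [ x1 ] (λ u p → preY⊆leg p) (λ { v (here refl) → x1∈leg }) bⱼ∉preY∷y1)
                 (ac-mono (λ u p → preY⊆leg p) (λ v p → p) legⱼ-Q⁻-ac))
      bᵢ∉preX : b i ∉ preX
      bᵢ∉preX = base∉pre {i} legᵢ≡
      bᵢ∉[x1] : b i ∉ [ x1 ]
      bᵢ∉[x1] (here e) = x1≢b (sym e)
      ac₂₃ : Anticomplete (leg k ++ reverse (y2 ∷ postY)) (preX ++ x1 ∷ Q⁻)
      ac₂₃ = ac-sym (ac-++ˡ preX (x1 ∷ Q⁻)
              (ac-++ʳ (leg k) (reverse (y2 ∷ postY)) (legs-ac i k (≢-sym k≢i) preX (leg k) (λ u p → ∈-pre {i} legᵢ≡ p) (λ v p → p) bᵢ∉preX)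
                                              (ac-reverseʳ (y2 ∷ postY) (legs-ac i j i≢j preX (y2 ∷ postY) (λ u p → ∈-pre {i} legᵢ≡ p) (λ v p → postY⊆leg p) bᵢ∉preX)))
              (ac-∷ˡ x1 Q⁻
                (ac-++ʳ (leg k) (reverse (y2 ∷ postY)) (legs-ac i k (≢-sym k≢i) [ x1 ] (leg k) (λ { u (here refl) → x1∈leg }) (λ v p → p) bᵢ∉[x1])
                                                (ac-reverseʳ (y2 ∷ postY) (legs-ac i j i≢j [ x1 ] (y2 ∷ postY) (λ { u (here refl) → x1∈leg }) (λ v p → postY⊆leg p) bᵢ∉[x1])))
                (ac-++ʳ (leg k) (reverse (y2 ∷ postY)) (ac-sym (ac-mono (λ u p → p) (λ v p → Q⁻⊆Q p) (legₖ-ac k k≢i k≢j)))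
                                                (ac-reverseʳ (y2 ∷ postY) (ac-sym (ac-mono (λ u p → postY⊆leg p) (λ v p → p) legⱼ-Q⁻-ac))))))

    -- Unless one end of Q sees exactly an edge of its leg, Q and two arcs of Σ form a theta.
    two-legs-case : ∀ x0 → x0 ∈ leg i → E q₁ x0 → x0 ≢ b i → ∀ y0 → y0 ∈ leg j → E qₘ y0
      → Outcome4At i j Q q₁ qₘ ⊎ Outcome4At j i (reverse Q) qₘ q₁
    two-legs-case x0 x0∈leg ex0 x0≢b y0 y0∈leg ey0 = by-cases (attachment q₁ i (x0 , x0∈leg , ex0)) (attachment qₘ j (y0 , y0∈leg , ey0))
      where
      first≢b : ∀ {preX x postX} → leg i ≡ preX ++ x ∷ postX → (∀ z → z ∈ preX → ¬ E q₁ z) → x ≢ b i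
      first≢b legᵢ≡ none-preX = first-nbr≢base {i} legᵢ≡ none-preX x0 x0∈leg ex0 x0≢b
      by-cases : Attachment q₁ i → Attachment qₘ j → Outcome4At i j Q q₁ qₘ ⊎ Outcome4At j i (reverse Q) qₘ q₁
      by-cases _ (edge preY y1 y2 postY legⱼ≡ e1 e2 none-preY none-postY) =
        inj₁ (edge-end-case i j i≢j seg attach x0 x0∈leg ex0 preY y1 y2 postY legⱼ≡ e1 e2 none-preY none-postY)
      by-cases (edge preX x1 x2 postX legᵢ≡ e1 e2 none-preX none-postX) _ =
        inj₂ (edge-end-case j i (≢-sym i≢j) (reverseSegment seg) (endsAttach-reverse i j seg attach) y0 y0∈leg ey0
                preX x1 x2 postX legᵢ≡ e1 e2 none-preX none-postX)
      by-cases (one preX x postX legᵢ≡ ex none-preX none-postX) (one preY y postY legⱼ≡ ey none-preY none-postY) =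
        ⊥-elim (noTheta (theta-one-one preX x postX legᵢ≡ ex none-preX none-postX (first≢b legᵢ≡ none-preX) preY y postY legⱼ≡ ey none-preY none-postY))
      by-cases (spread preX x1 midX x2 postX midX-nonempty legᵢ≡ e1 e2 none-preX none-postX) (one preY y postY legⱼ≡ ey none-preY none-postY) =
        ⊥-elim (noTheta (theta-spread-one preX x1 midX x2 postX midX-nonempty legᵢ≡ e1 e2 none-preX none-postX preY y postY legⱼ≡ ey none-preY none-postY))
      by-cases (one preX x postX legᵢ≡ ex none-preX _) (spread preY y1 midY y2 postY midY-nonempty legⱼ≡ e1 e2 none-preY none-postY) =
        ⊥-elim (noTheta (theta-any-spread preY y1 midY y2 postY midY-nonempty legⱼ≡ e1 e2 none-preY none-postY preX x postX legᵢ≡ ex none-preX (first≢b legᵢ≡ none-preX)))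
      by-cases (spread preX x1 midX x2 postX _ legᵢ≡ ex1 _ none-preX _) (spread preY y1 midY y2 postY midY-nonempty legⱼ≡ e1 e2 none-preY none-postY) =
        ⊥-elim (noTheta (theta-any-spread preY y1 midY y2 postY midY-nonempty legⱼ≡ e1 e2 none-preY none-postY
          preX x1 (midX ++ x2 ∷ postX) legᵢ≡ ex1 none-preX (first≢b legᵢ≡ none-preX)))

  module LegAndBases (i j : Fin 3) (i≢j : i ≢ j) (seg : Segment)
            (q₁-nbrs : ∀ s → InΣ G Py s → E s (Segment.q₁ seg) → s ∈ leg i)
            (later-nbrs : ∀ s q → InΣ G Py s → q ∈ Segment.Q seg → q ≢ Segment.q₁ seg → E s q
                  → s ≡ b i ⊎ (q ≡ Segment.qₘ seg × (s ≡ b j ⊎ s ≡ b (proj₁ (third i j i≢j)))))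
            (x0 : V) (x0∈leg : x0 ∈ leg i) (ex0 : E (Segment.q₁ seg) x0) (x0≢b : x0 ≢ b i)
            (qₘbⱼ : E (Segment.qₘ seg) (b j)) where
    open Segment seg
    open SegmentFacts seg
    open Third i j i≢j

    isPath-reverse-Q : IsPath G (reverse Q)
    isPath-reverse-Q = subst (IsPath G) (sym reverse-Q) (induced⇒isPath qₘ (reverse Q⁻) (subst Induced reverse-Q (induced-reverse Q induced-Q)))

    outside-reverse-Q : ∀ q → q ∈ reverse Q → ¬ InΣ G Py q
    outside-reverse-Q q p = outside-Q q (∈-reverse⁻ p)

    ends-reverse-Q : EndsAt G (reverse Q) qₘ q₁
    ends-reverse-Q = trans (head-reverse Q) last-Q , trans (last-reverse Q) head-Q

    legᵢ-nbr≡q₁ : ∀ u q → u ∈ leg i → u ≢ b i → q ∈ Q → E u q → q ≡ q₁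
    legᵢ-nbr≡q₁ u q uT ub q∈ e with q ≟F q₁
    ... | yes r = r
    ... | no nr with later-nbrs u q (leg⇒InΣ i uT) q∈ nr e
    ...   | inj₁ r = ⊥-elim (ub r)
    ...   | inj₂ (_ , inj₁ r) = ⊥-elim (legs-distinct i j i≢j u (b j) uT (base∈leg j) r)
    ...   | inj₂ (_ , inj₂ r) = ⊥-elim (legs-distinct i k (≢-sym k≢i) u (b k) uT (base∈leg k) r)

    baseⱼ-nbr≡qₘ : ∀ q → q ∈ Q → E (b j) q → q ≡ qₘ
    baseⱼ-nbr≡qₘ q q∈ e with q ≟F q₁
    ... | yes refl = ⊥-elim (legs-distinct i j i≢j (b j) (b j) (q₁-nbrs (b j) (base-InΣ j) e) (base∈leg j) refl)
    ... | no nr with later-nbrs (b j) q (base-InΣ j) q∈ nr e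
    ...   | inj₁ r = ⊥-elim (base-≢ i j i≢j (sym r))
    ...   | inj₂ (r , _) = r

    cornerPath : E qₘ (b k) → CornerPathFor G Py i (reverse Q)
    cornerPath qₘbₖ = isPath-reverse-Q , outside-reverse-Q , qₘ , q₁ , ends-reverse-Q , bs , (x0 , leg⊆path i x0∈leg , x0≢b , ex0) , edges
      where
      bs : ∀ j′ → j′ ≢ i → E qₘ (b j′)
      bs j′ ji with j′ ≟F j
      ... | yes refl = qₘbⱼ
      ... | no nj = subst (λ l → E qₘ (b l)) (sym (third-unique i j i≢j j′ ji nj)) qₘbₖ
      edges : ∀ s r → InΣ G Py s → s ≢ b i → r ∈ reverse Q → E s r →
              (r ≡ qₘ × ∃ λ j′ → (j′ ≢ i × s ≡ b j′)) ⊎ (r ≡ q₁ × s ∈ path i)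
      edges s r s∈Σ sb ri e with r ≟F q₁
      ... | yes refl = inj₂ (refl , leg⊆path i (q₁-nbrs s s∈Σ e))
      ... | no nr with later-nbrs s r s∈Σ (∈-reverse⁻ ri) nr e
      ...   | inj₁ x = ⊥-elim (sb x)
      ...   | inj₂ (rq , inj₁ x) = inj₁ (rq , j , ≢-sym i≢j , x)
      ...   | inj₂ (rq , inj₂ x) = inj₁ (rq , k , k≢i , x)

    module NoCorner (¬qₘbₖ : ¬ E qₘ (b k)) where
      legₖ-nonadj : ∀ u q → u ∈ leg k → q ∈ Q → ¬ E u q
      legₖ-nonadj u q uT q∈ e with q ≟F q₁
      ... | yes refl = legs-distinct k i k≢i u u uT (q₁-nbrs u (leg⇒InΣ k uT) e) refl
      ... | no nr with later-nbrs u q (leg⇒InΣ k uT) q∈ nr e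
      ...   | inj₁ r = legs-distinct k i k≢i u (b i) uT (base∈leg i) r
      ...   | inj₂ (_ , inj₁ r) = legs-distinct k j k≢j u (b j) uT (base∈leg j) r
      ...   | inj₂ (refl , inj₂ refl) = ¬qₘbₖ (E-sym e)

      loaded : E a (b j) → LoadedWith G Py i j k (reverse Q)
      loaded abⱼ = abⱼ , isPath-reverse-Q , outside-reverse-Q , qₘ , q₁ , ends-reverse-Q , qₘbⱼ , (x0 , (leg⊆path i x0∈leg , (λ q → apex∉leg i (subst (_∈ leg i) q x0∈leg)) , x0≢b) , ex0) ,
               pk , pbj , pi
        where
        pk : ∀ s q → s ∈ path k → q ∈ reverse Q → ¬ E s q
        pk s q si q∈ e with path⇒apex⊎leg k si
        ... | inj₁ refl = apex-nonadj (outside-Q q (∈-reverse⁻ q∈)) e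
        ... | inj₂ p = legₖ-nonadj s q p (∈-reverse⁻ q∈) e
        pbj : ∀ q → q ∈ reverse Q → q ≢ qₘ → ¬ E (b j) q
        pbj q q∈ none e = none (baseⱼ-nbr≡qₘ q (∈-reverse⁻ q∈) e)
        pi : ∀ s q → s ∈ path i → s ≢ b i → q ∈ reverse Q → q ≢ q₁ → ¬ E s q
        pi s q si sb q∈ none e with path⇒apex⊎leg i si
        ... | inj₁ refl = apex-nonadj (outside-Q q (∈-reverse⁻ q∈)) e
        ... | inj₂ p = none (legᵢ-nbr≡q₁ s q p sb (∈-reverse⁻ q∈) e)

      arm-via-legₖ : ¬ E a (b j) → ThetaArm a (b j) (leg k)
      arm-via-legₖ ¬abⱼ = induced-++⁺ (a ∷ leg k) [ b j ] (induced-apex∷leg k) induced-[ _ ] ab ends , b k , base∈leg k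
        where
        ab : Abutting (a ∷ leg k) [ b j ]
        ab u v (here refl) (here refl) = (λ r → base≢apex j (sym r)) , λ e′ → ⊥-elim (¬abⱼ e′)
        ab u v (there p) (here refl) = legs-distinct k j k≢j u (b j) p (base∈leg j) ,
          λ e′ → subst (λ q → last (a ∷ leg k) ≡ just q) (sym (proj₁ (leg-edge⇒bases k j k≢j u (b j) p (base∈leg j) e′))) (last-apex∷leg k) , refl
        ends : EndsAdjacent (a ∷ leg k) [ b j ]
        ends u v lu refl = subst (λ q → E q (b j)) (just-injective (trans (sym (last-apex∷leg k)) lu)) (base-adj k j k≢j)

      arm-via-Q : ¬ E a (b j) → ∀ preX x1 restX → leg i ≡ preX ++ x1 ∷ restX → E q₁ x1 → (∀ z → z ∈ preX → ¬ E q₁ z) → x1 ≢ b i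
        → ThetaArm a (b j) (preX ++ x1 ∷ Q)
      arm-via-Q ¬abⱼ preX x1 restX legᵢ≡ ex1 none-preX x1≢b = arm₃
        where
        x1∈leg : x1 ∈ leg i
        x1∈leg = ∈-post {i} legᵢ≡ (here refl)
        bᵢ∉preX : b i ∉ preX ++ [ x1 ]
        bᵢ∉preX p with ∈-++⁻ preX p
        ... | inj₁ q = base∉pre {i} legᵢ≡ q
        ... | inj₂ (here r) = x1≢b (sym r)
        preX⊆leg : ∀ {v} → v ∈ preX ++ [ x1 ] → v ∈ leg i
        preX⊆leg p = ∈-pre∷ʳ {i} legᵢ≡ p
        induced-via-Q : Induced ((a ∷ preX ++ [ x1 ]) ++ Q)
        induced-via-Q = induced-++⁺ (a ∷ preX ++ [ x1 ]) Q (induced-apex-pre {i} legᵢ≡) induced-Q ab ends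
          where
          ab : Abutting (a ∷ preX ++ [ x1 ]) Q
          ab u v (here refl) v∈ = ≢-sym (outside-Q≢ v∈ apex-InΣ) , λ e → ⊥-elim (apex-nonadj (outside-Q v v∈) e)
          ab u v (there u∈) v∈ with ∈-++⁻ preX u∈
          ... | inj₁ p = ≢-sym (outside-Q≢ v∈ (leg⇒InΣ i (∈-pre {i} legᵢ≡ p))) ,
                λ e → ⊥-elim (none-preX u p (subst (λ q → E q u)
                        (legᵢ-nbr≡q₁ u v (∈-pre {i} legᵢ≡ p) (λ r → base∉pre {i} legᵢ≡ (subst (_∈ preX) r p)) v∈ e) (E-sym e)))
          ... | inj₂ (here refl) = ≢-sym (outside-Q≢ v∈ (leg⇒InΣ i x1∈leg)) ,
                λ e → last-∷ʳ (a ∷ preX) x1 , trans head-Q (cong just (sym (legᵢ-nbr≡q₁ u v x1∈leg x1≢b v∈ e)))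
          ends : EndsAdjacent (a ∷ preX ++ [ x1 ]) Q
          ends u v lu hv = subst₂ E (just-injective (trans (sym (last-∷ʳ (a ∷ preX) x1)) lu)) (just-injective (trans (sym head-Q) hv)) (E-sym ex1)
        last-via-Q : last ((a ∷ preX ++ [ x1 ]) ++ Q) ≡ just qₘ
        last-via-Q = trans (last-++-nonempty (a ∷ preX ++ [ x1 ]) Q (qₘ , qₘ∈Q)) last-Q
        arm₃ : ThetaArm a (b j) (preX ++ x1 ∷ Q)
        arm₃ = subst Induced (cong (λ L → a ∷ (L ++ [ b j ])) (++-assoc preX [ x1 ] Q))
               (induced-++⁺ ((a ∷ preX ++ [ x1 ]) ++ Q) [ b j ] induced-via-Q induced-[ _ ] ab ends) , x1 , ∈-++⁺ʳ preX (here refl)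
          where
          ab : Abutting ((a ∷ preX ++ [ x1 ]) ++ Q) [ b j ]
          ab u v u∈ (here refl) with ∈-++⁻ (a ∷ preX ++ [ x1 ]) u∈
          ... | inj₁ (here refl) = (λ r → base≢apex j (sym r)) , λ e → ⊥-elim (¬abⱼ e)
          ... | inj₁ (there p) = legs-distinct i j i≢j u (b j) (preX⊆leg p) (base∈leg j) ,
                λ e → ⊥-elim (bᵢ∉preX (subst (_∈ preX ++ [ x1 ]) (proj₁ (leg-edge⇒bases i j i≢j u (b j) (preX⊆leg p) (base∈leg j) e)) p))
          ... | inj₂ p = outside-Q≢ p (base-InΣ j) , λ e → subst (λ q → last ((a ∷ preX ++ [ x1 ]) ++ Q) ≡ just q) (sym (baseⱼ-nbr≡qₘ u p (E-sym e))) last-via-Q , refl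
          ends : EndsAdjacent ((a ∷ preX ++ [ x1 ]) ++ Q) [ b j ]
          ends u v lu refl = subst (λ q → E q (b j)) (just-injective (trans (sym last-via-Q) lu)) qₘbⱼ

      theta-from-base : ¬ E a (b j) → HasTheta G
      theta-from-base ¬abⱼ with ∈-∃++ (base∈leg j)
      ... | preB0 , postB0 , legⱼ≡ with first-satisfying (E? q₁) (leg i) (x0 , x0∈leg , ex0)
      ...   | preX , x1 , restX , legᵢ≡ , ex1 , none-preX = go preB0 postB0 legⱼ≡
        where
        x1≢b : x1 ≢ b i
        x1≢b = first-nbr≢base {i} legᵢ≡ none-preX x0 x0∈leg ex0 x0≢b
        x1∈leg : x1 ∈ leg i
        x1∈leg = ∈-post {i} legᵢ≡ (here refl)
        go : ∀ preB postB → leg j ≡ preB ++ b j ∷ postB → HasTheta G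
        go preB (p ∷ ps) e = ⊥-elim (induced-last≢head (b j) (p ∷ ps) (induced-post {j} e) (p , here refl) (last-post {j} e))
        go [] [] e = ⊥-elim (¬abⱼ (apex-adj-head j (b j) (cong head e)))
        go (p0 ∷ ps) [] e = theta a (b j) (p0 ∷ ps) (leg k) (preX ++ x1 ∷ Q) arm₁ (arm-via-legₖ ¬abⱼ)
            (arm-via-Q ¬abⱼ preX x1 restX legᵢ≡ ex1 none-preX x1≢b) ac₁₂ ac₁₃ ac₂₃
          where
          preB : List V
          preB = p0 ∷ ps
          bⱼ∉preB : b j ∉ preB
          bⱼ∉preB = base∉pre {j} e
          preB⊆leg : ∀ {v} → v ∈ preB → v ∈ leg j
          preB⊆leg p = ∈-pre {j} e p
          arm₁ : ThetaArm a (b j) preB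
          arm₁ = subst Induced (cong (a ∷_) e) (induced-apex∷leg j) , p0 , here refl
          preB-Q-ac : Anticomplete preB Q
          preB-Q-ac u q u∈ q∈ = u≢q , λ e′ → by-attach (q ≟F q₁) e′
            where
            u≢q : u ≢ q
            u≢q r = outside-Q≢ q∈ (leg⇒InΣ j (preB⊆leg u∈)) (sym r)
            by-attach : Dec (q ≡ q₁) → E u q → ⊥
            by-attach (yes refl) e′ = legs-distinct i j i≢j u u (q₁-nbrs u (leg⇒InΣ j (preB⊆leg u∈)) e′) (preB⊆leg u∈) refl
            by-attach (no nr) e′ with later-nbrs u q (leg⇒InΣ j (preB⊆leg u∈)) q∈ nr e′
            ... | inj₁ r = legs-distinct j i (≢-sym i≢j) u (b i) (preB⊆leg u∈) (base∈leg i) r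
            ... | inj₂ (_ , inj₁ r) = bⱼ∉preB (subst (_∈ preB) r u∈)
            ... | inj₂ (_ , inj₂ r) = legs-distinct j k (≢-sym k≢j) u (b k) (preB⊆leg u∈) (base∈leg k) r
          ac₁₂ : Anticomplete preB (leg k)
          ac₁₂ = legs-ac j k (≢-sym k≢j) preB (leg k) (λ u p → preB⊆leg p) (λ v p → p) bⱼ∉preB
          ac₁₃ : Anticomplete preB (preX ++ x1 ∷ Q)
          ac₁₃ = ac-++ʳ preX (x1 ∷ Q) (legs-ac j i (≢-sym i≢j) preB preX (λ u p → preB⊆leg p) (λ v p → ∈-pre {i} legᵢ≡ p) bⱼ∉preB)
                  (ac-∷ʳ x1 Q (legs-ac j i (≢-sym i≢j) preB [ x1 ] (λ u p → preB⊆leg p) (λ { v (here refl) → x1∈leg }) bⱼ∉preB) preB-Q-ac)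
          ac₂₃ : Anticomplete (leg k) (preX ++ x1 ∷ Q)
          ac₂₃ = ac-++ʳ preX (x1 ∷ Q) (ac-sym (legs-ac i k (≢-sym k≢i) preX (leg k) (λ u p → ∈-pre {i} legᵢ≡ p) (λ v p → p) (base∉pre {i} legᵢ≡)))
                  (ac-∷ʳ x1 Q (ac-sym (legs-ac i k (≢-sym k≢i) [ x1 ] (leg k) (λ { u (here refl) → x1∈leg }) (λ v p → p) (λ { (here r) → x1≢b (sym r) })))
                    (λ u q u∈ q∈ → (λ r → outside-Q≢ q∈ (leg⇒InΣ k u∈) (sym r)) , legₖ-nonadj u q u∈ q∈))

    -- If qₘ does not see b k then Σ-neighbours of Q lie in P i ∪ {b j}; reading Q from qₘ, this makes
    -- (Σ, Q) a loaded pyramid when a is adjacent to b j, and yields a theta with ends a, b j otherwise.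
    leg-and-bases-case : CornerPathFor G Py i (reverse Q) ⊎ LoadedWith G Py i j k (reverse Q)
    leg-and-bases-case with E? qₘ (b k)
    ... | yes qₘbₖ = inj₁ (cornerPath qₘbₖ)
    ... | no ¬qₘbₖ with E? a (b j)
    ...   | yes abⱼ = inj₂ (NoCorner.loaded ¬qₘbₖ abⱼ)
    ...   | no ¬abⱼ = ⊥-elim (noTheta (NoCorner.theta-from-base ¬qₘbₖ ¬abⱼ))


  InΣ? : ∀ s → Dec (InΣ G Py s)
  InΣ? s = any? (λ i → s ∈? P i)

  NΣ-of : List V → V → Set
  NΣ-of L = NΣ G Py (_∈ L)

  NΣ-of? : ∀ L v → Dec (NΣ-of L v)
  NΣ-of? L v = InΣ? v ×-dec (¬? (v ∈? L) ×-dec any-∈? (E? v) L)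

  LocalNbhd : List V → Set
  LocalNbhd L = Local G Py (NΣ-of L)

  localNbhd? : ∀ L → Dec (LocalNbhd L)
  localNbhd? L = any? (λ i → all? (λ v → NΣ-of? L v →-dec v ∈? P i)) ⊎-dec all? (λ v → NΣ-of? L v →-dec any? (λ i → v ≟F b i))

  local-mono : ∀ {X Y : V → Set} → (∀ v → Y v → X v) → Local G Py X → Local G Py Y
  local-mono Y⊆X (inj₁ (i , X⊆P)) = inj₁ (i , λ v y → X⊆P v (Y⊆X v y))
  local-mono Y⊆X (inj₂ X⊆B) = inj₂ λ v y → X⊆B v (Y⊆X v y)

  AllOutside : List V → Set
  AllOutside L = ∀ v → v ∈ L → Outside v

  mk-NΣ-of : ∀ {L v x} → AllOutside L → InΣ G Py v → x ∈ L → E v x → NΣ-of L v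
  mk-NΣ-of outside v∈Σ x∈ e = v∈Σ , (λ v∈ → outside _ v∈ v∈Σ) , _ , x∈ , e

  localNbhd-mono : ∀ {L L′} → AllOutside L → (∀ v → v ∈ L′ → v ∈ L) → LocalNbhd L → LocalNbhd L′
  localNbhd-mono outside L′⊆L = local-mono λ { v (v∈Σ , _ , x , x∈ , e) → mk-NΣ-of outside v∈Σ (L′⊆L x x∈) e }

  nbr-off-path : ∀ L i → ¬ LocalNbhd L → ∃ λ v → NΣ-of L v × v ∉ P i
  nbr-off-path L i nonlocal with ¬∀⟶∃¬ n _ (λ v → NΣ-of? L v →-dec v ∈? P i) (λ N⊆P → nonlocal (inj₁ (i , N⊆P)))
  ... | v , N⊈P = v , ¬→⇒×¬ (NΣ-of? L v) N⊈P

  nbr-off-base : ∀ L → ¬ LocalNbhd L → ∃ λ v → NΣ-of L v × ¬ (∃ λ l → v ≡ b l)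
  nbr-off-base L nonlocal with ¬∀⟶∃¬ n _ (λ v → NΣ-of? L v →-dec any? (λ l → v ≟F b l)) (λ N⊆B → nonlocal (inj₂ N⊆B))
  ... | v , N⊈B = v , ¬→⇒×¬ (NΣ-of? L v) N⊈B

  NonlocalSuffix : List V → Set
  NonlocalSuffix L = Σ (List V) λ A → Σ V λ r → Σ (List V) λ R → L ≡ A ++ r ∷ R × ¬ LocalNbhd (r ∷ R) × (R ≡ [] ⊎ LocalNbhd R)

  nonlocal-suffix : ∀ L → ¬ LocalNbhd L → (∃ λ w → w ∈ L) → NonlocalSuffix L
  nonlocal-suffix (x ∷ []) nonlocal _ = [] , x , [] , refl , nonlocal , inj₁ refl
  nonlocal-suffix (x ∷ y ∷ L) nonlocal _ = extend (localNbhd? (y ∷ L)) (λ nonlocal′ → nonlocal-suffix (y ∷ L) nonlocal′ (y , here refl))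
    where
    extend : Dec (LocalNbhd (y ∷ L)) → (¬ LocalNbhd (y ∷ L) → NonlocalSuffix (y ∷ L)) → NonlocalSuffix (x ∷ y ∷ L)
    extend (yes local) _ = [] , x , y ∷ L , refl , nonlocal , inj₂ local
    extend (no nonlocal′) suffix with suffix nonlocal′
    ... | A , r , R , e , nonlocal-r∷R , R-local = x ∷ A , r , R , cong (x ∷_) e , nonlocal-r∷R , R-local

  data MinimalNonlocal (P : List V) : Set where
    vertex : ∀ q → q ∈ P → ¬ LocalNbhd [ q ] → MinimalNonlocal P
    segment : (seg : Segment) → Subpath G (Segment.Q seg) P
      → LocalNbhd (Segment.Q⁻ seg) → LocalNbhd (Segment.Q⁺ seg) → ¬ LocalNbhd (Segment.Q seg) → MinimalNonlocal P

  -- Shrink P from the front to the shortest non-local suffix r ∷ R, then shrink reverse (r ∷ R) the same way.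
  minimal-nonlocal : ∀ P → IsPath G P → AllOutside P → ¬ LocalNbhd P → MinimalNonlocal P
  minimal-nonlocal P@(p ∷ _) isPath outside nonlocal with nonlocal-suffix P nonlocal (p , here refl)
  ... | A , r , R , P≡ , nonlocal-r∷R , R-local =
    shrink (nonlocal-suffix (reverse (r ∷ R)) nonlocal-rev (r , ∈-reverse⁺ {xs = r ∷ R} (here refl)))
    where
    ⊆P : ∀ {v} → v ∈ r ∷ R → v ∈ P
    ⊆P v∈ = subst (_ ∈_) (sym P≡) (∈-++⁺ʳ A v∈)
    outside-rev : AllOutside (reverse (r ∷ R))
    outside-rev v v∈ = outside v (⊆P (∈-reverse⁻ v∈))
    nonlocal-rev : ¬ LocalNbhd (reverse (r ∷ R))
    nonlocal-rev local = nonlocal-r∷R (localNbhd-mono outside-rev (λ v v∈ → ∈-reverse⁺ v∈) local)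
    induced-rev : Induced (reverse (r ∷ R))
    induced-rev = induced-reverse (r ∷ R) (proj₁ (proj₂ (induced-++⁻ A (r ∷ R) (subst Induced P≡ (isPath⇒induced P isPath)))))
    local-init : ∀ R′ Q⁻ → (∀ v → v ∈ Q⁻ → v ∈ reverse R′) → (∀ v → v ∈ R′ → v ∈ P) → (R′ ≡ [] ⊎ LocalNbhd R′) → LocalNbhd Q⁻
    local-init .[] Q⁻ Q⁻⊆ _ (inj₁ refl) = inj₂ λ { v (_ , _ , x , x∈ , _) → ⊥-elim (∉[] (Q⁻⊆ x x∈)) }
      where ∉[] : ∀ {x : V} → x ∉ []
            ∉[] ()
    local-init R′ Q⁻ Q⁻⊆ R′⊆P (inj₂ local) = localNbhd-mono (λ v v∈ → outside v (R′⊆P v v∈)) (λ v v∈ → ∈-reverse⁻ (Q⁻⊆ v v∈)) local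
    shrink : NonlocalSuffix (reverse (r ∷ R)) → MinimalNonlocal P
    shrink (B , q , [] , e , nonlocal-q , _) = vertex q (⊆P (∈-reverse⁻ (subst (_ ∈_) (sym e) (∈-++⁺ʳ B (here refl))))) nonlocal-q
    shrink (B , q , s ∷ S , e , _ , inj₁ ())
    shrink (B , q₁ , s ∷ S , e , nonlocal-Q , inj₂ local-Q⁺)
      with init-of-suffix B (q₁ ∷ s ∷ S) (reverse R) r (trans (sym e) (unfold-reverse r R)) (q₁ , here refl)
    ... | Q⁻ , Q≡ , Q⁻⊆ = segment seg sub (local-init R Q⁻ Q⁻⊆ (λ v v∈ → ⊆P (there v∈)) R-local) local-Q⁺ nonlocal-Q
      where
      Q = q₁ ∷ s ∷ S
      Q⊆P : ∀ {v} → v ∈ Q → v ∈ P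
      Q⊆P v∈ = ⊆P (∈-reverse⁻ (subst (_ ∈_) (sym e) (∈-++⁺ʳ B v∈)))
      seg : Segment
      seg = record { Q = Q ; q₁ = q₁ ; qₘ = r ; Q⁺ = s ∷ S ; Q⁻ = Q⁻ ; Q≡q₁∷ = refl ; Q≡∷qₘ = Q≡ ; Q⁺-nonempty = s , here refl
                   ; induced-Q = proj₁ (proj₂ (induced-++⁻ B Q (subst Induced e induced-rev))) ; outside-Q = λ v v∈ → outside v (Q⊆P v∈) }
      r∷R≡ : r ∷ R ≡ reverse Q ++ reverse B
      r∷R≡ = trans (sym (reverse-involutive (r ∷ R))) (trans (cong reverse e) (reverse-++ B Q))
      sub : Subpath G Q P
      sub = inj₂ (subst (Infix _≡_ (reverse Q)) (sym (trans P≡ (cong (A ++_) r∷R≡))) (infix-++ A (reverse Q) (reverse B)))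

  Conclusion : List V → Set
  Conclusion P = Local G Py (NΣ G Py (_∈ P))
    ⊎ (∃[ v ] (v ∈ P × Major G Py v))
    ⊎ (∃[ R ] (Subpath G R P × CornerPath G Py R))
    ⊎ Outcome4 G Py P
    ⊎ Outcome5 G Py P

  module Conclude (PP : List V) where

    sub-reverse : ∀ L → Subpath G L PP → Subpath G (reverse L) PP
    sub-reverse L (inj₁ inf) = inj₂ (subst (λ X → Infix _≡_ X PP) (sym (reverse-involutive L)) inf)
    sub-reverse L (inj₂ inf) = inj₁ inf

    by-outcome4 : ∀ {i j} → i ≢ j → (seg : Segment) → Subpath G (Segment.Q seg) PP
      → Outcome4At i j (Segment.Q seg) (Segment.q₁ seg) (Segment.qₘ seg) ⊎ Outcome4At j i (reverse (Segment.Q seg)) (Segment.qₘ seg) (Segment.q₁ seg)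
      → Conclusion PP
    by-outcome4 {i} {j} i≢j seg sub (inj₁ o) = inj₂ (inj₂ (inj₂ (inj₁ (i , j , i≢j , _ , _ , _ , sub , o))))
    by-outcome4 {i} {j} i≢j seg sub (inj₂ o) = inj₂ (inj₂ (inj₂ (inj₁ (j , i , ≢-sym i≢j , _ , _ , _ , sub-reverse _ sub , o))))

    by-corner : ∀ i L → Subpath G L PP → CornerPathFor G Py i L → Conclusion PP
    by-corner i L sub corner = inj₂ (inj₂ (inj₁ (L , sub , i , corner)))

    by-outcome5 : ∀ {i j} (i≢j : i ≢ j) L → Subpath G L PP → LoadedWith G Py i j (proj₁ (third i j i≢j)) L → Conclusion PP
    by-outcome5 {i} {j} i≢j L sub loaded with third i j i≢j
    ... | k , k≢i , k≢j = inj₂ (inj₂ (inj₂ (inj₂ (j , i , k , ≢-sym i≢j , ≢-sym k≢i , ≢-sym k≢j , L , sub , loaded))))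

    module Cases (seg : Segment) (sub : Subpath G (Segment.Q seg) PP) where
      open Segment seg
      open SegmentFacts seg

      NΣ-of-split : ∀ v → NΣ-of Q v → NΣ-of Q⁻ v ⊎ NΣ-of Q⁺ v
      NΣ-of-split v (v∈Σ , v∉Q , x , x∈ , e) with ∈Q⇒Q⁻⊎qₘ x∈
      ... | inj₁ x∈Q⁻ = inj₁ (v∈Σ , (λ v∈ → v∉Q (Q⁻⊆Q v∈)) , x , x∈Q⁻ , e)
      ... | inj₂ refl = inj₂ (v∈Σ , (λ v∈ → v∉Q (Q⁺⊆Q v∈)) , qₘ , qₘ∈Q⁺ , e)

      outside-Q⁻ : AllOutside Q⁻
      outside-Q⁻ v v∈ = outside-Q v (Q⁻⊆Q v∈)

      outside-Q⁺ : AllOutside Q⁺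
      outside-Q⁺ v v∈ = outside-Q v (Q⁺⊆Q v∈)

      q₁-nbr∈leg : ∀ i → (∀ v → NΣ-of Q⁻ v → v ∈ P i) → ∀ s → InΣ G Py s → E s q₁ → s ∈ leg i
      q₁-nbr∈leg i N⁻⊆Pᵢ s s∈Σ e with path⇒apex⊎leg i (N⁻⊆Pᵢ s (mk-NΣ-of outside-Q⁻ s∈Σ q₁∈Q⁻ e))
      ... | inj₁ refl = ⊥-elim (apex-nonadj (outside-Q q₁ q₁∈Q) e)
      ... | inj₂ s∈leg = s∈leg

      later-nbrs : ∀ i j (i≢j : i ≢ j) → (∀ v → NΣ-of Q⁻ v → v ∈ P i) → (∀ v → NΣ-of Q⁺ v → ∃ λ l → v ≡ b l)
        → ∀ s q → InΣ G Py s → q ∈ Q → q ≢ q₁ → E s q → s ≡ b i ⊎ (q ≡ qₘ × (s ≡ b j ⊎ s ≡ b (proj₁ (third i j i≢j))))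
      later-nbrs i j i≢j N⁻⊆Pᵢ N⁺⊆B s q s∈Σ q∈ q≢q₁ e with ∈Q⇒q₁⊎Q⁺ q∈
      ... | inj₁ q≡q₁ = ⊥-elim (q≢q₁ q≡q₁)
      ... | inj₂ q∈Q⁺ with N⁺⊆B s (mk-NΣ-of outside-Q⁺ s∈Σ q∈Q⁺ e)
      ...   | l , refl with ∈Q⇒Q⁻⊎qₘ q∈
      ...     | inj₁ q∈Q⁻ = inj₁ (cong b (base∈path⇒≡ l (N⁻⊆Pᵢ (b l) (mk-NΣ-of outside-Q⁻ s∈Σ q∈Q⁻ e))))
      ...     | inj₂ refl with l ≟F i | l ≟F j
      ...       | yes l≡i | _ = inj₁ (cong b l≡i)
      ...       | no _ | yes l≡j = inj₂ (refl , inj₁ (cong b l≡j))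
      ...       | no l≢i | no l≢j = inj₂ (refl , inj₂ (cong b (third-unique i j i≢j l l≢i l≢j)))

      leg-and-base : ∀ i j → j ≢ i → (∀ v → NΣ-of Q⁻ v → v ∈ P i) → (∀ v → NΣ-of Q⁺ v → ∃ λ l → v ≡ b l)
        → ¬ LocalNbhd Q → E qₘ (b j) → Conclusion PP
      leg-and-base i j j≢i N⁻⊆Pᵢ N⁺⊆B nonlocal qₘbⱼ with nbr-off-base Q nonlocal
      ... | v , (v∈Σ , _ , q , q∈ , e) , v∉B with ∈Q⇒q₁⊎Q⁺ q∈
      ...   | inj₂ q∈Q⁺ = ⊥-elim (v∉B (N⁺⊆B v (mk-NΣ-of outside-Q⁺ v∈Σ q∈Q⁺ e)))
      ...   | inj₁ refl with LegAndBases.leg-and-bases-case i j (≢-sym j≢i) seg (q₁-nbr∈leg i N⁻⊆Pᵢ) (later-nbrs i j (≢-sym j≢i) N⁻⊆Pᵢ N⁺⊆B)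
                               v (q₁-nbr∈leg i N⁻⊆Pᵢ v v∈Σ e) (E-sym e) (λ v≡b → v∉B (i , v≡b)) qₘbⱼ
      ...     | inj₁ corner = by-corner i (reverse Q) (sub-reverse Q sub) corner
      ...     | inj₂ loaded = by-outcome5 (≢-sym j≢i) (reverse Q) (sub-reverse Q sub) loaded

      leg-and-bases : ∀ i → (∀ v → NΣ-of Q⁻ v → v ∈ P i) → (∀ v → NΣ-of Q⁺ v → ∃ λ l → v ≡ b l) → ¬ LocalNbhd Q → Conclusion PP
      leg-and-bases i N⁻⊆Pᵢ N⁺⊆B nonlocal with nbr-off-path Q i nonlocal
      ... | w , (w∈Σ , _ , q , q∈ , e) , w∉Pᵢ with ∈Q⇒Q⁻⊎qₘ q∈
      ...   | inj₁ q∈Q⁻ = ⊥-elim (w∉Pᵢ (N⁻⊆Pᵢ w (mk-NΣ-of outside-Q⁻ w∈Σ q∈Q⁻ e)))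
      ...   | inj₂ refl with N⁺⊆B w (mk-NΣ-of outside-Q⁺ w∈Σ qₘ∈Q⁺ e)
      ...     | j , refl with j ≟F i
      ...       | yes refl = ⊥-elim (w∉Pᵢ (base∈path i))
      ...       | no j≢i = leg-and-base i j j≢i N⁻⊆Pᵢ N⁺⊆B nonlocal (E-sym e)

      two-legs-attach : ∀ i j → i ≢ j → (∀ v → NΣ-of Q⁻ v → v ∈ P i) → (∀ v → NΣ-of Q⁺ v → v ∈ P j) → EndsAttach i j seg
      two-legs-attach i j i≢j N⁻⊆Pᵢ N⁺⊆Pⱼ s q s∈Σ q∈ e with ∈Q⇒q₁⊎Q⁺ q∈
      ... | inj₁ refl = inj₁ (refl , q₁-nbr∈leg i N⁻⊆Pᵢ s s∈Σ e)
      ... | inj₂ q∈Q⁺ with ∈Q⇒Q⁻⊎qₘ q∈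
      ...   | inj₂ refl with path⇒apex⊎leg j (N⁺⊆Pⱼ s (mk-NΣ-of outside-Q⁺ s∈Σ qₘ∈Q⁺ e))
      ...     | inj₁ refl = ⊥-elim (apex-nonadj (outside-Q qₘ qₘ∈Q) e)
      ...     | inj₂ s∈leg = inj₂ (refl , s∈leg)
      two-legs-attach i j i≢j N⁻⊆Pᵢ N⁺⊆Pⱼ s q s∈Σ q∈ e | inj₂ q∈Q⁺ | inj₁ q∈Q⁻
        with path⇒apex⊎leg i (N⁻⊆Pᵢ s (mk-NΣ-of outside-Q⁻ s∈Σ q∈Q⁻ e))
      ... | inj₁ refl = ⊥-elim (apex-nonadj (outside-Q q q∈) e)
      ... | inj₂ s∈leg = ⊥-elim (leg∉path j i (≢-sym i≢j) s s∈leg (N⁺⊆Pⱼ s (mk-NΣ-of outside-Q⁺ s∈Σ q∈Q⁺ e)))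

      two-legs : ∀ i j → (∀ v → NΣ-of Q⁻ v → v ∈ P i) → (∀ v → NΣ-of Q⁺ v → v ∈ P j) → ¬ LocalNbhd Q → Conclusion PP
      two-legs i j N⁻⊆Pᵢ N⁺⊆Pⱼ nonlocal with i ≟F j
      ... | yes refl = ⊥-elim (nonlocal (inj₁ (i , λ v v∈N → [ N⁻⊆Pᵢ v , N⁺⊆Pⱼ v ]′ (NΣ-of-split v v∈N))))
      ... | no i≢j = from-nonbase (nbr-off-base Q nonlocal)
        where
        attach = two-legs-attach i j i≢j N⁻⊆Pᵢ N⁺⊆Pⱼ
        from-nonbase : (∃ λ v → NΣ-of Q v × ¬ (∃ λ l → v ≡ b l)) → Conclusion PP
        from-nonbase (v , (v∈Σ , _ , q , q∈ , e) , v∉B) with attach v q v∈Σ q∈ e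
        ... | inj₁ (refl , v∈legᵢ) with nbr-off-path Q i nonlocal
        ...   | w , (w∈Σ , _ , q′ , q′∈ , e′) , w∉Pᵢ with attach w q′ w∈Σ q′∈ e′
        ...     | inj₁ (_ , w∈legᵢ) = ⊥-elim (w∉Pᵢ (leg⊆path i w∈legᵢ))
        ...     | inj₂ (refl , w∈legⱼ) = by-outcome4 i≢j seg sub
                    (TwoLegs.two-legs-case i j i≢j seg attach v v∈legᵢ (E-sym e) (λ v≡b → v∉B (i , v≡b)) w w∈legⱼ (E-sym e′))
        from-nonbase (v , (v∈Σ , _ , q , q∈ , e) , v∉B) | inj₂ (refl , v∈legⱼ) with nbr-off-path Q j nonlocal
        ...   | w , (w∈Σ , _ , q′ , q′∈ , e′) , w∉Pⱼ with attach w q′ w∈Σ q′∈ e′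
        ...     | inj₂ (_ , w∈legⱼ) = ⊥-elim (w∉Pⱼ (leg⊆path j w∈legⱼ))
        ...     | inj₁ (refl , w∈legᵢ) = by-outcome4 (≢-sym i≢j) (reverseSegment seg) (sub-reverse Q sub)
                    (TwoLegs.two-legs-case j i (≢-sym i≢j) (reverseSegment seg) (endsAttach-reverse i j seg attach)
                       v v∈legⱼ (E-sym e) (λ v≡b → v∉B (j , v≡b)) w w∈legᵢ (E-sym e′))

    minimal-nonlocal-case : (seg : Segment) → Subpath G (Segment.Q seg) PP → LocalNbhd (Segment.Q⁻ seg) → LocalNbhd (Segment.Q⁺ seg)
      → ¬ LocalNbhd (Segment.Q seg) → Conclusion PP
    minimal-nonlocal-case seg sub (inj₁ (i , N⁻⊆Pᵢ)) (inj₁ (j , N⁺⊆Pⱼ)) = Cases.two-legs seg sub i j N⁻⊆Pᵢ N⁺⊆Pⱼ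
    minimal-nonlocal-case seg sub (inj₁ (i , N⁻⊆Pᵢ)) (inj₂ N⁺⊆B) = Cases.leg-and-bases seg sub i N⁻⊆Pᵢ N⁺⊆B
    minimal-nonlocal-case seg sub (inj₂ N⁻⊆B) (inj₁ (j , N⁺⊆Pⱼ)) nonlocal =
      Cases.leg-and-bases (reverseSegment seg) (sub-reverse (Segment.Q seg) sub) j
        (λ v v∈N → N⁺⊆Pⱼ v (NΣ-of-mono (Cases.outside-Q⁺ seg sub) v v∈N))
        (λ v v∈N → N⁻⊆B v (NΣ-of-mono (Cases.outside-Q⁻ seg sub) v v∈N))
        (λ local → nonlocal (localNbhd-mono (λ v v∈ → Segment.outside-Q seg v (∈-reverse⁻ v∈)) (λ v v∈ → ∈-reverse⁺ v∈) local))
      where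
      NΣ-of-mono : ∀ {L} → AllOutside L → ∀ v → NΣ-of (reverse L) v → NΣ-of L v
      NΣ-of-mono outside v (v∈Σ , _ , x , x∈ , e) = mk-NΣ-of outside v∈Σ (∈-reverse⁻ x∈) e
    minimal-nonlocal-case seg sub (inj₂ N⁻⊆B) (inj₂ N⁺⊆B) nonlocal =
      ⊥-elim (nonlocal (inj₂ λ v v∈N → [ N⁻⊆B v , N⁺⊆B v ]′ (Cases.NΣ-of-split seg sub v v∈N)))

    CornerVertex : Fin 3 → V → Set
    CornerVertex i q = (∀ j → j ≢ i → E q (b j)) × (∃ λ s → s ∈ P i × s ≢ b i × E q s)
      × (∀ s → InΣ G Py s → s ≢ b i → E s q → (∃ λ j → j ≢ i × s ≡ b j) ⊎ s ∈ P i)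

    cornerVertex? : ∀ i q → Dec (CornerVertex i q)
    cornerVertex? i q = all? (λ j → ¬? (j ≟F i) →-dec E? q (b j))
      ×-dec any? (λ s → s ∈? P i ×-dec (¬? (s ≟F b i) ×-dec E? q s))
      ×-dec all? (λ s → InΣ? s →-dec (¬? (s ≟F b i) →-dec (E? s q →-dec (any? (λ j → ¬? (j ≟F i) ×-dec (s ≟F b j)) ⊎-dec s ∈? P i))))

    cornerVertex⇒cornerPath : ∀ i q → Outside q → CornerVertex i q → CornerPathFor G Py i [ q ]
    cornerVertex⇒cornerPath i q q∉Σ (adj-bases , adj-path , only) =
      induced⇒isPath q [] induced-[ _ ] , (λ { r (here refl) → q∉Σ }) , q , q , (refl , refl) , adj-bases , adj-path , only′
      where
      only′ : ∀ s r → InΣ G Py s → s ≢ b i → r ∈ [ q ] → E s r → (r ≡ q × ∃ λ j → j ≢ i × s ≡ b j) ⊎ (r ≡ q × s ∈ path i)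
      only′ s r s∈Σ s≢b (here refl) e = ⊎-map (refl ,_) (refl ,_) (only s s∈Σ s≢b e)

    cornerPath⇒cornerVertex : ∀ i q → CornerPathFor G Py i [ q ] → CornerVertex i q
    cornerPath⇒cornerVertex i q (_ , _ , _ , _ , (refl , refl) , adj-bases , adj-path , only) = adj-bases , adj-path , only′
      where
      only′ : ∀ s → InΣ G Py s → s ≢ b i → E s q → (∃ λ j → j ≢ i × s ≡ b j) ⊎ s ∈ P i
      only′ s s∈Σ s≢b e = ⊎-map proj₂ proj₂ (only s q s∈Σ s≢b (here refl) e)

    single-vertex-case : ∀ q → q ∈ PP → Outside q → ¬ LocalNbhd [ q ] → Conclusion PP
    single-vertex-case q q∈ q∉Σ nonlocal with any? (λ i → cornerVertex? i q)
    ... | yes (i , corner) = by-corner i [ q ] (inj₁ (subst (Infix _≡_ [ q ]) (sym pre++q∷post) (infix-++ pre [ q ] post)))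
                                      (cornerVertex⇒cornerPath i q q∉Σ corner)
      where
      pre = proj₁ (∈-∃++ q∈)
      post = proj₁ (proj₂ (∈-∃++ q∈))
      pre++q∷post = proj₂ (proj₂ (∈-∃++ q∈))
    ... | no ¬corner = inj₂ (inj₁ (q , q∈ , q∉Σ , (λ (i , corner) → ¬corner (i , cornerPath⇒cornerVertex i q corner)) , λ local → nonlocal (local-mono single local)))
      where single : ∀ v → NΣ-of [ q ] v → NΣ G Py (_≡ q) v
            single v (v∈Σ , v∉ , x , here refl , e) = v∈Σ , (λ v≡q → v∉ (here v≡q)) , q , refl , e

theorem4p2 : (G : Graph) → InC G → (Py : Pyramid G)
    → (∀ v → Graph.E G (Pyramid.apex Py) v → InΣ G Py v)
    → (P : List (Vtx G)) → IsPath G P → (∀ v → v ∈ P → ¬ InΣ G Py v)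
    → Local G Py (NΣ G Py (_∈ P))
    ⊎ (∃[ v ] (v ∈ P × Major G Py v))
    ⊎ (∃[ R ] (Subpath G R P × CornerPath G Py R))
    ⊎ Outcome4 G Py P
    ⊎ Outcome5 G Py P
theorem4p2 G G∈C Py apex-closed P isPath outside = case localNbhd? P of λ where
    (yes local) → inj₁ local
    (no nonlocal) → case minimal-nonlocal P isPath outside nonlocal of λ where
      (vertex q q∈ nonlocal-q) → single-vertex-case q q∈ (outside q q∈) nonlocal-q
      (segment seg sub local⁻ local⁺ nonlocal-Q) → minimal-nonlocal-case seg sub local⁻ local⁺ nonlocal-Q
  where
  open Attachments G Py G∈C apex-closed hiding (P)
  open Conclude P
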